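{- Let $n\geq 3$. The group $U'(n)$ is cyclic if and only if either $n=2^ip^k$ with $p$ a prime, $k\geq 1$ and $i\in\{0,1,2\}$, or $n=2^jq^kr^t$ with $q,r$ odd primes, $k,t\geq 1$, $j\in\{0,1\}$ and $\gcd\big(q^{k-1}(q-1),\,r^{t-1}(r-1)\big)=2$.
   Context: $U(n)$ denotes the multiplicative group of units of $\mathbb{Z}/n\mathbb{Z}$. For $k\in U(n)$, $[k]=\{x\in\mathbb{Z}\mid x\equiv \pm k\pmod n\}$, and $U'(n)=\{[k]\mid k\in U(n)\}$ is the group with operation $[a]\cdot[b]=[ab]$. -}

module Defs where

open import Data.Nat using (ℕ; _<_; _^_; _*_; _≤_; _∸_)
open import Data.Nat.Coprimality using (Coprime)
open import Data.Nat.Primality using (Prime)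
open import Data.Nat.GCD using (gcd)
open import Data.Integer as ℤ using (ℤ; +_)
open import Data.Integer.Divisibility using () renaming (_∣_ to _∣ℤ_)
open import Data.Product using (Σ; ∃; _×_)
open import Data.Sum using (_⊎_)
open import Relation.Binary.PropositionalEquality using (_≡_)
open import Relation.Nullary using (¬_)

-- U(n): represented by the canonical residues k with 0 ≤ k < n and gcd(k,n)=1.
InU : ℕ → ℕ → Set
InU n k = k < n × Coprime k n

-- x ∈ [k] in Z/nZ, i.e. x ≡ ± k (mod n).
_≡±_[mod_] : ℕ → ℕ → ℕ → Set
x ≡± k [mod n ] = ((+ n) ∣ℤ ((+ x) ℤ.- (+ k))) ⊎ ((+ n) ∣ℤ ((+ x) ℤ.+ (+ k)))

-- U'(n) = {[k] | k ∈ U(n)} with [a][b] = [ab] is cyclic: some class [g]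
-- generates it, i.e. every class [k] is a power [g]^m = [g^m].
U'-cyclic : ℕ → Set
U'-cyclic n = Σ ℕ λ g → InU n g × (∀ k → InU n k → ∃ λ m → (g ^ m) ≡± k [mod n ])

Form1 : ℕ → Set
Form1 n = ∃ λ i → ∃ λ p → ∃ λ k →
  Prime p × 1 ≤ k × i ≤ 2 × n ≡ 2 ^ i * p ^ k

Form2 : ℕ → Set
Form2 n = ∃ λ j → ∃ λ q → ∃ λ k → ∃ λ r → ∃ λ t →
  Prime q × ¬ (q ≡ 2) × Prime r × ¬ (r ≡ 2) × 1 ≤ k × 1 ≤ t × j ≤ 1 ×
  n ≡ 2 ^ j * q ^ k * r ^ t ×
  gcd (q ^ (k ∸ 1) * (q ∸ 1)) (r ^ (t ∸ 1) * (r ∸ 1)) ≡ 2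

-- U'(n) is U(n)/{±1}.  For the listed n a generator is assembled by the Chinese remainder theorem:
-- 5 generates U(2^k) up to sign, and a primitive root modulo an odd prime power is lifted from one
-- modulo p, which exists by Lagrange's bound on the roots of X^d - 1.  For n = 2^j q^k r^t the condition
-- gcd(φ(q^k), φ(r^t)) = 2 makes, say, φ(q^k)/2 odd and coprime to φ(r^t), so the square of a primitive
-- root modulo q^k and a primitive root modulo r^t combine into a generator up to sign.
-- Conversely a cyclic group has a unique subgroup of each prime order, while for every other n the
-- Chinese remainder theorem yields two independent subgroups of order 2 (from ±1, from 1 + 2^(e+2)
-- modulo 2^(e+3), or from square roots of -1 when 4 divides the gcd) or of an odd prime order ℓ
-- dividing the gcd.

module Submission where

open import Defs
open import Data.Nat using (ℕ; _≤_)
open import Data.Sum using (_⊎_)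
open import Data.Product using (_×_; _,_)

open import Data.Nat as ℕ using (zero; suc; z≤n; s≤s; NonZero)
import Data.Nat.Properties as ℕ
import Data.Nat.Divisibility as ℕ
open import Data.Nat.Combinatorics using (_C_; nCn≡1; nC1≡n; k>n⇒nCk≡0; nCk+nC[k+1]≡[n+1]C[k+1])
open import Data.Nat.Coprimality as Coprime using (Coprime)
open import Data.Nat.GCD using (gcd; gcd-GCD; module Bézout; gcd-greatest; gcd-comm; gcd[m,n]∣m; gcd[m,n]∣n)
open import Data.Nat.Primality using (Prime; prime[2]; ¬prime[1]; euclidsLemma; prime⇒nonZero; prime⇒nonTrivial; prime⇒irreducible)
open import Data.Integer as ℤ using (ℤ; +_; _+_; _*_; -_; _-_; _^_; ∣_∣)
import Data.Integer.Properties as ℤ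
import Data.Integer.DivMod as ℤ
open import Data.Integer.Divisibility.Signed
open import Data.Integer.Tactic.RingSolver using (solve-∀)
import Data.Nat.Tactic.RingSolver as ℕ-Solver
open import Data.Sum using (inj₁; inj₂)
open import Data.List using (List; []; _∷_; length; replicate; applyDownFrom)
import Data.List.Properties as List
open import Data.List.Relation.Unary.All as All using (All; []; _∷_)
open import Data.List.Relation.Unary.AllPairs using (AllPairs; []; _∷_)
import Data.List.Relation.Unary.All.Properties as All
import Data.List.Relation.Unary.AllPairs.Properties as AllPairs
open import Data.Product using (∃; proj₁; proj₂)
open import Data.Empty using (⊥; ⊥-elim)
open import Data.Fin using (toℕ; fromℕ<)
import Data.Fin.Properties as Fin
open import Function using (_∘_)
open import Data.Nat.Primality.Factorisation using (factorise)
import Data.Nat.ListAction as ℕ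
open import Data.Nat.Induction using (<-wellFounded)
open import Induction.WellFounded using (Acc; acc)
open import Relation.Binary.PropositionalEquality
open import Relation.Binary.Bundles using (Setoid)
import Relation.Binary.Reasoning.Setoid as SetoidReasoning
open import Relation.Nullary using (¬_; Dec; yes; no; ¬?)
open import Relation.Nullary.Decidable using (decidable-stable)

-- Congruences modulo n

infix 4 _≈_[mod_] _≈±_[mod_]

-- A record rather than a synonym, so that a, b and n can be inferred.
record _≈_[mod_] (a b : ℤ) (n : ℕ) : Set where
  constructor congruent
  field ∣-difference : + n ∣ a - b
open _≈_[mod_] public

_≈±_[mod_] : ℤ → ℤ → ℕ → Set
a ≈± b [mod n ] = a ≈ b [mod n ] ⊎ a ≈ - b [mod n ]

module _ {n : ℕ} where

  ≈-reflexive : ∀ {a b} → a ≡ b → a ≈ b [mod n ]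
  ≈-reflexive {a} refl = congruent (divides (+ 0) (trans (ℤ.+-inverseʳ a) (sym (ℤ.*-zeroˡ (+ n)))))

  ≈-refl : ∀ {a} → a ≈ a [mod n ]
  ≈-refl = ≈-reflexive refl

  ≈-sym : ∀ {a b} → a ≈ b [mod n ] → b ≈ a [mod n ]
  ≈-sym {a} {b} (congruent d) = congruent (subst (+ n ∣_) (lemma a b) (∣m⇒∣-m d))
    where
    lemma : ∀ a b → - (a - b) ≡ b - a
    lemma = solve-∀

  ≈-trans : ∀ {a b c} → a ≈ b [mod n ] → b ≈ c [mod n ] → a ≈ c [mod n ]
  ≈-trans {a} {b} {c} (congruent d) (congruent e) = congruent (subst (+ n ∣_) (lemma a b c) (∣m∣n⇒∣m+n d e))
    where
    lemma : ∀ a b c → (a - b) + (b - c) ≡ a - c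
    lemma = solve-∀

  +-cong : ∀ {a b c d} → a ≈ b [mod n ] → c ≈ d [mod n ] → a + c ≈ b + d [mod n ]
  +-cong {a} {b} {c} {d} (congruent x) (congruent y) = congruent (subst (+ n ∣_) (lemma a b c d) (∣m∣n⇒∣m+n x y))
    where
    lemma : ∀ a b c d → (a - b) + (c - d) ≡ (a + c) - (b + d)
    lemma = solve-∀

  -‿cong : ∀ {a b} → a ≈ b [mod n ] → - a ≈ - b [mod n ]
  -‿cong {a} {b} (congruent x) = congruent (subst (+ n ∣_) (lemma a b) (∣m⇒∣-m x))
    where
    lemma : ∀ a b → - (a - b) ≡ - a - - b
    lemma = solve-∀

  *-cong : ∀ {a b c d} → a ≈ b [mod n ] → c ≈ d [mod n ] → a * c ≈ b * d [mod n ]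
  *-cong {a} {b} {c} {d} (congruent x) (congruent y) =
    congruent (subst (+ n ∣_) (lemma a b c d) (∣m∣n⇒∣m+n (∣n⇒∣m*n a y) (∣m⇒∣m*n d x)))
    where
    lemma : ∀ a b c d → a * (c - d) + (a - b) * d ≡ a * c - b * d
    lemma = solve-∀

  *-congˡ : ∀ {a b} c → a ≈ b [mod n ] → c * a ≈ c * b [mod n ]
  *-congˡ c = *-cong (≈-refl {c})

  *-congʳ : ∀ {a b} c → a ≈ b [mod n ] → a * c ≈ b * c [mod n ]
  *-congʳ c x = *-cong x (≈-refl {c})

  ^-cong : ∀ {a b} k → a ≈ b [mod n ] → a ^ k ≈ b ^ k [mod n ]
  ^-cong zero x = ≈-refl
  ^-cong (suc k) x = *-cong x (^-cong k x)

≈-setoid : ℕ → Setoid _ _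
≈-setoid n = record
  { Carrier = ℤ
  ; _≈_ = _≈_[mod n ]
  ; isEquivalence = record { refl = ≈-refl ; sym = ≈-sym ; trans = ≈-trans }
  }

module ≈-Reasoning (n : ℕ) = SetoidReasoning (≈-setoid n)

∣⇒≈0 : ∀ {n a} → + n ∣ a → a ≈ + 0 [mod n ]
∣⇒≈0 {a = a} d = congruent (subst (_ ∣_) (sym (ℤ.+-identityʳ a)) d)

≈0⇒∣ : ∀ {n a} → a ≈ + 0 [mod n ] → + n ∣ a
≈0⇒∣ {a = a} (congruent d) = subst (_ ∣_) (ℤ.+-identityʳ a) d

≈⇒-≈0 : ∀ {n a b} → a ≈ b [mod n ] → a - b ≈ + 0 [mod n ]
≈⇒-≈0 (congruent d) = ∣⇒≈0 d

-≈0⇒≈ : ∀ {n a b} → a - b ≈ + 0 [mod n ] → a ≈ b [mod n ]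
-≈0⇒≈ x = congruent (≈0⇒∣ x)

+≈0-cancelʳ : ∀ {n a c} → a + c ≈ + 0 [mod n ] → c ≈ + 0 [mod n ] → a ≈ + 0 [mod n ]
+≈0-cancelʳ {a = a} {c} (congruent x) (congruent y) = congruent (subst (_ ∣_) (lemma a c) (∣m∣n⇒∣m-n x y))
  where
  lemma : ∀ a c → a + c - + 0 - (c - + 0) ≡ a - + 0
  lemma = solve-∀

+-cancelˡ-≈ : ∀ {n a b c d} → a ≈ b [mod n ] → a + c ≈ b + d [mod n ] → c ≈ d [mod n ]
+-cancelˡ-≈ {a = a} {b} {c} {d} (congruent x) (congruent y) = congruent (subst (_ ∣_) (lemma a b c d) (∣m∣n⇒∣m-n y x))
  where
  lemma : ∀ a b c d → a + c - (b + d) - (a - b) ≡ c - d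
  lemma = solve-∀

≈-mod-∣ : ∀ {m n a b} → m ℕ.∣ n → a ≈ b [mod n ] → a ≈ b [mod m ]
≈-mod-∣ {m} (ℕ.divides q refl) (congruent d) = congruent (∣-trans (divides (+ q) (ℤ.pos-* q m)) d)

≈-mod-1 : ∀ a b → a ≈ b [mod 1 ]
≈-mod-1 a b = congruent (divides (a - b) (sym (ℤ.*-identityʳ (a - b))))

≈-dec : ∀ n a b → Dec (a ≈ b [mod n ])
≈-dec n a b with n ℕ.∣? ∣ a - b ∣
... | yes d = yes (congruent (∣ᵤ⇒∣ d))
... | no ∤ = no λ (congruent d) → ∤ (∣⇒∣ᵤ d)

∣∧∣⇒*∣ : ∀ {m n x} → Coprime m n → m ℕ.∣ x → n ℕ.∣ x → m ℕ.* n ℕ.∣ x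
∣∧∣⇒*∣ {m} {n} c (ℕ.divides u refl) n∣um
  with ℕ.divides v refl ← Coprime.coprime-divisor (Coprime.sym c) (subst (n ℕ.∣_) (ℕ.*-comm u m) n∣um) =
  ℕ.divides v (trans (ℕ.*-assoc v n m) (cong (v ℕ.*_) (ℕ.*-comm n m)))

≈-combine : ∀ {m n a b} → Coprime m n → a ≈ b [mod m ] → a ≈ b [mod n ] → a ≈ b [mod m ℕ.* n ]
≈-combine c (congruent x) (congruent y) = congruent (∣ᵤ⇒∣ (∣∧∣⇒*∣ c (∣⇒∣ᵤ x) (∣⇒∣ᵤ y)))

≈⇒∣∸ : ∀ {d m m′} → m′ ℕ.≤ m → + m ≈ + m′ [mod d ] → d ℕ.∣ m ℕ.∸ m′
≈⇒∣∸ {m = m} {m′} m′≤m (congruent d∣m-m′) =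
  subst (_ ℕ.∣_) (trans (cong ∣_∣ (ℤ.[+m]-[+n]≡m⊖n m m′)) (trans (ℤ.∣m⊖n∣≡∣n⊖m∣ m m′) (ℤ.∣⊖∣-≤ m′≤m))) (∣⇒∣ᵤ d∣m-m′)

<-incongruent : ∀ {p i j} → j ℕ.< i → i ℕ.< p → ¬ (+ i ≈ + j [mod p ])
<-incongruent {p} {i} {j} j<i i<p i≈j =
  ℕ.>⇒∤ {{ℕ.>-nonZero (ℕ.m<n⇒0<n∸m j<i)}} (ℕ.≤-<-trans (ℕ.m∸n≤m i j) i<p) (≈⇒∣∸ (ℕ.<⇒≤ j<i) i≈j)

a≈a%ℕn : ∀ n .{{_ : NonZero n}} a → a ≈ + (a ℤ.%ℕ n) [mod n ]
a≈a%ℕn n a = congruent (divides (a ℤ./ℕ n) (trans (cong (_- + (a ℤ.%ℕ n)) (ℤ.a≡a%ℕn+[a/ℕn]*n a n)) (lemma (+ (a ℤ.%ℕ n)) _)))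
  where
  lemma : ∀ r q → r + q - r ≡ q
  lemma = solve-∀

module _ {n : ℕ} where

  ≈±-refl : ∀ {a} → a ≈± a [mod n ]
  ≈±-refl = inj₁ ≈-refl

  ≈±-sym : ∀ {a b} → a ≈± b [mod n ] → b ≈± a [mod n ]
  ≈±-sym (inj₁ x) = inj₁ (≈-sym x)
  ≈±-sym {b = b} (inj₂ x) = inj₂ (≈-trans (≈-reflexive (sym (ℤ.neg-involutive b))) (-‿cong (≈-sym x)))

  ≈±-trans : ∀ {a b c} → a ≈± b [mod n ] → b ≈± c [mod n ] → a ≈± c [mod n ]
  ≈±-trans (inj₁ x) (inj₁ y) = inj₁ (≈-trans x y)
  ≈±-trans (inj₁ x) (inj₂ y) = inj₂ (≈-trans x y)
  ≈±-trans (inj₂ x) (inj₁ y) = inj₂ (≈-trans x (-‿cong y))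
  ≈±-trans {c = c} (inj₂ x) (inj₂ y) = inj₁ (≈-trans x (≈-trans (-‿cong y) (≈-reflexive (ℤ.neg-involutive c))))

  ≈±-*-cong : ∀ {a b c d} → a ≈± b [mod n ] → c ≈± d [mod n ] → a * c ≈± b * d [mod n ]
  ≈±-*-cong (inj₁ x) (inj₁ y) = inj₁ (*-cong x y)
  ≈±-*-cong {b = b} {d = d} (inj₁ x) (inj₂ y) = inj₂ (≈-trans (*-cong x y) (≈-reflexive (sym (ℤ.neg-distribʳ-* b d))))
  ≈±-*-cong {b = b} {d = d} (inj₂ x) (inj₁ y) = inj₂ (≈-trans (*-cong x y) (≈-reflexive (sym (ℤ.neg-distribˡ-* b d))))
  ≈±-*-cong {b = b} {d = d} (inj₂ x) (inj₂ y) = inj₁ (≈-trans (*-cong x y) (≈-reflexive (lemma b d)))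
    where
    lemma : ∀ b d → - b * - d ≡ b * d
    lemma = solve-∀

  ≈±-^-cong : ∀ {a b} k → a ≈± b [mod n ] → a ^ k ≈± b ^ k [mod n ]
  ≈±-^-cong zero x = ≈±-refl
  ≈±-^-cong (suc k) x = ≈±-*-cong x (≈±-^-cong k x)

≈±-mod-∣ : ∀ {m n a b} → m ℕ.∣ n → a ≈± b [mod n ] → a ≈± b [mod m ]
≈±-mod-∣ d (inj₁ x) = inj₁ (≈-mod-∣ d x)
≈±-mod-∣ d (inj₂ x) = inj₂ (≈-mod-∣ d x)

≈±-dec : ∀ n a b → Dec (a ≈± b [mod n ])
≈±-dec n a b with ≈-dec n a b | ≈-dec n a (- b)
... | yes x | _ = yes (inj₁ x)
... | no _ | yes y = yes (inj₂ y)
... | no x | no y = no λ { (inj₁ u) → x u ; (inj₂ u) → y u }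

pos-^ : ∀ a k → + (a ℕ.^ k) ≡ (+ a) ^ k
pos-^ a zero = refl
pos-^ a (suc k) = trans (ℤ.pos-* a (a ℕ.^ k)) (cong ((+ a) *_) (pos-^ a k))

^-distribʳ-* : ∀ a b k → (a * b) ^ k ≡ a ^ k * b ^ k
^-distribʳ-* a b zero = refl
^-distribʳ-* a b (suc k) = trans (cong ((a * b) *_) (^-distribʳ-* a b k)) (lemma a b (a ^ k) (b ^ k))
  where
  lemma : ∀ a b c d → a * b * (c * d) ≡ a * c * (b * d)
  lemma = solve-∀

^-* : ∀ a m k → a ^ (m ℕ.* k) ≡ (a ^ m) ^ k
^-* a m k = sym (ℤ.^-*-assoc a m k)

≈1⇒^≈1 : ∀ {n a} k → a ≈ + 1 [mod n ] → a ^ k ≈ + 1 [mod n ]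
≈1⇒^≈1 k x = ≈-trans (^-cong k x) (≈-reflexive (ℤ.^-zeroˡ k))

prime≥2 : ∀ {p} → Prime p → 2 ℕ.≤ p
prime≥2 {p} pr = ℕ.nonTrivial⇒n>1 p {{prime⇒nonTrivial pr}}

-- Roots of polynomials modulo a prime

search-below : (P : ℕ → Set) → (∀ i → Dec (P i)) → ∀ k → (∃ λ i → i ℕ.< k × P i) ⊎ (∀ i → i ℕ.< k → ¬ P i)
search-below P P? zero = inj₂ λ _ ()
search-below P P? (suc k) with P? k | search-below P P? k
... | yes Pk | _ = inj₁ (k , ℕ.n<1+n k , Pk)
... | no _ | inj₁ (i , i<k , Pi) = inj₁ (i , ℕ.m<n⇒m<1+n i<k , Pi)
... | no ¬Pk | inj₂ none-below = inj₂ λ i i<1+k → below-or-at (ℕ.m≤n⇒m<n∨m≡n (ℕ.≤-pred i<1+k))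
  where
  below-or-at : ∀ {i} → i ℕ.< k ⊎ i ≡ k → ¬ P i
  below-or-at (inj₁ i<k) = none-below _ i<k
  below-or-at (inj₂ refl) = ¬Pk

≈0-*-prime : ∀ {p} → Prime p → ∀ a b → a * b ≈ + 0 [mod p ] → a ≈ + 0 [mod p ] ⊎ b ≈ + 0 [mod p ]
≈0-*-prime {p} pr a b ab with euclidsLemma ∣ a ∣ ∣ b ∣ pr (subst (p ℕ.∣_) (ℤ.abs-* a b) (∣⇒∣ᵤ (≈0⇒∣ ab)))
... | inj₁ x = inj₁ (∣⇒≈0 (∣ᵤ⇒∣ x))
... | inj₂ x = inj₂ (∣⇒≈0 (∣ᵤ⇒∣ x))

1≉0 : ∀ {p} → Prime p → ¬ (+ 1 ≈ + 0 [mod p ])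
1≉0 pr h with ℕ.∣1⇒≡1 (∣⇒∣ᵤ (≈0⇒∣ h))
... | refl = ¬prime[1] pr

-- A coefficient list cs stands for the monic polynomial c₀ + x (c₁ + x (⋯ + x · 1)), of degree length cs.
eval : List ℤ → ℤ → ℤ
eval [] x = + 1
eval (c ∷ cs) x = c + x * eval cs x

divide : ℤ → List ℤ → List ℤ
divide a [] = []
divide a (c ∷ []) = []
divide a (c ∷ d ∷ ds) = eval (d ∷ ds) a ∷ divide a (d ∷ ds)

length-divide : ∀ a c cs → length (divide a (c ∷ cs)) ≡ length cs
length-divide a c [] = refl
length-divide a c (d ∷ ds) = cong suc (length-divide a d ds)

eval-divide : ∀ a c cs x → eval (c ∷ cs) x ≡ (x - a) * eval (divide a (c ∷ cs)) x + eval (c ∷ cs) a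
eval-divide a c [] x = lemma c x a
  where
  lemma : ∀ c x a → c + x * + 1 ≡ (x - a) * + 1 + (c + a * + 1)
  lemma = solve-∀
eval-divide a c (d ∷ ds) x =
  trans (cong (λ z → c + x * z) (eval-divide a d ds x)) (lemma c x a (eval (divide a (d ∷ ds)) x) (eval (d ∷ ds) a))
  where
  lemma : ∀ c x a q r → c + x * ((x - a) * q + r) ≡ (x - a) * (r + x * q) + (c + a * r)
  lemma = solve-∀

Incongruent : ℕ → List ℤ → Set
Incongruent p = AllPairs λ a b → ¬ (a ≈ b [mod p ])

roots≤degree : ∀ {p} → Prime p → ∀ (cs xs : List ℤ) →
  Incongruent p xs → All (λ x → eval cs x ≈ + 0 [mod p ]) xs → length xs ℕ.≤ length cs
roots≤degree pr cs [] _ _ = z≤n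
roots≤degree pr [] (x ∷ xs) _ (root ∷ _) = ⊥-elim (1≉0 pr root)
roots≤degree {p} pr (c ∷ cs) (a ∷ xs) (a≉xs ∷ distinct) (root-a ∷ roots) =
  subst (λ z → length (a ∷ xs) ℕ.≤ suc z) (length-divide a c cs)
    (s≤s (roots≤degree pr (divide a (c ∷ cs)) xs distinct (All.zipWith root-of-quotient (a≉xs , roots))))
  where
  root-of-quotient : ∀ {y} → ¬ (a ≈ y [mod p ]) × eval (c ∷ cs) y ≈ + 0 [mod p ] → eval (divide a (c ∷ cs)) y ≈ + 0 [mod p ]
  root-of-quotient {y} (a≉y , root-y) = root-of-factor (≈0-*-prime pr (y - a) (eval (divide a (c ∷ cs)) y) product≈0)
    where
    product≈0 : (y - a) * eval (divide a (c ∷ cs)) y ≈ + 0 [mod p ]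
    product≈0 = +≈0-cancelʳ (≈-trans (≈-reflexive (sym (eval-divide a c cs y))) root-y) root-a
    root-of-factor : y - a ≈ + 0 [mod p ] ⊎ eval (divide a (c ∷ cs)) y ≈ + 0 [mod p ] → eval (divide a (c ∷ cs)) y ≈ + 0 [mod p ]
    root-of-factor (inj₁ y≈a) = ⊥-elim (a≉y (≈-sym (-≈0⇒≈ y≈a)))
    root-of-factor (inj₂ q≈0) = q≈0

X^suc-1 : ℕ → List ℤ
X^suc-1 m = - + 1 ∷ replicate m (+ 0)

eval-X^suc-1 : ∀ m x → eval (X^suc-1 m) x ≡ x ^ suc m - + 1
eval-X^suc-1 m x = trans (cong (λ z → - + 1 + x * z) (eval-zeros m)) (lemma x (x ^ m))
  where
  eval-zeros : ∀ k → eval (replicate k (+ 0)) x ≡ x ^ k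
  eval-zeros zero = refl
  eval-zeros (suc k) = trans (ℤ.+-identityˡ _) (cong (x *_) (eval-zeros k))
  lemma : ∀ x y → - + 1 + x * y ≡ x * y - + 1
  lemma = solve-∀

roots-of-unity≤ : ∀ {p} → Prime p → ∀ m (xs : List ℤ) →
  Incongruent p xs → All (λ x → x ^ suc m ≈ + 1 [mod p ]) xs → length xs ℕ.≤ suc m
roots-of-unity≤ pr m xs distinct roots =
  subst (λ z → length xs ℕ.≤ suc z) (List.length-replicate m)
    (roots≤degree pr (X^suc-1 m) xs distinct (All.map (λ {x} r → ≈-trans (≈-reflexive (eval-X^suc-1 m x)) (≈⇒-≈0 r)) roots))

p∸1<p : ∀ {p} → Prime p → p ℕ.∸ 1 ℕ.< p
p∸1<p {suc p′} _ = ℕ.n<1+n p′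

-- Lagrange's bound forbids all p - 1 nonzero residues to be roots of X^(suc m) - 1.
non-root : ∀ {p} → Prime p → ∀ m → suc m ℕ.< p ℕ.∸ 1 → ∃ λ x → 1 ℕ.≤ x × x ℕ.< p × ¬ ((+ x) ^ suc m ≈ + 1 [mod p ])
non-root {p} pr m m<p-1 with search-below (λ i → ¬ ((+ suc i) ^ suc m ≈ + 1 [mod p ])) (λ i → ¬? (≈-dec p _ _)) (p ℕ.∸ 1)
... | inj₁ (i , i<p-1 , non-root-i) = suc i , s≤s z≤n , ℕ.<-≤-trans (s≤s i<p-1) (p∸1<p pr) , non-root-i
... | inj₂ no-non-root = ⊥-elim (ℕ.<⇒≱ m<p-1 (subst (ℕ._≤ suc m) (List.length-applyDownFrom _ (p ℕ.∸ 1)) bound))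
  where
  bound : length (applyDownFrom (λ i → + suc i) (p ℕ.∸ 1)) ℕ.≤ suc m
  bound = roots-of-unity≤ pr m _
    (AllPairs.applyDownFrom⁺₁ _ (p ℕ.∸ 1) (λ j<i i<p-1 → <-incongruent (s≤s j<i) (ℕ.<-≤-trans (s≤s i<p-1) (p∸1<p pr))))
    (All.applyDownFrom⁺₁ _ (p ℕ.∸ 1) λ i<p-1 → decidable-stable (≈-dec p _ _) (no-non-root _ i<p-1))

-- Binomial theorem and Fermat's little theorem

[1+k]*[1+n]C[1+k]≡[1+n]*nCk : ∀ n k → suc k ℕ.* (suc n C suc k) ≡ suc n ℕ.* (n C k)
[1+k]*[1+n]C[1+k]≡[1+n]*nCk zero zero = refl
[1+k]*[1+n]C[1+k]≡[1+n]*nCk zero (suc k) =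
  trans (cong (suc (suc k) ℕ.*_) (k>n⇒nCk≡0 {1} {suc (suc k)} (s≤s (s≤s z≤n))))
    (trans (ℕ.*-zeroʳ (suc (suc k))) (sym (cong (1 ℕ.*_) (k>n⇒nCk≡0 {0} {suc k} (s≤s z≤n)))))
[1+k]*[1+n]C[1+k]≡[1+n]*nCk (suc n) zero = trans (ℕ.*-identityˡ _) (trans (nC1≡n (suc (suc n))) (sym (ℕ.*-identityʳ (suc (suc n)))))
[1+k]*[1+n]C[1+k]≡[1+n]*nCk (suc n) (suc k) = begin
  suc (suc k) ℕ.* (suc (suc n) C suc (suc k))
    ≡⟨ cong (suc (suc k) ℕ.*_) (sym (nCk+nC[k+1]≡[n+1]C[k+1] (suc n) (suc k))) ⟩
  suc (suc k) ℕ.* (suc n C suc k ℕ.+ suc n C suc (suc k))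
    ≡⟨ distribute (suc k) (suc n C suc k) (suc n C suc (suc k)) ⟩
  suc n C suc k ℕ.+ suc k ℕ.* (suc n C suc k) ℕ.+ suc (suc k) ℕ.* (suc n C suc (suc k))
    ≡⟨ cong₂ (λ a b → suc n C suc k ℕ.+ a ℕ.+ b) ([1+k]*[1+n]C[1+k]≡[1+n]*nCk n k) ([1+k]*[1+n]C[1+k]≡[1+n]*nCk n (suc k)) ⟩
  suc n C suc k ℕ.+ suc n ℕ.* (n C k) ℕ.+ suc n ℕ.* (n C suc k)
    ≡⟨ cong (λ a → a ℕ.+ suc n ℕ.* (n C k) ℕ.+ suc n ℕ.* (n C suc k)) (sym (nCk+nC[k+1]≡[n+1]C[k+1] n k)) ⟩
  n C k ℕ.+ n C suc k ℕ.+ suc n ℕ.* (n C k) ℕ.+ suc n ℕ.* (n C suc k)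
    ≡⟨ collect n (n C k) (n C suc k) ⟩
  suc (suc n) ℕ.* (n C k ℕ.+ n C suc k)
    ≡⟨ cong (suc (suc n) ℕ.*_) (nCk+nC[k+1]≡[n+1]C[k+1] n k) ⟩
  suc (suc n) ℕ.* (suc n C suc k) ∎
  where
  open ≡-Reasoning
  distribute : ∀ k a b → suc k ℕ.* (a ℕ.+ b) ≡ a ℕ.+ k ℕ.* a ℕ.+ suc k ℕ.* b
  distribute = ℕ-Solver.solve-∀
  collect : ∀ n a b → a ℕ.+ b ℕ.+ suc n ℕ.* a ℕ.+ suc n ℕ.* b ≡ suc (suc n) ℕ.* (a ℕ.+ b)
  collect = ℕ-Solver.solve-∀

p∣pCk : ∀ {p} → Prime p → ∀ k → 0 ℕ.< k → k ℕ.< p → p ℕ.∣ p C k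
p∣pCk {suc p′} pr (suc k) _ k<p
  with euclidsLemma (suc k) (suc p′ C suc k) pr (subst (suc p′ ℕ.∣_) (sym ([1+k]*[1+n]C[1+k]≡[1+n]*nCk p′ k)) (ℕ.m∣m*n (p′ C k)))
... | inj₁ p∣k = ⊥-elim (ℕ.>⇒∤ k<p p∣k)
... | inj₂ p∣C = p∣C

∑ : (ℕ → ℤ) → ℕ → ℤ
∑ f zero = + 0
∑ f (suc m) = ∑ f m + f m

∑-≈-prefix : ∀ {n} f s m → s ℕ.≤ m → (∀ k → s ℕ.≤ k → k ℕ.< m → + n ∣ f k) → ∑ f m ≈ ∑ f s [mod n ]
∑-≈-prefix f s zero z≤n _ = ≈-refl
∑-≈-prefix f s (suc m) s≤1+m tail∣ with ℕ.m≤n⇒m<n∨m≡n s≤1+m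
... | inj₂ refl = ≈-refl
... | inj₁ (s≤s s≤m) = ≈-trans
  (+-cong (∑-≈-prefix f s m s≤m λ k s≤k k<m → tail∣ k s≤k (ℕ.m<n⇒m<1+n k<m)) (∣⇒≈0 (tail∣ m s≤m ℕ.≤-refl)))
  (≈-reflexive (ℤ.+-identityʳ _))

binomial-sum : ℕ → ℤ → ℕ → ℤ
binomial-sum n x = ∑ λ k → + (n C k) * x ^ k

binomial-sum-pascal : ∀ n x m → binomial-sum (suc n) x (suc m) ≡ binomial-sum n x (suc m) + x * binomial-sum n x m
binomial-sum-pascal n x zero = lemma x
  where
  lemma : ∀ x → + 0 + + 1 * + 1 ≡ + 0 + + 1 * + 1 + x * + 0
  lemma = solve-∀
binomial-sum-pascal n x (suc m) = begin
  binomial-sum (suc n) x (suc m) + + (suc n C suc m) * x ^ suc m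
    ≡⟨ cong₂ _+_ (binomial-sum-pascal n x m) (cong (λ c → + c * x ^ suc m) (sym (nCk+nC[k+1]≡[n+1]C[k+1] n m))) ⟩
  binomial-sum n x (suc m) + x * binomial-sum n x m + + (n C m ℕ.+ n C suc m) * (x * x ^ m)
    ≡⟨ cong (λ c → binomial-sum n x (suc m) + x * binomial-sum n x m + c * (x * x ^ m)) (ℤ.pos-+ (n C m) (n C suc m)) ⟩
  binomial-sum n x (suc m) + x * binomial-sum n x m + (+ (n C m) + + (n C suc m)) * (x * x ^ m)
    ≡⟨ lemma (binomial-sum n x m) (+ (n C m) * x ^ m) (+ (n C m)) (+ (n C suc m)) x (x ^ m) ⟩
  binomial-sum n x (suc m) + + (n C suc m) * x ^ suc m + x * (binomial-sum n x m + + (n C m) * x ^ m) ∎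
  where
  open ≡-Reasoning
  lemma : ∀ s t c d x y → s + t + x * s + (c + d) * (x * y) ≡ s + t + d * (x * y) + x * (s + c * y)
  lemma = solve-∀

binomial-theorem : ∀ n x → (+ 1 + x) ^ n ≡ binomial-sum n x (suc n)
binomial-theorem zero x = refl
binomial-theorem (suc n) x = begin
  (+ 1 + x) * (+ 1 + x) ^ n              ≡⟨ cong ((+ 1 + x) *_) (binomial-theorem n x) ⟩
  (+ 1 + x) * binomial-sum n x (suc n)   ≡⟨ lemma (binomial-sum n x (suc n)) x ⟩
  binomial-sum n x (suc n) + + 0 * x ^ suc n + x * binomial-sum n x (suc n)
    ≡⟨ cong (λ c → binomial-sum n x (suc n) + + c * x ^ suc n + x * binomial-sum n x (suc n)) (sym (k>n⇒nCk≡0 (ℕ.n<1+n n))) ⟩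
  binomial-sum n x (suc (suc n)) + x * binomial-sum n x (suc n) ≡⟨ sym (binomial-sum-pascal n x (suc n)) ⟩
  binomial-sum (suc n) x (suc (suc n)) ∎
  where
  open ≡-Reasoning
  lemma : ∀ b x → (+ 1 + x) * b ≡ b + + 0 * x ^ suc n + x * b
  lemma b x = trans (distrib b x) (cong (λ z → b + z + x * b) (sym (ℤ.*-zeroˡ (x ^ suc n))))
    where
    distrib : ∀ b x → (+ 1 + x) * b ≡ b + + 0 + x * b
    distrib = solve-∀

freshman's-dream : ∀ {p} → Prime p → ∀ x → (+ 1 + x) ^ p ≈ + 1 + x ^ p [mod p ]
freshman's-dream {p} pr x = ≈-trans (≈-reflexive (binomial-theorem p x)) (+-cong middle≈0 (≈-reflexive last))
  where
  middle≈0 : binomial-sum p x p ≈ binomial-sum p x 1 [mod p ]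
  middle≈0 = ∑-≈-prefix _ 1 p (ℕ.<⇒≤ (prime≥2 pr))
    λ k 1≤k k<p → ∣m⇒∣m*n (x ^ k) (∣ᵤ⇒∣ {+ p} {+ (p C k)} (p∣pCk pr k 1≤k k<p))
  last : + (p C p) * x ^ p ≡ x ^ p
  last = trans (cong (λ c → + c * x ^ p) (nCn≡1 p)) (ℤ.*-identityˡ _)

fermat-ℕ : ∀ {p} → Prime p → ∀ a → (+ a) ^ p ≈ + a [mod p ]
fermat-ℕ {suc p′} pr zero = ≈-refl
fermat-ℕ {p} pr (suc a) = ≈-trans (≈-reflexive (cong (_^ p) (sym (ℤ.pos-+ 1 a))))
  (≈-trans (freshman's-dream pr (+ a)) (≈-trans (+-cong (≈-refl {a = + 1}) (fermat-ℕ pr a)) (≈-reflexive (sym (ℤ.pos-+ 1 a)))))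

fermat : ∀ {p} → Prime p → ∀ a → a ^ p ≈ a [mod p ]
fermat {p} pr a = ≈-trans (^-cong p a≈r) (≈-trans (fermat-ℕ pr _) (≈-sym a≈r))
  where
  instance
    p≢0 : NonZero p
    p≢0 = prime⇒nonZero pr
  a≈r : a ≈ + (a ℤ.%ℕ p) [mod p ]
  a≈r = a≈a%ℕn p a

fermat-unit : ∀ {p} → Prime p → ∀ a → ¬ (a ≈ + 0 [mod p ]) → a ^ (p ℕ.∸ 1) ≈ + 1 [mod p ]
fermat-unit {suc p′} pr a a≉0 = second-factor (≈0-*-prime pr a (a ^ p′ - + 1) a[a^p′-1]≈0)
  where
  lemma : ∀ a b → a * b - a ≡ a * (b - + 1)
  lemma = solve-∀
  a[a^p′-1]≈0 : a * (a ^ p′ - + 1) ≈ + 0 [mod suc p′ ]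
  a[a^p′-1]≈0 = ≈-trans (≈-reflexive (sym (lemma a (a ^ p′)))) (≈⇒-≈0 (fermat pr a))
  second-factor : a ≈ + 0 [mod suc p′ ] ⊎ a ^ p′ - + 1 ≈ + 0 [mod suc p′ ] → a ^ p′ ≈ + 1 [mod suc p′ ]
  second-factor (inj₁ a≈0) = ⊥-elim (a≉0 a≈0)
  second-factor (inj₂ a^p′-1≈0) = -≈0⇒≈ a^p′-1≈0

-- All higher binomial terms are multiples of y².
binomial-≈-first-order : ∀ {M} x y → + M ∣ y * y → ∀ m → (x + y) ^ suc m ≈ x ^ suc m + + suc m * (x ^ m * y) [mod M ]
binomial-≈-first-order x y M∣y² zero = ≈-reflexive (lemma x y)
  where
  lemma : ∀ x y → (x + y) * + 1 ≡ x * + 1 + + 1 * (+ 1 * y)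
  lemma = solve-∀
binomial-≈-first-order {M} x y M∣y² (suc m) = ≈-trans (*-congˡ (x + y) (binomial-≈-first-order x y M∣y² m))
  (≈-trans (≈-reflexive (expand x y (x ^ m) (+ suc m)))
    (≈-trans (+-cong (≈-refl {a = x * (x * x ^ m) + (+ 1 + + suc m) * (x * x ^ m * y)}) (∣⇒≈0 (∣n⇒∣m*n (+ suc m * x ^ m) M∣y²)))
      (≈-reflexive (trans (ℤ.+-identityʳ _) (cong (λ c → x * (x * x ^ m) + c * (x * x ^ m * y)) (sym (ℤ.pos-+ 1 (suc m))))))))
  where
  expand : ∀ x y X s → (x + y) * (x * X + s * (X * y)) ≡ x * (x * X) + (+ 1 + s) * (x * X * y) + s * X * (y * y)
  expand = solve-∀

1+y^s≈1+sy : ∀ {M} y → + M ∣ y * y → ∀ s → (+ 1 + y) ^ s ≈ + 1 + + s * y [mod M ]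
1+y^s≈1+sy y M∣y² zero = ≈-reflexive (lemma y)
  where
  lemma : ∀ y → + 1 ≡ + 1 + + 0 * y
  lemma = solve-∀
1+y^s≈1+sy y M∣y² (suc m) = ≈-trans (binomial-≈-first-order (+ 1) y M∣y² m)
  (≈-reflexive (cong₂ (λ a b → a + + suc m * b) (ℤ.^-zeroˡ (suc m)) (trans (cong (_* y) (ℤ.^-zeroˡ m)) (ℤ.*-identityˡ y))))

-- For an odd prime p the term C(p,p) y^p = y^p is a multiple of p y² as well, since p ∣ y.
1+y^p≈1+py : ∀ {p M} → Prime p → 3 ℕ.≤ p → ∀ y → + p ∣ y → + M ∣ + p * (y * y) → (+ 1 + y) ^ p ≈ + 1 + + p * y [mod M ]
1+y^p≈1+py {p} {M} pr p≥3 y p∣y@(divides w eqw) M∣py² =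
  ≈-trans (≈-reflexive (binomial-theorem p y)) (≈-trans (∑-≈-prefix _ 2 (suc p) (ℕ.m≤n⇒m≤1+n (ℕ.<⇒≤ p≥3)) high-terms) (≈-reflexive first-two))
  where
  first-two : binomial-sum p y 2 ≡ + 1 + + p * y
  first-two = trans (lemma (+ (p C 1)) y) (cong (λ c → + 1 + + c * y) (nC1≡n p))
    where
    lemma : ∀ c y → + 0 + + 1 * + 1 + c * (y * + 1) ≡ + 1 + c * y
    lemma = solve-∀
  middle : ∀ k → 2 ℕ.≤ k → k ℕ.< p → + p * (y * y) ∣ + (p C k) * y ^ k
  middle (suc zero) (s≤s ()) _
  middle (suc (suc r)) _ k<p with ℕ.divides c eq ← p∣pCk pr (suc (suc r)) (s≤s z≤n) k<p =
    divides (+ c * y ^ r) (trans (cong (λ n → + n * y ^ suc (suc r)) eq) (trans (cong (_* y ^ suc (suc r)) (ℤ.pos-* c p)) (lemma (+ c) (+ p) y (y ^ r))))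
    where
    lemma : ∀ c p y Y → c * p * (y * (y * Y)) ≡ c * Y * (p * (y * y))
    lemma = solve-∀
  top : ∀ r → p ≡ 3 ℕ.+ r → + p * (y * y) ∣ + (p C p) * y ^ p
  top r refl = divides (w * y ^ r) (begin
    + (p C p) * (y * (y * (y * y ^ r))) ≡⟨ cong (λ c → + c * (y * (y * (y * y ^ r)))) (nCn≡1 p) ⟩
    + 1 * (y * (y * (y * y ^ r)))        ≡⟨ cong (λ z → + 1 * (y * (y * (z * y ^ r)))) eqw ⟩
    + 1 * (y * (y * ((w * + p) * y ^ r))) ≡⟨ lemma y w (+ p) (y ^ r) ⟩
    w * y ^ r * (+ p * (y * y)) ∎)
    where
    open ≡-Reasoning
    lemma : ∀ y w p Y → + 1 * (y * (y * ((w * p) * Y))) ≡ w * Y * (p * (y * y))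
    lemma = solve-∀
  high-terms : ∀ k → 2 ℕ.≤ k → k ℕ.< suc p → + M ∣ + (p C k) * y ^ k
  high-terms k 2≤k (s≤s k≤p) with ℕ.m≤n⇒m<n∨m≡n k≤p
  ... | inj₁ k<p = ∣-trans M∣py² (middle k 2≤k k<p)
  ... | inj₂ refl = ∣-trans M∣py² (top (p ℕ.∸ 3) (sym (ℕ.m+[n∸m]≡n p≥3)))

-- Orders

coprime-*ˡ : ∀ {a b j} → Coprime a j → Coprime b j → Coprime (a ℕ.* b) j
coprime-*ˡ {a} {b} {j} ca cb {i} (i∣ab , i∣j) = cb (Coprime.coprime-divisor cia i∣ab , i∣j)
  where
  cia : Coprime i a
  cia (k∣i , k∣a) = ca (k∣a , ℕ.∣-trans k∣i i∣j)

coprime-*ʳ : ∀ {j a b} → Coprime j a → Coprime j b → Coprime j (a ℕ.* b)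
coprime-*ʳ c1 c2 = Coprime.sym (coprime-*ˡ (Coprime.sym c1) (Coprime.sym c2))

coprime-^ˡ : ∀ {a j} → Coprime a j → ∀ k → Coprime (a ℕ.^ k) j
coprime-^ˡ ca zero (i∣1 , _) = ℕ.∣1⇒≡1 i∣1
coprime-^ˡ ca (suc k) = coprime-*ˡ ca (coprime-^ˡ ca k)

coprime-∣ʳ : ∀ {a j i} → Coprime a j → i ℕ.∣ j → Coprime a i
coprime-∣ʳ ca i∣j (x , y) = ca (x , ℕ.∣-trans y i∣j)

prime∤⇒coprime : ∀ {ℓ j} → Prime ℓ → ¬ (ℓ ℕ.∣ j) → Coprime ℓ j
prime∤⇒coprime pr ℓ∤j (i∣ℓ , i∣j) with prime⇒irreducible pr i∣ℓ
... | inj₁ i≡1 = i≡1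
... | inj₂ refl = ⊥-elim (ℓ∤j i∣j)

infix 4 _HasOrder_[mod_]

record _HasOrder_[mod_] (g : ℤ) (d n : ℕ) : Set where
  constructor has-order
  field
    ^order≈1 : g ^ d ≈ + 1 [mod n ]
    order∣ : ∀ j → g ^ j ≈ + 1 [mod n ] → d ℕ.∣ j
open _HasOrder_[mod_] public

^-multiple≈1 : ∀ {n} g d {j} → g ^ d ≈ + 1 [mod n ] → d ℕ.∣ j → g ^ j ≈ + 1 [mod n ]
^-multiple≈1 g d g^d≈1 (ℕ.divides q refl) =
  ≈-trans (≈-reflexive (trans (cong (g ^_) (ℕ.*-comm q d)) (^-* g d q))) (≈1⇒^≈1 q g^d≈1)

HasOrder-cong : ∀ {n a b d} → a ≈ b [mod n ] → a HasOrder d [mod n ] → b HasOrder d [mod n ]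
HasOrder-cong {d = d} a≈b ord-a =
  has-order (≈-trans (≈-sym (^-cong d a≈b)) (^order≈1 ord-a)) λ j b^j≈1 → order∣ ord-a j (≈-trans (^-cong j a≈b) b^j≈1)

^-+≈1-cancel : ∀ {n g} d e → g ^ (d ℕ.+ e) ≈ + 1 [mod n ] → g ^ e ≈ + 1 [mod n ] → g ^ d ≈ + 1 [mod n ]
^-+≈1-cancel {g = g} d e g^d+e≈1 g^e≈1 = ≈-trans (≈-reflexive (sym (ℤ.*-identityʳ (g ^ d))))
  (≈-trans (*-congˡ (g ^ d) (≈-sym g^e≈1)) (≈-trans (≈-reflexive (sym (ℤ.^-distribˡ-+-* g d e))) g^d+e≈1))

^-gcd≈1 : ∀ {n g} i j → g ^ i ≈ + 1 [mod n ] → g ^ j ≈ + 1 [mod n ] → g ^ gcd i j ≈ + 1 [mod n ]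
^-gcd≈1 {n} {g} i j g^i≈1 g^j≈1 with Bézout.identity (gcd-GCD i j)
... | Bézout.+- x y eq = ^-+≈1-cancel (gcd i j) (y ℕ.* j)
  (subst (λ e → g ^ e ≈ + 1 [mod n ]) (sym eq) (^-multiple≈1 g i g^i≈1 (ℕ.n∣m*n x))) (^-multiple≈1 g j g^j≈1 (ℕ.n∣m*n y))
... | Bézout.-+ x y eq = ^-+≈1-cancel (gcd i j) (x ℕ.* i)
  (subst (λ e → g ^ e ≈ + 1 [mod n ]) (sym eq) (^-multiple≈1 g j g^j≈1 (ℕ.n∣m*n y))) (^-multiple≈1 g i g^i≈1 (ℕ.n∣m*n x))

has-prime-power-order : ∀ {n ℓ} → Prime ℓ → ∀ a g → g ^ (ℓ ℕ.^ suc a) ≈ + 1 [mod n ] → ¬ (g ^ (ℓ ℕ.^ a) ≈ + 1 [mod n ]) →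
  g HasOrder ℓ ℕ.^ suc a [mod n ]
has-prime-power-order {n} {ℓ} pr a g g^ℓ^[1+a]≈1 g^ℓ^a≉1 = has-order g^ℓ^[1+a]≈1 (divides-exponents a g g^ℓ^[1+a]≈1 g^ℓ^a≉1)
  where
  divides-exponents : ∀ a g → g ^ (ℓ ℕ.^ suc a) ≈ + 1 [mod n ] → ¬ (g ^ (ℓ ℕ.^ a) ≈ + 1 [mod n ]) →
    ∀ j → g ^ j ≈ + 1 [mod n ] → ℓ ℕ.^ suc a ℕ.∣ j
  divides-exponents a g g^ℓ^[1+a]≈1 g^ℓ^a≉1 j g^j≈1 with ℓ ℕ.∣? j
  ... | no ℓ∤j = ⊥-elim (g^ℓ^a≉1 (≈1⇒^≈1 (ℓ ℕ.^ a) g≈1))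
    where
    gcd≡1 : gcd (ℓ ℕ.^ suc a) j ≡ 1
    gcd≡1 = Coprime.coprime⇒gcd≡1 (coprime-^ˡ (prime∤⇒coprime pr ℓ∤j) (suc a))
    g≈1 : g ≈ + 1 [mod n ]
    g≈1 = ≈-trans (≈-reflexive (sym (ℤ.*-identityʳ g))) (subst (λ e → g ^ e ≈ + 1 [mod n ]) gcd≡1 (^-gcd≈1 (ℓ ℕ.^ suc a) j g^ℓ^[1+a]≈1 g^j≈1))
  divides-exponents zero g _ _ j _ | yes ℓ∣j = subst (ℕ._∣ j) (sym (ℕ.*-identityʳ ℓ)) ℓ∣j
  divides-exponents (suc a) g g^ℓ^[1+a]≈1 g^ℓ^a≉1 j g^j≈1 | yes (ℕ.divides j′ refl) =
    subst (λ e → ℓ ℕ.* ℓ ℕ.^ suc a ℕ.∣ e) (ℕ.*-comm ℓ j′) (ℕ.*-monoʳ-∣ ℓ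
      (divides-exponents a (g ^ ℓ) (≈-trans (≈-reflexive (sym (^-* g ℓ (ℓ ℕ.^ suc a)))) g^ℓ^[1+a]≈1)
        (λ x → g^ℓ^a≉1 (≈-trans (≈-reflexive (^-* g ℓ (ℓ ℕ.^ a))) x)) j′
        (≈-trans (≈-reflexive (sym (^-* g ℓ j′))) (subst (λ e → g ^ e ≈ + 1 [mod n ]) (ℕ.*-comm j′ ℓ) g^j≈1))))

*-has-order : ∀ {n g h d e} → g HasOrder d [mod n ] → h HasOrder e [mod n ] → Coprime d e → g * h HasOrder d ℕ.* e [mod n ]
*-has-order {n} {g} {h} {d} {e} ord-g ord-h d⊥e = has-order [gh]^de≈1 d*e∣
  where
  [gh]^de≈1 : (g * h) ^ (d ℕ.* e) ≈ + 1 [mod n ]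
  [gh]^de≈1 = ≈-trans (≈-reflexive (^-distribʳ-* g h (d ℕ.* e)))
    (*-cong (^-multiple≈1 g d (^order≈1 ord-g) (ℕ.m∣m*n e)) (^-multiple≈1 h e (^order≈1 ord-h) (ℕ.n∣m*n d)))
  d*e∣ : ∀ j → (g * h) ^ j ≈ + 1 [mod n ] → d ℕ.* e ℕ.∣ j
  d*e∣ j [gh]^j≈1 = ∣∧∣⇒*∣ d⊥e (Coprime.coprime-divisor d⊥e (subst (d ℕ.∣_) (ℕ.*-comm j e) (order∣ ord-g _ g^je≈1)))
    (Coprime.coprime-divisor (Coprime.sym d⊥e) (subst (e ℕ.∣_) (ℕ.*-comm j d) (order∣ ord-h _ h^jd≈1)))
    where
    kill : ∀ {u v} k → u ^ k ≈ + 1 [mod n ] → (u * v) ^ k ≈ + 1 [mod n ] → v ^ k ≈ + 1 [mod n ]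
    kill {u} {v} k u^k≈1 [uv]^k≈1 = ≈-trans (≈-reflexive (sym (ℤ.*-identityˡ _)))
      (≈-trans (*-congʳ (v ^ k) (≈-sym u^k≈1)) (≈-trans (≈-reflexive (sym (^-distribʳ-* u v k))) [uv]^k≈1))
    h^jd≈1 : h ^ (j ℕ.* d) ≈ + 1 [mod n ]
    h^jd≈1 = kill (j ℕ.* d) (^-multiple≈1 g d (^order≈1 ord-g) (ℕ.n∣m*n j)) (^-multiple≈1 (g * h) j [gh]^j≈1 (ℕ.m∣m*n d))
    g^je≈1 : g ^ (j ℕ.* e) ≈ + 1 [mod n ]
    g^je≈1 = kill (j ℕ.* e) (^-multiple≈1 h e (^order≈1 ord-h) (ℕ.n∣m*n j))
      (≈-trans (≈-reflexive (cong (_^ (j ℕ.* e)) (ℤ.*-comm h g))) (^-multiple≈1 (g * h) j [gh]^j≈1 (ℕ.m∣m*n e)))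

-- Primitive roots modulo a prime

prime-factor : ∀ n → 2 ℕ.≤ n → ∃ λ ℓ → Prime ℓ × ℓ ℕ.∣ n
prime-factor n 2≤n with factorise n {{ℕ.>-nonZero (ℕ.<-trans (s≤s z≤n) 2≤n)}}
... | record { factors = [] ; isFactorisation = n≡1 } = ⊥-elim (ℕ.<⇒≢ 2≤n (sym n≡1))
... | record { factors = ℓ ∷ ℓs ; isFactorisation = n≡ℓ*ℓs ; factorsPrime = prime-ℓ ∷ _ } =
  ℓ , prime-ℓ , ℕ.divides (ℕ.product ℓs) (trans n≡ℓ*ℓs (ℕ.*-comm ℓ _))

*-positive⇒positive : ∀ {m ℓ c} → 0 ℕ.< m → m ≡ c ℕ.* ℓ → 0 ℕ.< c
*-positive⇒positive {c = zero} 0<m m≡0 = ⊥-elim (ℕ.<⇒≢ 0<m (sym m≡0))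
*-positive⇒positive {c = suc _} _ _ = s≤s z≤n

split-prime-power : ∀ {ℓ} → Prime ℓ → ∀ m → 0 ℕ.< m → ∃ λ a → ∃ λ m′ → m ≡ ℓ ℕ.^ a ℕ.* m′ × ¬ (ℓ ℕ.∣ m′)
split-prime-power {ℓ} pr m 0<m = split m (<-wellFounded m) 0<m
  where
  split : ∀ m → Acc ℕ._<_ m → 0 ℕ.< m → ∃ λ a → ∃ λ m′ → m ≡ ℓ ℕ.^ a ℕ.* m′ × ¬ (ℓ ℕ.∣ m′)
  split m (acc smaller) 0<m with ℓ ℕ.∣? m
  ... | no ℓ∤m = 0 , m , sym (ℕ.+-identityʳ m) , ℓ∤m
  ... | yes (ℕ.divides c refl) with split c (smaller c<m) 0<c
    where
    0<c : 0 ℕ.< c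
    0<c = *-positive⇒positive 0<m refl
    c<m : c ℕ.< c ℕ.* ℓ
    c<m = ℕ.m<m*n c ℓ {{ℕ.>-nonZero 0<c}} (prime≥2 pr)
  ... | a , m′ , refl , ℓ∤m′ = suc a , m′ , lemma (ℓ ℕ.^ a) m′ ℓ , ℓ∤m′
    where
    lemma : ∀ x y l → x ℕ.* y ℕ.* l ≡ l ℕ.* x ℕ.* y
    lemma = ℕ-Solver.solve-∀

prime-power-factor : ∀ R → 2 ℕ.≤ R → ∃ λ ℓ → ∃ λ a → ∃ λ R′ → Prime ℓ × R ≡ ℓ ℕ.^ suc a ℕ.* R′ × ¬ (ℓ ℕ.∣ R′)
prime-power-factor R 2≤R with ℓ , prime-ℓ , ℓ∣R ← prime-factor R 2≤R with split-prime-power prime-ℓ R (ℕ.<-trans (s≤s z≤n) 2≤R)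
... | zero , R′ , R≡R′ , ℓ∤R′ = ⊥-elim (ℓ∤R′ (subst (ℓ ℕ.∣_) (trans R≡R′ (ℕ.+-identityʳ R′)) ℓ∣R))
... | suc a , R′ , R≡ℓ^[1+a]R′ , ℓ∤R′ = ℓ , a , R′ , prime-ℓ , R≡ℓ^[1+a]R′ , ℓ∤R′

1≤p∸1 : ∀ {p} → Prime p → 1 ℕ.≤ p ℕ.∸ 1
1≤p∸1 {p} pr = ℕ.m<n⇒0<n∸m (prime≥2 pr)

-- If ℓ^(a+1) ∣ p - 1 = c ℓ^(a+1), then x^c has order ℓ^(a+1) for any x with x^(c ℓ^a) ≢ 1.
element-of-prime-power-order : ∀ {p ℓ} → Prime p → Prime ℓ → ∀ a → ℓ ℕ.^ suc a ℕ.∣ p ℕ.∸ 1 →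
  ∃ λ g → g HasOrder ℓ ℕ.^ suc a [mod p ]
element-of-prime-power-order {p} {ℓ} prime-p prime-ℓ a (ℕ.divides c p-1≡) = element (c ℕ.* ℓ ℕ.^ a) refl
  where
  rearrange : ∀ c l la → c ℕ.* (l ℕ.* la) ≡ l ℕ.* (c ℕ.* la)
  rearrange = ℕ-Solver.solve-∀
  p-1≡ℓm : ∀ m → m ≡ c ℕ.* ℓ ℕ.^ a → p ℕ.∸ 1 ≡ ℓ ℕ.* m
  p-1≡ℓm m m≡ = trans p-1≡ (trans (rearrange c ℓ (ℓ ℕ.^ a)) (cong (ℓ ℕ.*_) (sym m≡)))
  element : ∀ m → m ≡ c ℕ.* ℓ ℕ.^ a → ∃ λ g → g HasOrder ℓ ℕ.^ suc a [mod p ]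
  element zero m≡ = ⊥-elim (ℕ.<⇒≢ (1≤p∸1 prime-p) (sym (trans (p-1≡ℓm 0 m≡) (ℕ.*-zeroʳ ℓ))))
  element (suc m) m≡ with non-root prime-p m 1+m<p-1
    where
    1+m<p-1 : suc m ℕ.< p ℕ.∸ 1
    1+m<p-1 = subst (suc m ℕ.<_) (trans (ℕ.*-comm (suc m) ℓ) (sym (p-1≡ℓm (suc m) m≡))) (ℕ.m<m*n (suc m) ℓ (prime≥2 prime-ℓ))
  ... | x , 1≤x , x<p , x^[1+m]≉1 = (+ x) ^ c , has-prime-power-order prime-ℓ a ((+ x) ^ c) order-divides order-not-smaller
    where
    order-divides : ((+ x) ^ c) ^ (ℓ ℕ.^ suc a) ≈ + 1 [mod p ]
    order-divides = ≈-trans (≈-reflexive (trans (sym (^-* (+ x) c (ℓ ℕ.^ suc a))) (cong ((+ x) ^_) (sym p-1≡))))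
      (fermat-unit prime-p (+ x) (<-incongruent 1≤x x<p))
    order-not-smaller : ¬ (((+ x) ^ c) ^ (ℓ ℕ.^ a) ≈ + 1 [mod p ])
    order-not-smaller h = x^[1+m]≉1 (≈-trans (≈-reflexive (trans (cong ((+ x) ^_) m≡) (^-* (+ x) c (ℓ ℕ.^ a)))) h)

-- Multiply together elements of order ℓ^a for the prime powers ℓ^a exactly dividing p - 1.
primitive-root-mod-prime : ∀ {p} → Prime p → ∃ λ g → g HasOrder p ℕ.∸ 1 [mod p ]
primitive-root-mod-prime {p} prime-p =
  extend (p ℕ.∸ 1) (<-wellFounded _) 1 (+ 1) (sym (ℕ.*-identityˡ _)) (λ (i∣1 , _) → ℕ.∣1⇒≡1 i∣1)
    (has-order ≈-refl λ j _ → ℕ.1∣ j)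
  where
  extend : ∀ R → Acc ℕ._<_ R → ∀ D g → p ℕ.∸ 1 ≡ D ℕ.* R → Coprime D R → g HasOrder D [mod p ] →
    ∃ λ g → g HasOrder p ℕ.∸ 1 [mod p ]
  extend zero _ D g p-1≡ _ _ = ⊥-elim (ℕ.<⇒≢ (1≤p∸1 prime-p) (sym (trans p-1≡ (ℕ.*-zeroʳ D))))
  extend (suc zero) _ D g p-1≡ _ ord-g = g , subst (g HasOrder_[mod p ]) (sym (trans p-1≡ (ℕ.*-identityʳ D))) ord-g
  extend R@(suc (suc _)) (acc smaller) D g p-1≡ D⊥R ord-g
    with ℓ , a , R′ , prime-ℓ , R≡LR′ , ℓ∤R′ ← prime-power-factor R (s≤s (s≤s z≤n))
    with h , ord-h ← element-of-prime-power-order prime-p prime-ℓ a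
           (subst (ℓ ℕ.^ suc a ℕ.∣_) (sym p-1≡) (ℕ.∣n⇒∣m*n D (ℕ.divides R′ (trans R≡LR′ (ℕ.*-comm _ R′)))))
    = extend R′ (smaller R′<R) (D ℕ.* L) (g * h) (trans p-1≡ (trans (cong (D ℕ.*_) R≡LR′) (sym (ℕ.*-assoc D L R′))))
        (coprime-*ˡ (coprime-∣ʳ D⊥R (ℕ.divides L R≡LR′)) (coprime-^ˡ (prime∤⇒coprime prime-ℓ ℓ∤R′) (suc a)))
        (*-has-order ord-g ord-h (coprime-∣ʳ D⊥R (ℕ.divides R′ (trans R≡LR′ (ℕ.*-comm L R′)))))
    where
    L : ℕ
    L = ℓ ℕ.^ suc a
    R′<R : R′ ℕ.< R
    R′<R = subst (R′ ℕ.<_) (trans (ℕ.*-comm R′ L) (sym R≡LR′))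
      (ℕ.m<m*n R′ L {{ℕ.>-nonZero (*-positive⇒positive (s≤s z≤n) (trans R≡LR′ (ℕ.*-comm L R′)))}}
        (ℕ.≤-trans (prime≥2 prime-ℓ) (ℕ.m≤m*n ℓ (ℓ ℕ.^ a) {{ℕ.m^n≢0 ℓ a {{prime⇒nonZero prime-ℓ}}}})))

*-cancelˡ-unit : ∀ {n u v a b} → u * v ≈ + 1 [mod n ] → u * a ≈ u * b [mod n ] → a ≈ b [mod n ]
*-cancelˡ-unit {n} {u} {v} {a} {b} uv≈1 ua≈ub = begin
  a             ≡⟨ ℤ.*-identityˡ a ⟨
  + 1 * a       ≈⟨ *-congʳ a vu≈1 ⟨
  v * u * a     ≡⟨ ℤ.*-assoc v u a ⟩
  v * (u * a)   ≈⟨ *-congˡ v ua≈ub ⟩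
  v * (u * b)   ≡⟨ ℤ.*-assoc v u b ⟨
  v * u * b     ≈⟨ *-congʳ b vu≈1 ⟩
  + 1 * b       ≡⟨ ℤ.*-identityˡ b ⟩
  b             ∎
  where
  open ≈-Reasoning n
  vu≈1 : v * u ≈ + 1 [mod n ]
  vu≈1 = ≈-trans (≈-reflexive (ℤ.*-comm v u)) uv≈1

^-unit : ∀ {n} u v i → u * v ≈ + 1 [mod n ] → u ^ i * v ^ i ≈ + 1 [mod n ]
^-unit u v i uv≈1 = ≈-trans (≈-reflexive (sym (^-distribʳ-* u v i))) (≈1⇒^≈1 i uv≈1)

^-injective-below-order : ∀ {n g d} → g HasOrder d [mod n ] → ∀ {i j} → i ℕ.< j → j ℕ.< d → ¬ (g ^ j ≈ g ^ i [mod n ])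
^-injective-below-order {n} {g} {suc t} ord-g {i} {j} i<j j<d g^j≈g^i =
  ℕ.>⇒∤ {{ℕ.>-nonZero (ℕ.m<n⇒0<n∸m i<j)}} (ℕ.≤-<-trans (ℕ.m∸n≤m j i) j<d) (order∣ ord-g (j ℕ.∸ i) g^[j-i]≈1)
  where
  g^j≡ : g ^ j ≡ g ^ i * g ^ (j ℕ.∸ i)
  g^j≡ = trans (cong (g ^_) (sym (ℕ.m+[n∸m]≡n (ℕ.<⇒≤ i<j)))) (ℤ.^-distribˡ-+-* g i (j ℕ.∸ i))
  g^[j-i]≈1 : g ^ (j ℕ.∸ i) ≈ + 1 [mod n ]
  g^[j-i]≈1 = *-cancelˡ-unit {u = g ^ i} (^-unit g (g ^ t) i (^order≈1 ord-g))
    (≈-trans (≈-reflexive (sym g^j≡)) (≈-trans g^j≈g^i (≈-reflexive (sym (ℤ.*-identityʳ (g ^ i))))))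

-- The p - 1 powers of g together with a further residue x would be p distinct roots of X^(p-1) - 1.
primitive-root-mod-prime-generates : ∀ {p g} → Prime p → g HasOrder p ℕ.∸ 1 [mod p ] →
  ∀ x → ¬ (x ≈ + 0 [mod p ]) → ∃ λ m → g ^ m ≈ x [mod p ]
primitive-root-mod-prime-generates {p@(suc (suc t))} {g} prime-p ord-g x x≉0 with search-below (λ i → g ^ i ≈ x [mod p ]) (λ i → ≈-dec p _ _) (suc t)
... | inj₁ (m , _ , g^m≈x) = m , g^m≈x
... | inj₂ x-not-a-power = ⊥-elim (ℕ.<-irrefl refl (subst (λ k → suc k ℕ.≤ suc t) (List.length-applyDownFrom (g ^_) (suc t)) bound))
  where
  g^i^[1+t]≈1 : ∀ i → (g ^ i) ^ suc t ≈ + 1 [mod p ]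
  g^i^[1+t]≈1 i = ≈-trans (≈-reflexive (sym (^-* g i (suc t)))) (^-multiple≈1 g (suc t) (^order≈1 ord-g) (ℕ.n∣m*n i))
  bound : length (x ∷ applyDownFrom (g ^_) (suc t)) ℕ.≤ suc t
  bound = roots-of-unity≤ prime-p t _
    (All.applyDownFrom⁺₁ _ (suc t) (λ i<1+t x≈g^i → x-not-a-power _ i<1+t (≈-sym x≈g^i))
      ∷ AllPairs.applyDownFrom⁺₁ _ (suc t) (λ j<i i<1+t → ^-injective-below-order ord-g j<i i<1+t))
    (fermat-unit prime-p x x≉0 ∷ All.applyDownFrom⁺₁ _ (suc t) λ {i} _ → g^i^[1+t]≈1 i)
primitive-root-mod-prime-generates {suc zero} prime-p = ⊥-elim (¬prime[1] prime-p)

-- Primitive roots modulo odd prime powers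

-- s = -d u^(p-2), since u^(p-1) ≡ 1.
linear-congruence-solvable : ∀ {p u} → Prime p → ¬ (u ≈ + 0 [mod p ]) → ∀ d → ∃ λ s → + p ∣ d + + s * u
linear-congruence-solvable {suc (suc p″)} {u} prime-p u≉0 d = s , subst (_ ∣_) (lemma d (+ s * u)) (∣-difference su≈-d)
  where
  p : ℕ
  p = suc (suc p″)
  lemma : ∀ d a → a - - d ≡ d + a
  lemma = solve-∀
  s : ℕ
  s = (- d * u ^ p″) ℤ.%ℕ p
  su≈-d : + s * u ≈ - d [mod p ]
  su≈-d = begin
    + s * u              ≈⟨ *-congʳ u (a≈a%ℕn p (- d * u ^ p″)) ⟨
    - d * u ^ p″ * u     ≡⟨ rearrange (- d) u (u ^ p″) ⟩
    - d * (u * u ^ p″)   ≈⟨ *-congˡ (- d) (fermat-unit prime-p u u≉0) ⟩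
    - d * + 1            ≡⟨ ℤ.*-identityʳ (- d) ⟩
    - d                  ∎
    where
    open ≈-Reasoning p
    rearrange : ∀ a u v → a * v * u ≡ a * (u * v)
    rearrange = solve-∀
linear-congruence-solvable {suc zero} prime-p = ⊥-elim (¬prime[1] prime-p)

φ : ℕ → ℕ → ℕ
φ p k = p ℕ.^ (k ℕ.∸ 1) ℕ.* (p ℕ.∸ 1)

record PrimitiveRoot (p k : ℕ) : Set where
  field
    root : ℤ
    root-order : root HasOrder φ p k [mod p ℕ.^ k ]
    root-generates : ∀ x → ¬ (x ≈ + 0 [mod p ]) → ∃ λ m → root ^ m ≈ x [mod p ℕ.^ k ]
open PrimitiveRoot public

module _ {p t : ℕ} (prime-p : Prime p) (p≥3 : 3 ℕ.≤ p) (p-1≡1+t : p ℕ.∸ 1 ≡ suc t) where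

  private
    instance
      p≢0 : NonZero p
      p≢0 = prime⇒nonZero prime-p

    P : ℕ → ℤ
    P e = (+ p) ^ e

    ∣P⇒∣p^ : ∀ {e a} → P e ∣ a → + (p ℕ.^ e) ∣ a
    ∣P⇒∣p^ {e} = subst (_∣ _) (sym (pos-^ p e))

    p∤p-1 : ¬ (+ p ∣ + suc t)
    p∤p-1 p∣p-1 = <-incongruent (s≤s z≤n) (subst (ℕ._< p) p-1≡1+t (p∸1<p prime-p)) (∣⇒≈0 p∣p-1)

    -- If g^(p-1) ≡ 1 (mod p²), then (g + p)^(p-1) ≡ 1 - p g^(p-2) ≢ 1 (mod p²).
    good-root : ∃ λ g → g HasOrder suc t [mod p ] × ¬ (g ^ suc t ≈ + 1 [mod p ℕ.* p ])
    good-root with g , ord-g ← subst (λ d → ∃ λ g → g HasOrder d [mod p ]) p-1≡1+t (primitive-root-mod-prime prime-p) | ≈-dec (p ℕ.* p) (g ^ suc t) (+ 1)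
    ... | no g^[p-1]≉1 = g , ord-g , g^[p-1]≉1
    ... | yes g^[p-1]≈1 = g + + p , HasOrder-cong g≈g+p ord-g , shifted≉1
      where
      g≈g+p : g ≈ g + + p [mod p ]
      g≈g+p = ≈-trans (≈-reflexive (sym (ℤ.+-identityʳ g))) (+-cong (≈-refl {a = g}) (≈-sym (∣⇒≈0 ∣-refl)))
      shifted≉1 : ¬ ((g + + p) ^ suc t ≈ + 1 [mod p ℕ.* p ])
      shifted≉1 shifted≈1 = neither (≈0-*-prime prime-p (+ suc t) (g ^ t) (∣⇒≈0 (*-cancelʳ-∣ (+ p) p²∣)))
        where
        correction≈0 : + suc t * (g ^ t * + p) ≈ + 0 [mod p ℕ.* p ]
        correction≈0 = +-cancelˡ-≈ g^[p-1]≈1 (≈-trans (≈-sym (binomial-≈-first-order g (+ p) (∣-reflexive (ℤ.pos-* p p)) t))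
          (≈-trans shifted≈1 (≈-reflexive (sym (ℤ.+-identityʳ (+ 1))))))
        p²∣ : + p * + p ∣ + suc t * g ^ t * + p
        p²∣ = subst₂ _∣_ (ℤ.pos-* p p) (sym (ℤ.*-assoc (+ suc t) (g ^ t) (+ p))) (≈0⇒∣ correction≈0)
        neither : + suc t ≈ + 0 [mod p ] ⊎ g ^ t ≈ + 0 [mod p ] → ⊥
        neither (inj₁ p∣p-1) = p∤p-1 (≈0⇒∣ p∣p-1)
        neither (inj₂ g^t≈0) = 1≉0 prime-p (≈-trans (≈-sym (^order≈1 ord-g)) (≈-trans (*-congˡ g g^t≈0) (≈-reflexive (ℤ.*-zeroʳ g))))

    g₀ : ℤ
    g₀ = proj₁ good-root

    g₀-order-mod-p : g₀ HasOrder suc t [mod p ]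
    g₀-order-mod-p = proj₁ (proj₂ good-root)

    h : ℤ
    h = g₀ ^ suc t

    p∣P[1+e]w : ∀ e w → + p ∣ P (suc e) * w
    p∣P[1+e]w e w = divides (P e * w) (lemma (+ p) (P e) w)
      where
      lemma : ∀ p Pe w → p * Pe * w ≡ Pe * w * p
      lemma = solve-∀

    p^[3+e]∣p[P[1+e]w]² : ∀ e w → + (p ℕ.^ (3 ℕ.+ e)) ∣ + p * (P (suc e) * w * (P (suc e) * w))
    p^[3+e]∣p[P[1+e]w]² e w = ∣P⇒∣p^ {3 ℕ.+ e} (divides (P e * w * w) (lemma (+ p) (P e) w))
      where
      lemma : ∀ p Pe w → p * (p * Pe * w * (p * Pe * w)) ≡ Pe * w * w * (p * (p * (p * Pe)))
      lemma = solve-∀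

    h^p^e : ∀ e → ∃ λ w → h ^ (p ℕ.^ e) ≡ + 1 + P (suc e) * w × ¬ (+ p ∣ w)
    h^p^e zero with divides w h-1≡ ← ∣-difference (^order≈1 g₀-order-mod-p) =
      w , trans (ℤ.*-identityʳ h) (trans (split-off-1 h) (trans (cong (_+_ (+ 1)) h-1≡) (rearrange w (+ p)))) , p∤w
      where
      split-off-1 : ∀ h → h ≡ + 1 + (h - + 1)
      split-off-1 = solve-∀
      rearrange : ∀ w p → + 1 + w * p ≡ + 1 + p * + 1 * w
      rearrange = solve-∀
      p∤w : ¬ (+ p ∣ w)
      p∤w (divides w′ refl) = proj₂ (proj₂ good-root) (congruent (divides w′ (trans h-1≡
        (trans (ℤ.*-assoc w′ (+ p) (+ p)) (cong (w′ *_) (sym (ℤ.pos-* p p)))))))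
    h^p^e (suc e) with w , h^p^e≡ , p∤w ← h^p^e e = w + + p * c , h^p^[1+e]≡ , p∤w+pc
      where
      y : ℤ
      y = P (suc e) * w
      p^[3+e]∣ : + (p ℕ.^ (3 ℕ.+ e)) ∣ (+ 1 + y) ^ p - (+ 1 + + p * y)
      p^[3+e]∣ = ∣-difference (1+y^p≈1+py prime-p p≥3 y (p∣P[1+e]w e w) (p^[3+e]∣p[P[1+e]w]² e w))
      c : ℤ
      c = _∣_.quotient p^[3+e]∣
      split : ∀ p Pe w c z → z ≡ + 1 + p * (p * Pe * w) + (z - (+ 1 + p * (p * Pe * w)))
      split = solve-∀
      collect : ∀ p Pe w c → + 1 + p * (p * Pe * w) + c * (p * (p * (p * Pe))) ≡ + 1 + p * (p * Pe) * (w + p * c)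
      collect = solve-∀
      h^p^[1+e]≡ : h ^ (p ℕ.^ suc e) ≡ + 1 + P (2 ℕ.+ e) * (w + + p * c)
      h^p^[1+e]≡ = begin
        h ^ (p ℕ.^ suc e)                       ≡⟨ trans (cong (h ^_) (ℕ.*-comm p (p ℕ.^ e))) (^-* h (p ℕ.^ e) p) ⟩
        (h ^ (p ℕ.^ e)) ^ p                     ≡⟨ cong (_^ p) h^p^e≡ ⟩
        (+ 1 + y) ^ p                           ≡⟨ split (+ p) (P e) w c ((+ 1 + y) ^ p) ⟩
        + 1 + + p * y + ((+ 1 + y) ^ p - (+ 1 + + p * y))
          ≡⟨ cong (_+_ (+ 1 + + p * y)) (trans (_∣_.equality p^[3+e]∣) (cong (c *_) (pos-^ p (3 ℕ.+ e)))) ⟩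
        + 1 + + p * y + c * P (3 ℕ.+ e)         ≡⟨ collect (+ p) (P e) w c ⟩
        + 1 + P (2 ℕ.+ e) * (w + + p * c)       ∎
        where open ≡-Reasoning
      p∤w+pc : ¬ (+ p ∣ w + + p * c)
      p∤w+pc p∣w+pc = p∤w (∣m+n∣n⇒∣m p∣w+pc (∣m⇒∣m*n c ∣-refl))
    h^p^e-≈1 : ∀ e → h ^ (p ℕ.^ e) ≈ + 1 [mod p ℕ.^ suc e ]
    h^p^e-≈1 e = congruent (divides w (trans (cong (_- + 1) h^p^e≡) (trans (lemma (P (suc e)) w) (cong (w *_) (sym (pos-^ p (suc e)))))))
      where
      w : ℤ
      w = proj₁ (h^p^e e)
      h^p^e≡ : h ^ (p ℕ.^ e) ≡ + 1 + P (suc e) * w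
      h^p^e≡ = proj₁ (proj₂ (h^p^e e))
      lemma : ∀ P w → + 1 + P * w - + 1 ≡ w * P
      lemma = solve-∀

    h^p^e^s : ∀ e w → h ^ (p ℕ.^ e) ≡ + 1 + P (suc e) * w → ∀ s → (h ^ (p ℕ.^ e)) ^ s ≈ + 1 + + s * (P (suc e) * w) [mod p ℕ.^ (2 ℕ.+ e) ]
    h^p^e^s e w h^p^e≡ s = ≈-trans (≈-reflexive (cong (_^ s) h^p^e≡)) (1+y^s≈1+sy _ (∣P⇒∣p^ {2 ℕ.+ e} (divides (P e * w * w) (lemma (+ p) (P e) w))) s)
      where
      lemma : ∀ p Pe w → p * Pe * w * (p * Pe * w) ≡ Pe * w * w * (p * (p * Pe))
      lemma = solve-∀

    p∣multiplier : ∀ e w s → ¬ (+ p ∣ w) → + s * (P (suc e) * w) ≈ + 0 [mod p ℕ.^ (2 ℕ.+ e) ] → p ℕ.∣ s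
    p∣multiplier e w s p∤w sy≈0 = first-factor (≈0-*-prime prime-p (+ s) w (∣⇒≈0 (*-cancelˡ-∣ (P (suc e)) {{P≢0}} p∣sw)))
      where
      P≢0 : ℤ.NonZero (P (suc e))
      P≢0 = subst ℤ.NonZero (pos-^ p (suc e)) (ℕ.m^n≢0 p (suc e))
      lemma : ∀ p Pe s w → s * (p * Pe * w) ≡ p * Pe * (s * w)
      lemma = solve-∀
      p∣sw : P (suc e) * + p ∣ P (suc e) * (+ s * w)
      p∣sw = subst₂ _∣_ (trans (pos-^ p (2 ℕ.+ e)) (ℤ.*-comm (+ p) (P (suc e)))) (lemma (+ p) (P e) (+ s) w) (≈0⇒∣ sy≈0)
      first-factor : + s ≈ + 0 [mod p ] ⊎ w ≈ + 0 [mod p ] → p ℕ.∣ s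
      first-factor (inj₁ p∣s) = ∣⇒∣ᵤ (≈0⇒∣ p∣s)
      first-factor (inj₂ p∣w) = ⊥-elim (p∤w (≈0⇒∣ p∣w))

    g₀^-≡h^ : ∀ e s → g₀ ^ (s ℕ.* (p ℕ.^ e ℕ.* suc t)) ≡ (h ^ (p ℕ.^ e)) ^ s
    g₀^-≡h^ e s = trans (cong (g₀ ^_) (trans (ℕ.*-comm s _) (cong (ℕ._* s) (ℕ.*-comm (p ℕ.^ e) (suc t)))))
      (trans (^-* g₀ (suc t ℕ.* p ℕ.^ e) s) (cong (_^ s) (^-* g₀ (suc t) (p ℕ.^ e))))

    g₀-order : ∀ e → g₀ HasOrder p ℕ.^ e ℕ.* suc t [mod p ℕ.^ suc e ]
    g₀-order e = has-order (≈-trans (≈-reflexive (trans (cong (g₀ ^_) (sym (ℕ.*-identityˡ (p ℕ.^ e ℕ.* suc t)))) (g₀^-≡h^ e 1))) (≈-trans (≈-reflexive (ℤ.*-identityʳ _)) (h^p^e-≈1 e)))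
      (order-divides e)
      where
      order-divides : ∀ e j → g₀ ^ j ≈ + 1 [mod p ℕ.^ suc e ] → p ℕ.^ e ℕ.* suc t ℕ.∣ j
      order-divides zero j g₀^j≈1 = subst (ℕ._∣ j) (sym (ℕ.*-identityˡ (suc t))) (order∣ g₀-order-mod-p j (≈-mod-∣ (ℕ.m∣m*n 1) g₀^j≈1))
      order-divides (suc e) j g₀^j≈1 with ℕ.divides s refl ← order-divides e j (≈-mod-∣ (ℕ.n∣m*n p) g₀^j≈1) =
        subst (ℕ._∣ s ℕ.* (p ℕ.^ e ℕ.* suc t)) (sym (ℕ.*-assoc p (p ℕ.^ e) (suc t))) (ℕ.*-monoˡ-∣ (p ℕ.^ e ℕ.* suc t) (p∣s (h^p^e e)))
        where
        p∣s : (∃ λ w → h ^ (p ℕ.^ e) ≡ + 1 + P (suc e) * w × ¬ (+ p ∣ w)) → p ℕ.∣ s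
        p∣s (w , h^p^e≡ , p∤w) = p∣multiplier e w s p∤w (+-cancelˡ-≈ (≈-refl {a = + 1})
          (≈-trans (≈-sym (h^p^e^s e w h^p^e≡ s)) (≈-trans (≈-reflexive (sym (g₀^-≡h^ e s))) (≈-trans g₀^j≈1 (≈-reflexive (sym (ℤ.+-identityʳ (+ 1))))))))

    g₀^m*w≉0 : ∀ m w → ¬ (+ p ∣ w) → ¬ (g₀ ^ m * w ≈ + 0 [mod p ])
    g₀^m*w≉0 m w p∤w g₀^m*w≈0 with ≈0-*-prime prime-p (g₀ ^ m) w g₀^m*w≈0
    ... | inj₁ g₀^m≈0 = 1≉0 prime-p (≈-trans (≈-sym (^-multiple≈1 g₀ (suc t) (^order≈1 g₀-order-mod-p) (ℕ.n∣m*n m)))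
      (≈-trans (≈-reflexive (^-* g₀ m (suc t))) (≈-trans (^-cong (suc t) g₀^m≈0) (≈-reflexive refl))))
    ... | inj₂ w≈0 = p∤w (≈0⇒∣ w≈0)

    -- Lift g₀^m ≡ x (mod p^(e+1)) to p^(e+2) by correcting the exponent by a multiple s of the order mod p^(e+1).
    g₀-generates : ∀ e x → ¬ (x ≈ + 0 [mod p ]) → ∃ λ m → g₀ ^ m ≈ x [mod p ℕ.^ suc e ]
    g₀-generates zero x x≉0 with m , g₀^m≈x ← primitive-root-mod-prime-generates prime-p (subst (g₀ HasOrder_[mod p ]) (sym p-1≡1+t) g₀-order-mod-p) x x≉0 =
      m , ≈-mod-∣ (ℕ.∣-reflexive (ℕ.*-identityʳ p)) g₀^m≈x
    g₀-generates (suc e) x x≉0 = lift (g₀-generates e x x≉0) (h^p^e e)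
      where
      lift : (∃ λ m → g₀ ^ m ≈ x [mod p ℕ.^ suc e ]) → (∃ λ w → h ^ (p ℕ.^ e) ≡ + 1 + P (suc e) * w × ¬ (+ p ∣ w)) →
        ∃ λ m → g₀ ^ m ≈ x [mod p ℕ.^ (2 ℕ.+ e) ]
      lift (m , congruent (divides d g₀^m-x≡)) (w , h^p^e≡ , p∤w) = m ℕ.+ s ℕ.* (p ℕ.^ e ℕ.* suc t) , (begin
        g₀ ^ (m ℕ.+ s ℕ.* (p ℕ.^ e ℕ.* suc t))        ≡⟨ ℤ.^-distribˡ-+-* g₀ m _ ⟩
        g₀ ^ m * g₀ ^ (s ℕ.* (p ℕ.^ e ℕ.* suc t))     ≡⟨ cong (g₀ ^ m *_) (g₀^-≡h^ e s) ⟩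
        g₀ ^ m * (h ^ (p ℕ.^ e)) ^ s                  ≈⟨ *-congˡ (g₀ ^ m) (h^p^e^s e w h^p^e≡ s) ⟩
        g₀ ^ m * (+ 1 + + s * (P (suc e) * w))        ≈⟨ congruent (divides c g₀^m[1+sy]-x≡) ⟩
        x                                             ∎)
        where
        open ≈-Reasoning (p ℕ.^ (2 ℕ.+ e))
        s : ℕ
        s = proj₁ (linear-congruence-solvable prime-p (g₀^m*w≉0 m w p∤w) d)
        p∣d+su : + p ∣ d + + s * (g₀ ^ m * w)
        p∣d+su = proj₂ (linear-congruence-solvable prime-p (g₀^m*w≉0 m w p∤w) d)
        c : ℤ
        c = _∣_.quotient p∣d+su
        collect : ∀ G x d s w p Pe → G - x ≡ d * (p * Pe) →
          G * (+ 1 + s * (p * Pe * w)) - x ≡ (p * Pe) * (d + s * (G * w))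
        collect G x d s w p Pe eq = trans (expand G x s (p * Pe) w) (trans (cong (_+ s * G * (p * Pe * w)) eq) (factor d (p * Pe) s G w))
          where
          expand : ∀ G x s Q w → G * (+ 1 + s * (Q * w)) - x ≡ (G - x) + s * G * (Q * w)
          expand = solve-∀
          factor : ∀ d Q s G w → d * Q + s * G * (Q * w) ≡ Q * (d + s * (G * w))
          factor = solve-∀
        g₀^m[1+sy]-x≡ : g₀ ^ m * (+ 1 + + s * (P (suc e) * w)) - x ≡ c * + (p ℕ.^ (2 ℕ.+ e))
        g₀^m[1+sy]-x≡ = trans (collect (g₀ ^ m) x d (+ s) w (+ p) (P e) (trans g₀^m-x≡ (cong (d *_) (pos-^ p (suc e)))))
          (trans (cong (P (suc e) *_) (_∣_.equality p∣d+su)) (trans (lemma (+ p) (P e) c) (cong (c *_) (sym (pos-^ p (2 ℕ.+ e))))))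
          where
          lemma : ∀ p Pe c → p * Pe * (c * p) ≡ c * (p * (p * Pe))
          lemma = solve-∀

  lifted-primitive-root : ∀ e → PrimitiveRoot p (suc e)
  lifted-primitive-root e = record
    { root = g₀
    ; root-order = subst (λ d → g₀ HasOrder p ℕ.^ e ℕ.* d [mod p ℕ.^ suc e ]) (sym p-1≡1+t) (g₀-order e)
    ; root-generates = g₀-generates e
    }

primitive-root-mod-odd-prime-power : ∀ {p} → Prime p → 3 ℕ.≤ p → ∀ k → 1 ℕ.≤ k → PrimitiveRoot p k
primitive-root-mod-odd-prime-power {p@(suc (suc t))} prime-p p≥3 (suc e) _ = lifted-primitive-root prime-p p≥3 refl e

^-has-order : ∀ {n g} c d .{{_ : NonZero c}} → g HasOrder c ℕ.* d [mod n ] → g ^ c HasOrder d [mod n ]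
^-has-order {g = g} c d ord-g = has-order (≈-trans (≈-reflexive (sym (^-* g c d))) (^order≈1 ord-g))
  λ j g^cj≈1 → ℕ.*-cancelˡ-∣ c (order∣ ord-g (c ℕ.* j) (≈-trans (≈-reflexive (^-* g c j)) g^cj≈1))

^-≈-exponent : ∀ {n g d m m′} → g ^ d ≈ + 1 [mod n ] → + m ≈ + m′ [mod d ] → g ^ m ≈ g ^ m′ [mod n ]
^-≈-exponent {n} {g} {d} {m} {m′} g^d≈1 m≈m′ = by-order (ℕ.≤-total m′ m)
  where
  larger : ∀ {m m′} → m′ ℕ.≤ m → + m ≈ + m′ [mod d ] → g ^ m ≈ g ^ m′ [mod n ]
  larger {m} {m′} m′≤m m≈m′ = ≈-trans (≈-reflexive (trans (cong (g ^_) (sym (ℕ.m+[n∸m]≡n m′≤m))) (ℤ.^-distribˡ-+-* g m′ (m ℕ.∸ m′))))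
    (≈-trans (*-congˡ (g ^ m′) (^-multiple≈1 g d g^d≈1 (≈⇒∣∸ m′≤m m≈m′))) (≈-reflexive (ℤ.*-identityʳ (g ^ m′))))
  by-order : m′ ℕ.≤ m ⊎ m ℕ.≤ m′ → g ^ m ≈ g ^ m′ [mod n ]
  by-order (inj₁ m′≤m) = larger m′≤m m≈m′
  by-order (inj₂ m≤m′) = ≈-sym (larger m≤m′ (≈-sym m≈m′))

-- An odd prime cannot divide both x - 1 and x + 1, which differ by 2.
square-root-of-1 : ∀ {p} k → Prime p → 3 ℕ.≤ p → ∀ x → x * x ≈ + 1 [mod p ℕ.^ k ] → x ≈ + 1 [mod p ℕ.^ k ] ⊎ x ≈ - + 1 [mod p ℕ.^ k ]
square-root-of-1 {p} k prime-p p≥3 x x²≈1 = by-residue (≈-dec p x (+ 1))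
  where
  factor : ∀ x → x * x - + 1 ≡ (x - + 1) * (x + + 1)
  factor = solve-∀
  x+1≡ : ∀ x → x + + 1 ≡ x - - + 1
  x+1≡ = solve-∀
  difference-2 : ∀ x → (x + + 1) - (x - + 1) ≡ + 2
  difference-2 = solve-∀
  p^k∣[x-1][x+1] : p ℕ.^ k ℕ.∣ ∣ x - + 1 ∣ ℕ.* ∣ x + + 1 ∣
  p^k∣[x-1][x+1] = subst (p ℕ.^ k ℕ.∣_) (ℤ.abs-* (x - + 1) (x + + 1)) (∣⇒∣ᵤ (subst (_ ∣_) (factor x) (∣-difference x²≈1)))
  p^k∣other : ∀ a b → ¬ (p ℕ.∣ ∣ a ∣) → p ℕ.^ k ℕ.∣ ∣ a ∣ ℕ.* ∣ b ∣ → + (p ℕ.^ k) ∣ b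
  p^k∣other a b p∤a p^k∣ab = ∣ᵤ⇒∣ (Coprime.coprime-divisor (coprime-^ˡ (prime∤⇒coprime prime-p p∤a) k) p^k∣ab)
  by-residue : Dec (x ≈ + 1 [mod p ]) → x ≈ + 1 [mod p ℕ.^ k ] ⊎ x ≈ - + 1 [mod p ℕ.^ k ]
  by-residue (no x≉1) = inj₂ (congruent (subst (_ ∣_) (x+1≡ x)
    (p^k∣other (x - + 1) (x + + 1) (λ p∣x-1 → x≉1 (congruent (∣ᵤ⇒∣ p∣x-1))) p^k∣[x-1][x+1])))
  by-residue (yes (congruent p∣x-1)) = inj₁ (congruent (p^k∣other (x + + 1) (x - + 1) p∤x+1
    (subst (p ℕ.^ k ℕ.∣_) (ℕ.*-comm ∣ x - + 1 ∣ ∣ x + + 1 ∣) p^k∣[x-1][x+1])))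
    where
    p∤x+1 : ¬ (p ℕ.∣ ∣ x + + 1 ∣)
    p∤x+1 p∣x+1 = ℕ.>⇒∤ p≥3 (∣⇒∣ᵤ (subst (_ ∣_) (difference-2 x) (∣m∣n⇒∣m-n (∣ᵤ⇒∣ {+ p} {x + + 1} p∣x+1) p∣x-1)))

half-order-power≈-1 : ∀ {p k g ψ} → Prime p → 3 ℕ.≤ p → 1 ℕ.≤ ψ → g HasOrder 2 ℕ.* ψ [mod p ℕ.^ k ] → g ^ ψ ≈ - + 1 [mod p ℕ.^ k ]
half-order-power≈-1 {p} {k} {g} {ψ} prime-p p≥3 1≤ψ ord-g with square-root-of-1 k prime-p p≥3 (g ^ ψ) g^ψ²≈1
  where
  g^ψ²≈1 : g ^ ψ * g ^ ψ ≈ + 1 [mod p ℕ.^ k ]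
  g^ψ²≈1 = ≈-trans (≈-reflexive (trans (sym (ℤ.^-distribˡ-+-* g ψ ψ)) (cong (λ e → g ^ (ψ ℕ.+ e)) (sym (ℕ.+-identityʳ ψ))))) (^order≈1 ord-g)
... | inj₂ g^ψ≈-1 = g^ψ≈-1
... | inj₁ g^ψ≈1 = ⊥-elim (ℕ.>⇒∤ {{ℕ.>-nonZero 1≤ψ}} (subst (ψ ℕ.<_) (cong (ψ ℕ.+_) (sym (ℕ.+-identityʳ ψ))) (ℕ.m<m+n ψ 1≤ψ)) (order∣ ord-g ψ g^ψ≈1))

-- Chinese remainder theorem

coprime⇒invertible : ∀ {m n} → Coprime m n → ∃ λ s → s * + m ≈ + 1 [mod n ]
coprime⇒invertible {m} {n} m⊥n with Coprime.coprime-Bézout m⊥n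
... | Bézout.+- x y eq = + x , congruent (divides (+ y) (trans (cong (_- + 1) xm≡1+yn) (cancel (+ y * + n))))
  where
  cancel : ∀ b → + 1 + b - + 1 ≡ b
  cancel = solve-∀
  xm≡1+yn : + x * + m ≡ + 1 + + y * + n
  xm≡1+yn = trans (sym (ℤ.pos-* x m)) (trans (cong +_ (sym eq)) (trans (ℤ.pos-+ 1 (y ℕ.* n)) (cong (_+_ (+ 1)) (ℤ.pos-* y n))))
... | Bézout.-+ x y eq = - + x , congruent (divides (- + y) (trans (negate (+ x) (+ m)) (trans (cong -_ 1+xm≡yn) (ℤ.neg-distribˡ-* (+ y) (+ n)))))
  where
  negate : ∀ x m → - x * m - + 1 ≡ - (+ 1 + x * m)
  negate = solve-∀
  1+xm≡yn : + 1 + + x * + m ≡ + y * + n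
  1+xm≡yn = trans (cong (_+_ (+ 1)) (sym (ℤ.pos-* x m))) (trans (sym (ℤ.pos-+ 1 (x ℕ.* m))) (trans (cong +_ eq) (ℤ.pos-* y n)))

-- X = a + s A (b - a), where s A ≡ 1 (mod B).
chinese-remainder : ∀ {A B} → Coprime A B → ∀ a b → ∃ λ X → X ≈ a [mod A ] × X ≈ b [mod B ]
chinese-remainder {A} {B} A⊥B a b with s , sA≈1 ← coprime⇒invertible A⊥B =
  a + s * + A * (b - a) , congruent (divides (s * (b - a)) (lemma a b s (+ A))) ,
    ≈-trans (+-cong (≈-refl {a = a}) (*-congʳ (b - a) sA≈1)) (≈-reflexive (lemma′ a b))
  where
  lemma : ∀ a b s A → a + s * A * (b - a) - a ≡ s * (b - a) * A
  lemma = solve-∀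
  lemma′ : ∀ a b → a + + 1 * (b - a) ≡ b
  lemma′ = solve-∀

-- Powers of 5 modulo powers of 2

residue : ∀ n .{{_ : NonZero n}} z → ∃ λ r → r ℕ.< n × z ≈ + r [mod n ]
residue n z = z ℤ.%ℕ n , ℤ.n%ℕd<d z n , a≈a%ℕn n z

even-or-odd : ∀ z → z ≈ + 0 [mod 2 ] ⊎ z ≈ + 1 [mod 2 ]
even-or-odd z with residue 2 z
... | 0 , _ , z≈0 = inj₁ z≈0
... | 1 , _ , z≈1 = inj₂ z≈1
... | suc (suc _) , s≤s (s≤s ()) , _

odd⇒≈±1-mod-4 : ∀ z → ¬ (z ≈ + 0 [mod 2 ]) → z ≈ + 1 [mod 4 ] ⊎ z ≈ - + 1 [mod 4 ]
odd⇒≈±1-mod-4 z z-odd with residue 4 z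
... | 0 , _ , z≈0 = ⊥-elim (z-odd (≈-mod-∣ (ℕ.divides 2 refl) z≈0))
... | 1 , _ , z≈1 = inj₁ z≈1
... | 2 , _ , z≈2 = ⊥-elim (z-odd (≈-trans (≈-mod-∣ (ℕ.divides 2 refl) z≈2) (congruent (divides (+ 1) refl))))
... | 3 , _ , z≈3 = inj₂ (≈-trans z≈3 (congruent (divides (+ 1) refl)))
... | suc (suc (suc (suc _))) , s≤s (s≤s (s≤s (s≤s ()))) , _

two^ : ℕ → ℤ
two^ k = (+ 2) ^ k

5^2^j≡ : ∀ j → ∃ λ c → (+ 5) ^ (2 ℕ.^ j) ≡ + 1 + two^ (2 ℕ.+ j) * (+ 1 + + 2 * c)
5^2^j≡ zero = + 0 , refl
5^2^j≡ (suc j) with c , 5^2^j≡1+… ← 5^2^j≡ j = c + two^ j * (+ 1 + + 2 * c) * (+ 1 + + 2 * c) , (begin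
  (+ 5) ^ (2 ℕ.^ suc j)                    ≡⟨ trans (cong ((+ 5) ^_) (ℕ.*-comm 2 (2 ℕ.^ j))) (^-* (+ 5) (2 ℕ.^ j) 2) ⟩
  ((+ 5) ^ (2 ℕ.^ j)) ^ 2                  ≡⟨ cong (_^ 2) 5^2^j≡1+… ⟩
  (+ 1 + two^ (2 ℕ.+ j) * (+ 1 + + 2 * c)) ^ 2 ≡⟨ square c (two^ j) ⟩
  + 1 + two^ (3 ℕ.+ j) * (+ 1 + + 2 * (c + two^ j * (+ 1 + + 2 * c) * (+ 1 + + 2 * c))) ∎)
  where
  open ≡-Reasoning
  square : ∀ c t → (+ 1 + + 2 * (+ 2 * t) * (+ 1 + + 2 * c)) * ((+ 1 + + 2 * (+ 2 * t) * (+ 1 + + 2 * c)) * + 1)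
                 ≡ + 1 + + 2 * (+ 2 * (+ 2 * t)) * (+ 1 + + 2 * (c + t * (+ 1 + + 2 * c) * (+ 1 + + 2 * c)))
  square = solve-∀

5^2^e≈1 : ∀ e → (+ 5) ^ (2 ℕ.^ e) ≈ + 1 [mod 2 ℕ.^ (2 ℕ.+ e) ]
5^2^e≈1 e with c , 5^2^e≡ ← 5^2^j≡ e =
  congruent (divides (+ 1 + + 2 * c) (trans (cong (_- + 1) 5^2^e≡) (trans (lemma (two^ (2 ℕ.+ e)) (+ 1 + + 2 * c)) (cong ((+ 1 + + 2 * c) *_) (sym (pos-^ 2 (2 ℕ.+ e)))))))
  where
  lemma : ∀ t w → + 1 + t * w - + 1 ≡ w * t
  lemma = solve-∀

-- If 5^m - y = d 2^(e+2) with d odd, then 5^(m + 2^e) ≡ y (mod 2^(e+3)) since 5^(2^e) = 1 + 2^(e+2) · odd.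
5^-lift : ∀ e y m → (+ 5) ^ m ≈ y [mod 2 ℕ.^ (2 ℕ.+ e) ] → ∃ λ m′ → (+ 5) ^ m′ ≈ y [mod 2 ℕ.^ (3 ℕ.+ e) ]
5^-lift e y m (congruent (divides d 5^m-y≡)) = by-parity (even-or-odd d) (5^2^j≡ e)
  where
  5^m-y≡dT : (+ 5) ^ m - y ≡ d * two^ (2 ℕ.+ e)
  5^m-y≡dT = trans 5^m-y≡ (cong (d *_) (pos-^ 2 (2 ℕ.+ e)))
  as-mod : ∀ {a} q → a ≡ q * two^ (3 ℕ.+ e) → a ≈ + 0 [mod 2 ℕ.^ (3 ℕ.+ e) ]
  as-mod q eq = ∣⇒≈0 (divides q (trans eq (cong (q *_) (sym (pos-^ 2 (3 ℕ.+ e))))))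
  by-parity : d ≈ + 0 [mod 2 ] ⊎ d ≈ + 1 [mod 2 ] → (∃ λ c → (+ 5) ^ (2 ℕ.^ e) ≡ + 1 + two^ (2 ℕ.+ e) * (+ 1 + + 2 * c)) →
    ∃ λ m′ → (+ 5) ^ m′ ≈ y [mod 2 ℕ.^ (3 ℕ.+ e) ]
  by-parity (inj₁ (congruent (divides d′ d-0≡))) _ = m , -≈0⇒≈ (as-mod d′ (trans 5^m-y≡dT (trans (cong (_* two^ (2 ℕ.+ e)) (trans (sym (ℤ.+-identityʳ d)) d-0≡)) (ℤ.*-assoc d′ (+ 2) _))))
  by-parity (inj₂ d≈1) (c , 5^2^e≡) = m ℕ.+ 2 ℕ.^ e , -≈0⇒≈ (as-mod q (begin
    (+ 5) ^ (m ℕ.+ 2 ℕ.^ e) - y                       ≡⟨ cong (_- y) (trans (ℤ.^-distribˡ-+-* (+ 5) m (2 ℕ.^ e)) (cong ((+ 5) ^ m *_) 5^2^e≡)) ⟩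
    (+ 5) ^ m * (+ 1 + two^ (2 ℕ.+ e) * W) - y           ≡⟨ expand ((+ 5) ^ m) y (two^ (2 ℕ.+ e)) W ⟩
    ((+ 5) ^ m - y) + two^ (2 ℕ.+ e) * ((+ 5) ^ m * W)   ≡⟨ cong (_+ two^ (2 ℕ.+ e) * ((+ 5) ^ m * W)) 5^m-y≡dT ⟩
    d * two^ (2 ℕ.+ e) + two^ (2 ℕ.+ e) * ((+ 5) ^ m * W)   ≡⟨ factor d (two^ (2 ℕ.+ e)) ((+ 5) ^ m * W) ⟨
    two^ (2 ℕ.+ e) * (d + (+ 5) ^ m * W)                 ≡⟨ cong (two^ (2 ℕ.+ e) *_) (_∣_.equality 2∣d+5^mW) ⟩
    two^ (2 ℕ.+ e) * (q * + 2)                           ≡⟨ reassociate (two^ (2 ℕ.+ e)) q ⟩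
    q * two^ (3 ℕ.+ e)                                   ∎))
    where
    open ≡-Reasoning
    W : ℤ
    W = + 1 + + 2 * c
    expand : ∀ A y t W → A * (+ 1 + t * W) - y ≡ (A - y) + t * (A * W)
    expand = solve-∀
    factor : ∀ d t a → t * (d + a) ≡ d * t + t * a
    factor = solve-∀
    reassociate : ∀ t q → t * (q * + 2) ≡ q * (+ 2 * t)
    reassociate = solve-∀
    W≈1 : W ≈ + 1 [mod 2 ]
    W≈1 = congruent (divides c (lemma c))
      where
      lemma : ∀ c → + 1 + + 2 * c - + 1 ≡ c * + 2
      lemma = solve-∀
    2∣d+5^mW : + 2 ∣ d + (+ 5) ^ m * W
    2∣d+5^mW = ≈0⇒∣ (≈-trans (+-cong d≈1 (*-cong (≈1⇒^≈1 m (congruent (divides (+ 2) refl))) W≈1)) (congruent (divides (+ 1) refl)))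
    q : ℤ
    q = _∣_.quotient 2∣d+5^mW

powers-of-5-generate : ∀ e x → ¬ (x ≈ + 0 [mod 2 ]) → ∃ λ m → (+ 5) ^ m ≈± x [mod 2 ℕ.^ (2 ℕ.+ e) ]
powers-of-5-generate zero x x-odd with odd⇒≈±1-mod-4 x x-odd
... | inj₁ x≈1 = 0 , inj₁ (≈-sym x≈1)
... | inj₂ x≈-1 = 0 , inj₂ (≈-trans (≈-reflexive (sym (ℤ.neg-involutive (+ 1)))) (-‿cong (≈-sym x≈-1)))
powers-of-5-generate (suc e) x x-odd with powers-of-5-generate e x x-odd
... | m , inj₁ 5^m≈x = proj₁ (5^-lift e x m 5^m≈x) , inj₁ (proj₂ (5^-lift e x m 5^m≈x))
... | m , inj₂ 5^m≈-x = proj₁ (5^-lift e (- x) m 5^m≈-x) , inj₂ (proj₂ (5^-lift e (- x) m 5^m≈-x))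

-- Cyclicity of U'(n) for the listed n

≈±⇒≡± : ∀ {n g m k} → (+ g) ^ m ≈± + k [mod n ] → (g ℕ.^ m) ≡± k [mod n ]
≈±⇒≡± {g = g} {m} {k} (inj₁ (congruent n∣)) = inj₁ (∣⇒∣ᵤ (subst (_ ∣_) (cong (_- + k) (sym (pos-^ g m))) n∣))
≈±⇒≡± {g = g} {m} {k} (inj₂ (congruent n∣)) = inj₂ (∣⇒∣ᵤ (subst (_ ∣_) (trans (lemma ((+ g) ^ m) (+ k)) (cong (_+ + k) (sym (pos-^ g m)))) n∣))
  where
  lemma : ∀ a b → a - - b ≡ a + b
  lemma = solve-∀

≡±⇒≈± : ∀ {n g m k} → (g ℕ.^ m) ≡± k [mod n ] → (+ g) ^ m ≈± + k [mod n ]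
≡±⇒≈± {g = g} {m} {k} (inj₁ n∣) = inj₁ (congruent (subst (_ ∣_) (cong (_- + k) (pos-^ g m)) (∣ᵤ⇒∣ n∣)))
≡±⇒≈± {g = g} {m} {k} (inj₂ n∣) = inj₂ (congruent (subst (_ ∣_) (trans (cong (_+ + k) (pos-^ g m)) (lemma ((+ g) ^ m) (+ k))) (∣ᵤ⇒∣ n∣)))
  where
  lemma : ∀ a b → a + b ≡ a - - b
  lemma = solve-∀

invertible⇒coprime : ∀ {n x} v → + x * v ≈ + 1 [mod n ] → Coprime x n
invertible⇒coprime {n} {x} v (congruent n∣xv-1) {i} (i∣x , i∣n) =
  ℕ.∣1⇒≡1 (∣⇒∣ᵤ (subst (+ i ∣_) (lemma (+ x) v) (∣m∣n⇒∣m-n (∣m⇒∣m*n v (∣ᵤ⇒∣ {+ i} {+ x} i∣x)) (∣-trans (∣ᵤ⇒∣ i∣n) n∣xv-1))))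
  where
  lemma : ∀ a b → a * b - (a * b - + 1) ≡ + 1
  lemma = solve-∀

coprime⇒≉0 : ∀ {k n p} → Coprime k n → Prime p → p ℕ.∣ n → ¬ (+ k ≈ + 0 [mod p ])
coprime⇒≉0 k⊥n prime-p p∣n k≈0 = ¬prime[1] (subst Prime (k⊥n (∣⇒∣ᵤ (≈0⇒∣ k≈0) , p∣n)) prime-p)

U'-cyclic-from-generator : ∀ n .{{_ : NonZero n}} G v → G * v ≈ + 1 [mod n ] →
  (∀ x → Coprime x n → ∃ λ m → G ^ m ≈± + x [mod n ]) → U'-cyclic n
U'-cyclic-from-generator n G v Gv≈1 generates =
  g , (ℤ.n%ℕd<d G n , invertible⇒coprime v (≈-trans (*-congʳ v (≈-sym G≈g)) Gv≈1)) ,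
    λ k k∈U → let m , G^m≈±k = generates k (proj₂ k∈U) in m , ≈±⇒≡± {g = g} {m} (≈±-trans (inj₁ (^-cong m (≈-sym G≈g))) G^m≈±k)
  where
  g : ℕ
  g = G ℤ.%ℕ n
  G≈g : G ≈ + g [mod n ]
  G≈g = a≈a%ℕn n G

U'-cyclic-2^ : ∀ E → 3 ℕ.≤ 2 ℕ.^ E → U'-cyclic (2 ℕ.^ E)
U'-cyclic-2^ zero (s≤s ())
U'-cyclic-2^ (suc zero) (s≤s (s≤s ()))
U'-cyclic-2^ (suc (suc e)) _ = U'-cyclic-from-generator (2 ℕ.^ (2 ℕ.+ e)) (+ 5) ((+ 5) ^ (2 ℕ.^ e ℕ.∸ 1)) 5-invertible
  λ x x⊥n → powers-of-5-generate e (+ x) (coprime⇒≉0 x⊥n prime[2] (ℕ.divides (2 ℕ.^ suc e) (ℕ.*-comm 2 (2 ℕ.^ suc e))))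
  where
  instance
    2^[2+e]≢0 : NonZero (2 ℕ.^ (2 ℕ.+ e))
    2^[2+e]≢0 = ℕ.m^n≢0 2 (2 ℕ.+ e)
  5-invertible : + 5 * (+ 5) ^ (2 ℕ.^ e ℕ.∸ 1) ≈ + 1 [mod 2 ℕ.^ (2 ℕ.+ e) ]
  5-invertible = ≈-trans (≈-reflexive (cong ((+ 5) ^_) (ℕ.m+[n∸m]≡n {1} (ℕ.m^n>0 2 e)))) (5^2^e≈1 e)

^≈1⇒invertible : ∀ {n g d} → 1 ℕ.≤ d → g ^ d ≈ + 1 [mod n ] → g * g ^ (d ℕ.∸ 1) ≈ + 1 [mod n ]
^≈1⇒invertible {g = g} {suc d} _ g^d≈1 = g^d≈1

1≤φ : ∀ {p} → Prime p → ∀ k → 1 ℕ.≤ φ p k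
1≤φ {p} prime-p k = ℕ.*-mono-≤ (ℕ.m^n>0 p {{prime⇒nonZero prime-p}} (k ℕ.∸ 1)) (1≤p∸1 prime-p)

odd-prime≥3 : ∀ {p} → Prime p → p ≢ 2 → 3 ℕ.≤ p
odd-prime≥3 {p} prime-p p≢2 with ℕ.m≤n⇒m<n∨m≡n (prime≥2 prime-p)
... | inj₁ 2<p = 2<p
... | inj₂ 2≡p = ⊥-elim (p≢2 (sym 2≡p))

primes-coprime : ∀ {p q} → Prime p → Prime q → p ≢ q → Coprime p q
primes-coprime {p} {q} prime-p prime-q p≢q = prime∤⇒coprime prime-p λ p∣q → divisor-of-prime (prime⇒irreducible prime-q p∣q)
  where
  divisor-of-prime : p ≡ 1 ⊎ p ≡ q → ⊥
  divisor-of-prime (inj₁ refl) = ¬prime[1] prime-p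
  divisor-of-prime (inj₂ p≡q) = p≢q p≡q

prime-powers-coprime : ∀ {p q} → Prime p → Prime q → p ≢ q → ∀ a b → Coprime (p ℕ.^ a) (q ℕ.^ b)
prime-powers-coprime prime-p prime-q p≢q a b =
  Coprime.sym (coprime-^ˡ (Coprime.sym (coprime-^ˡ (primes-coprime prime-p prime-q p≢q) a)) b)

p∣p^k : ∀ p k → 1 ℕ.≤ k → p ℕ.∣ p ℕ.^ k
p∣p^k p (suc k) _ = ℕ.m∣m*n (p ℕ.^ k)

unit-mod-2^i≈±1 : ∀ i x → i ℕ.≤ 2 → Coprime x (2 ℕ.^ i) → + x ≈ + 1 [mod 2 ℕ.^ i ] ⊎ + x ≈ - + 1 [mod 2 ℕ.^ i ]
unit-mod-2^i≈±1 zero x _ _ = inj₁ (≈-mod-1 (+ x) (+ 1))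
unit-mod-2^i≈±1 (suc zero) x _ x⊥2 with even-or-odd (+ x)
... | inj₁ x≈0 = ⊥-elim (coprime⇒≉0 x⊥2 prime[2] (ℕ.divides 1 refl) x≈0)
... | inj₂ x≈1 = inj₁ x≈1
unit-mod-2^i≈±1 (suc (suc zero)) x _ x⊥4 = odd⇒≈±1-mod-4 (+ x) (coprime⇒≉0 x⊥4 prime[2] (ℕ.divides 2 refl))
unit-mod-2^i≈±1 (suc (suc (suc _))) x (s≤s (s≤s ())) _

^≈-from-odd-part : ∀ {A B G y} m → Coprime A B → G ≈ + 1 [mod A ] → y ≈ + 1 [mod A ] → G ^ m ≈ y [mod B ] → G ^ m ≈ y [mod A ℕ.* B ]
^≈-from-odd-part m A⊥B G≈1 y≈1 G^m≈y = ≈-combine A⊥B (≈-trans (≈1⇒^≈1 m G≈1) (≈-sym y≈1)) G^m≈y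

≈-1⇒-≈1 : ∀ {n x} → x ≈ - + 1 [mod n ] → - x ≈ + 1 [mod n ]
≈-1⇒-≈1 x≈-1 = ≈-trans (-‿cong x≈-1) (≈-reflexive (ℤ.neg-involutive (+ 1)))

-≉0 : ∀ {n x} → ¬ (x ≈ + 0 [mod n ]) → ¬ (- x ≈ + 0 [mod n ])
-≉0 {x = x} x≉0 -x≈0 = x≉0 (≈-trans (≈-reflexive (sym (ℤ.neg-involutive x))) (-‿cong -x≈0))

-- G ≡ 1 (mod 2^i) and G ≡ g (mod p^k); every unit x is ±1 mod 2^i, and the matching one of ±x is a power of g mod p^k.
U'-cyclic-2^i*p^k : ∀ i {p} k → Prime p → p ≢ 2 → 1 ℕ.≤ k → i ℕ.≤ 2 → U'-cyclic (2 ℕ.^ i ℕ.* p ℕ.^ k)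
U'-cyclic-2^i*p^k i {p} k prime-p p≢2 1≤k i≤2 = U'-cyclic-from-generator (A ℕ.* Q) G (G ^ (φ p k ℕ.∸ 1)) G-invertible G-generates
  where
  A : ℕ
  A = 2 ℕ.^ i
  Q : ℕ
  Q = p ℕ.^ k
  instance
    A*Q≢0 : NonZero (A ℕ.* Q)
    A*Q≢0 = ℕ.m*n≢0 A Q {{ℕ.m^n≢0 2 i}} {{ℕ.m^n≢0 p k {{prime⇒nonZero prime-p}}}}
  A⊥Q : Coprime A Q
  A⊥Q = prime-powers-coprime prime[2] prime-p (λ 2≡p → p≢2 (sym 2≡p)) i k
  ρ : PrimitiveRoot p k
  ρ = primitive-root-mod-odd-prime-power prime-p (odd-prime≥3 prime-p p≢2) k 1≤k
  g : ℤ
  g = root ρ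
  crt : ∃ λ X → X ≈ + 1 [mod A ] × X ≈ g [mod Q ]
  crt = chinese-remainder A⊥Q (+ 1) g
  G : ℤ
  G = proj₁ crt
  G≈1 : G ≈ + 1 [mod A ]
  G≈1 = proj₁ (proj₂ crt)
  G≈g : G ≈ g [mod Q ]
  G≈g = proj₂ (proj₂ crt)
  G-invertible : G * G ^ (φ p k ℕ.∸ 1) ≈ + 1 [mod A ℕ.* Q ]
  G-invertible = ^≈1⇒invertible (1≤φ prime-p k)
    (≈-combine A⊥Q (≈1⇒^≈1 (φ p k) G≈1) (≈-trans (^-cong (φ p k) G≈g) (^order≈1 (root-order ρ))))
  hits : ∀ y → ¬ (y ≈ + 0 [mod p ]) → y ≈ + 1 [mod A ] → ∃ λ m → G ^ m ≈ y [mod A ℕ.* Q ]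
  hits y y≉0 y≈1 = let m , g^m≈y = root-generates ρ y y≉0 in m , ^≈-from-odd-part m A⊥Q G≈1 y≈1 (≈-trans (^-cong m G≈g) g^m≈y)
  G-generates : ∀ x → Coprime x (A ℕ.* Q) → ∃ λ m → G ^ m ≈± + x [mod A ℕ.* Q ]
  G-generates x x⊥n = by-sign (unit-mod-2^i≈±1 i x i≤2 (coprime-∣ʳ x⊥n (ℕ.m∣m*n Q)))
    where
    x≉0 : ¬ (+ x ≈ + 0 [mod p ])
    x≉0 = coprime⇒≉0 x⊥n prime-p (ℕ.∣n⇒∣m*n A (p∣p^k p k 1≤k))
    by-sign : + x ≈ + 1 [mod A ] ⊎ + x ≈ - + 1 [mod A ] → ∃ λ m → G ^ m ≈± + x [mod A ℕ.* Q ]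
    by-sign (inj₁ x≈1) = let m , G^m≈x = hits (+ x) x≉0 x≈1 in m , inj₁ G^m≈x
    by-sign (inj₂ x≈-1) = let m , G^m≈-x = hits (- + x) (-≉0 x≉0) (≈-1⇒-≈1 x≈-1) in m , inj₂ G^m≈-x

ℕ-even-or-odd : ∀ n → ∃ λ h → n ≡ 2 ℕ.* h ⊎ n ≡ suc (2 ℕ.* h)
ℕ-even-or-odd zero = 0 , inj₁ refl
ℕ-even-or-odd (suc n) with ℕ-even-or-odd n
... | h , inj₁ n≡2h = h , inj₂ (cong suc n≡2h)
... | h , inj₂ n≡1+2h = suc h , inj₁ (trans (cong suc n≡1+2h) (cong suc (sym (ℕ.+-suc h (h ℕ.+ 0)))))

p∸1-even : ∀ {p} → Prime p → p ≢ 2 → 2 ℕ.∣ p ℕ.∸ 1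
p∸1-even {p} prime-p p≢2 = by-parity (ℕ-even-or-odd (p ℕ.∸ 1))
  where
  lemma : ∀ h → suc (suc (2 ℕ.* h)) ≡ suc h ℕ.* 2
  lemma = ℕ-Solver.solve-∀
  2∣p⇒2≡p : 2 ℕ.∣ p → 2 ≡ p
  2∣p⇒2≡p 2∣p with prime⇒irreducible prime-p 2∣p
  ... | inj₂ 2≡p = 2≡p
  by-parity : (∃ λ h → p ℕ.∸ 1 ≡ 2 ℕ.* h ⊎ p ℕ.∸ 1 ≡ suc (2 ℕ.* h)) → 2 ℕ.∣ p ℕ.∸ 1
  by-parity (h , inj₁ p-1≡2h) = ℕ.divides h (trans p-1≡2h (ℕ.*-comm 2 h))
  by-parity (h , inj₂ p-1≡1+2h) = ⊥-elim (p≢2 (sym (2∣p⇒2≡p (ℕ.divides (suc h)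
    (trans (sym (ℕ.m+[n∸m]≡n {1} {p} (ℕ.<-trans (s≤s z≤n) (prime≥2 prime-p)))) (trans (cong suc p-1≡1+2h) (lemma h)))))))

2∣φ : ∀ {p} → Prime p → p ≢ 2 → ∀ k → 2 ℕ.∣ φ p k
2∣φ {p} prime-p p≢2 k = ℕ.∣n⇒∣m*n (p ℕ.^ (k ℕ.∸ 1)) (p∸1-even prime-p p≢2)

exponent-crt : ∀ {a b} .{{_ : NonZero (a ℕ.* b)}} → Coprime a b → ∀ α β → ∃ λ m → + m ≈ + α [mod a ] × + m ≈ + β [mod b ]
exponent-crt {a} {b} a⊥b α β =
  X ℤ.%ℕ (a ℕ.* b) , ≈-trans (≈-mod-∣ (ℕ.m∣m*n b) m≈X) X≈α , ≈-trans (≈-mod-∣ (ℕ.n∣m*n a) m≈X) X≈β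
  where
  crt : ∃ λ X → X ≈ + α [mod a ] × X ≈ + β [mod b ]
  crt = chinese-remainder a⊥b (+ α) (+ β)
  X : ℤ
  X = proj₁ crt
  X≈α : X ≈ + α [mod a ]
  X≈α = proj₁ (proj₂ crt)
  X≈β : X ≈ + β [mod b ]
  X≈β = proj₂ (proj₂ crt)
  m≈X : + (X ℤ.%ℕ (a ℕ.* b)) ≈ X [mod a ℕ.* b ]
  m≈X = ≈-sym (a≈a%ℕn (a ℕ.* b) X)

*-≈-mod-* : ∀ {a m α} c → + m ≈ + α [mod a ] → + (c ℕ.* m) ≈ + (c ℕ.* α) [mod c ℕ.* a ]
*-≈-mod-* {a} {m} {α} c (congruent (divides q eq)) = congruent (divides q (begin
  + (c ℕ.* m) - + (c ℕ.* α)  ≡⟨ cong₂ _-_ (ℤ.pos-* c m) (ℤ.pos-* c α) ⟩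
  + c * + m - + c * + α      ≡⟨ lemma₁ (+ c) (+ m) (+ α) ⟩
  + c * (+ m - + α)          ≡⟨ cong (+ c *_) eq ⟩
  + c * (q * + a)            ≡⟨ lemma₂ (+ c) q (+ a) ⟩
  q * (+ c * + a)            ≡⟨ cong (q *_) (ℤ.pos-* c a) ⟨
  q * + (c ℕ.* a)            ∎))
  where
  open ≡-Reasoning
  lemma₁ : ∀ c m α → c * m - c * α ≡ c * (m - α)
  lemma₁ = solve-∀
  lemma₂ : ∀ c q a → c * (q * a) ≡ q * (c * a)
  lemma₂ = solve-∀

chinese-remainder₃ : ∀ {A B C} → Coprime A B → Coprime A C → Coprime B C → ∀ a b c →
  ∃ λ X → X ≈ a [mod A ] × X ≈ b [mod B ] × X ≈ c [mod C ]
chinese-remainder₃ {A} {B} {C} A⊥B A⊥C B⊥C a b c =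
  X , X≈a , ≈-trans (≈-mod-∣ (ℕ.m∣m*n C) X≈Y) Y≈b , ≈-trans (≈-mod-∣ (ℕ.n∣m*n B) X≈Y) Y≈c
  where
  inner : ∃ λ Y → Y ≈ b [mod B ] × Y ≈ c [mod C ]
  inner = chinese-remainder B⊥C b c
  Y : ℤ
  Y = proj₁ inner
  Y≈b : Y ≈ b [mod B ]
  Y≈b = proj₁ (proj₂ inner)
  Y≈c : Y ≈ c [mod C ]
  Y≈c = proj₂ (proj₂ inner)
  outer : ∃ λ X → X ≈ a [mod A ] × X ≈ Y [mod B ℕ.* C ]
  outer = chinese-remainder (coprime-*ʳ A⊥B A⊥C) a Y
  X : ℤ
  X = proj₁ outer
  X≈a : X ≈ a [mod A ]
  X≈a = proj₁ (proj₂ outer)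
  X≈Y : X ≈ Y [mod B ℕ.* C ]
  X≈Y = proj₂ (proj₂ outer)

≈-combine₃ : ∀ {A B C x y} → Coprime A B → Coprime A C → Coprime B C →
  x ≈ y [mod A ] → x ≈ y [mod B ] → x ≈ y [mod C ] → x ≈ y [mod A ℕ.* (B ℕ.* C) ]
≈-combine₃ A⊥B A⊥C B⊥C x≈y x≈y′ x≈y″ = ≈-combine (coprime-*ʳ A⊥B A⊥C) x≈y (≈-combine B⊥C x≈y′ x≈y″)

1≈-1-mod-2^j : ∀ j → j ℕ.≤ 1 → + 1 ≈ - + 1 [mod 2 ℕ.^ j ]
1≈-1-mod-2^j zero _ = ≈-mod-1 _ _
1≈-1-mod-2^j (suc zero) _ = congruent (divides (+ 1) refl)
1≈-1-mod-2^j (suc (suc _)) (s≤s ())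

-- With φ(q^k) = 2a′, a′ odd and coprime to φ(r^t), take H ≡ 1, g₁², g₂ modulo 2^j, q^k, r^t.  A unit x
-- is g₁^α ≡ g₂^β; for even α it is a power of H, for odd α so is -x = g₁^(α + a′) = g₂^(β + φ(r^t)/2).
module _ (j : ℕ) {q r : ℕ} (k t : ℕ) (prime-q : Prime q) (q≢2 : q ≢ 2) (prime-r : Prime r) (r≢2 : r ≢ 2) (q≢r : q ≢ r)
  (1≤k : 1 ℕ.≤ k) (1≤t : 1 ℕ.≤ t) (j≤1 : j ℕ.≤ 1)
  (a′ : ℕ) (φ≡2a′ : φ q k ≡ 2 ℕ.* a′) (a′-odd : ¬ (2 ℕ.∣ a′)) (a′⊥b : Coprime a′ (φ r t)) where

  private
    A : ℕ
    A = 2 ℕ.^ j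
    Q : ℕ
    Q = q ℕ.^ k
    R : ℕ
    R = r ℕ.^ t
    a : ℕ
    a = φ q k
    b : ℕ
    b = φ r t
    n : ℕ
    n = A ℕ.* (Q ℕ.* R)

    instance
      n≢0 : NonZero n
      n≢0 = ℕ.m*n≢0 A (Q ℕ.* R) {{ℕ.m^n≢0 2 j}} {{ℕ.m*n≢0 Q R {{ℕ.m^n≢0 q k {{prime⇒nonZero prime-q}}}} {{ℕ.m^n≢0 r t {{prime⇒nonZero prime-r}}}}}}
      a′b≢0 : NonZero (a′ ℕ.* b)
      a′b≢0 = ℕ.m*n≢0 a′ b {{ℕ.>-nonZero (*-positive⇒positive (1≤φ prime-q k) (trans φ≡2a′ (ℕ.*-comm 2 a′)))}} {{ℕ.>-nonZero (1≤φ prime-r t)}}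

    A⊥Q : Coprime A Q
    A⊥Q = prime-powers-coprime prime[2] prime-q (λ 2≡q → q≢2 (sym 2≡q)) j k
    A⊥R : Coprime A R
    A⊥R = prime-powers-coprime prime[2] prime-r (λ 2≡r → r≢2 (sym 2≡r)) j t
    Q⊥R : Coprime Q R
    Q⊥R = prime-powers-coprime prime-q prime-r q≢r k t

    ρ₁ : PrimitiveRoot q k
    ρ₁ = primitive-root-mod-odd-prime-power prime-q (odd-prime≥3 prime-q q≢2) k 1≤k
    ρ₂ : PrimitiveRoot r t
    ρ₂ = primitive-root-mod-odd-prime-power prime-r (odd-prime≥3 prime-r r≢2) t 1≤t
    g₁ : ℤ
    g₁ = root ρ₁
    g₂ : ℤ
    g₂ = root ρ₂

    crt : ∃ λ X → X ≈ + 1 [mod A ] × X ≈ g₁ ^ 2 [mod Q ] × X ≈ g₂ [mod R ]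
    crt = chinese-remainder₃ A⊥Q A⊥R Q⊥R (+ 1) (g₁ ^ 2) g₂
    H : ℤ
    H = proj₁ crt
    H≈1 : H ≈ + 1 [mod A ]
    H≈1 = proj₁ (proj₂ crt)
    H≈g₁² : H ≈ g₁ ^ 2 [mod Q ]
    H≈g₁² = proj₁ (proj₂ (proj₂ crt))
    H≈g₂ : H ≈ g₂ [mod R ]
    H≈g₂ = proj₂ (proj₂ (proj₂ crt))

    H^m≈g₁^2m : ∀ m → H ^ m ≈ g₁ ^ (2 ℕ.* m) [mod Q ]
    H^m≈g₁^2m m = ≈-trans (^-cong m H≈g₁²) (≈-reflexive (sym (^-* g₁ 2 m)))

    H-invertible : H * H ^ (a ℕ.* b ℕ.∸ 1) ≈ + 1 [mod n ]
    H-invertible = ^≈1⇒invertible (ℕ.*-mono-≤ (1≤φ prime-q k) (1≤φ prime-r t)) (≈-combine₃ A⊥Q A⊥R Q⊥R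
      (≈1⇒^≈1 (a ℕ.* b) H≈1)
      (≈-trans (H^m≈g₁^2m (a ℕ.* b)) (^-multiple≈1 g₁ a (^order≈1 (root-order ρ₁)) (ℕ.divides (2 ℕ.* b) (lemma a b))))
      (≈-trans (^-cong (a ℕ.* b) H≈g₂) (^-multiple≈1 g₂ b (^order≈1 (root-order ρ₂)) (ℕ.n∣m*n a))))
      where
      lemma : ∀ a b → 2 ℕ.* (a ℕ.* b) ≡ 2 ℕ.* b ℕ.* a
      lemma = ℕ-Solver.solve-∀

    hits : ∀ y α₀ β → g₁ ^ (2 ℕ.* α₀) ≈ y [mod Q ] → g₂ ^ β ≈ y [mod R ] → y ≈ + 1 [mod A ] → ∃ λ m → H ^ m ≈ y [mod n ]
    hits y α₀ β g₁^2α₀≈y g₂^β≈y y≈1 = m , ≈-combine₃ A⊥Q A⊥R Q⊥R (≈-trans (≈1⇒^≈1 m H≈1) (≈-sym y≈1))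
      (≈-trans (H^m≈g₁^2m m) (≈-trans (^-≈-exponent (^order≈1 (root-order ρ₁)) (subst (λ d → + (2 ℕ.* m) ≈ + (2 ℕ.* α₀) [mod d ]) (sym φ≡2a′) (*-≈-mod-* 2 m≈α₀))) g₁^2α₀≈y))
      (≈-trans (^-cong m H≈g₂) (≈-trans (^-≈-exponent (^order≈1 (root-order ρ₂)) m≈β) g₂^β≈y))
      where
      exps : ∃ λ m → + m ≈ + α₀ [mod a′ ] × + m ≈ + β [mod b ]
      exps = exponent-crt a′⊥b α₀ β
      m : ℕ
      m = proj₁ exps
      m≈α₀ : + m ≈ + α₀ [mod a′ ]
      m≈α₀ = proj₁ (proj₂ exps)
      m≈β : + m ≈ + β [mod b ]
      m≈β = proj₂ (proj₂ exps)

    g₁^a′≈-1 : g₁ ^ a′ ≈ - + 1 [mod Q ]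
    g₁^a′≈-1 = half-order-power≈-1 {k = k} {ψ = a′} prime-q (odd-prime≥3 prime-q q≢2) (*-positive⇒positive (1≤φ prime-q k) (trans φ≡2a′ (ℕ.*-comm 2 a′)))
      (subst (g₁ HasOrder_[mod Q ]) φ≡2a′ (root-order ρ₁))

    b″ : ℕ
    b″ = ℕ.quotient (2∣φ prime-r r≢2 t)

    g₂^b″≈-1 : g₂ ^ b″ ≈ - + 1 [mod R ]
    g₂^b″≈-1 = half-order-power≈-1 {k = t} {ψ = b″} prime-r (odd-prime≥3 prime-r r≢2) (*-positive⇒positive (1≤φ prime-r t) b≡b″*2)
      (subst (g₂ HasOrder_[mod R ]) (trans b≡b″*2 (ℕ.*-comm b″ 2)) (root-order ρ₂))
      where
      b≡b″*2 : b ≡ b″ ℕ.* 2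
      b≡b″*2 = ℕ._∣_.equality (2∣φ prime-r r≢2 t)

    H-generates : ∀ x → Coprime x n → ∃ λ m → H ^ m ≈± + x [mod n ]
    H-generates x x⊥n = by-parity (ℕ-even-or-odd α) (ℕ-even-or-odd a′)
      where
      x≉0-mod-q : ¬ (+ x ≈ + 0 [mod q ])
      x≉0-mod-q = coprime⇒≉0 x⊥n prime-q (ℕ.∣n⇒∣m*n A (ℕ.∣m⇒∣m*n R (p∣p^k q k 1≤k)))
      x≉0-mod-r : ¬ (+ x ≈ + 0 [mod r ])
      x≉0-mod-r = coprime⇒≉0 x⊥n prime-r (ℕ.∣n⇒∣m*n A (ℕ.∣n⇒∣m*n Q (p∣p^k r t 1≤t)))
      x≈1 : + x ≈ + 1 [mod A ]
      x≈1 with unit-mod-2^i≈±1 j x (ℕ.≤-trans j≤1 (s≤s z≤n)) (coprime-∣ʳ x⊥n (ℕ.m∣m*n (Q ℕ.* R)))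
      ... | inj₁ x≈1 = x≈1
      ... | inj₂ x≈-1 = ≈-trans x≈-1 (≈-sym (1≈-1-mod-2^j j j≤1))
      -x≈1 : - + x ≈ + 1 [mod A ]
      -x≈1 = ≈-trans (-‿cong x≈1) (≈-sym (1≈-1-mod-2^j j j≤1))
      α : ℕ
      α = proj₁ (root-generates ρ₁ (+ x) x≉0-mod-q)
      g₁^α≈x : g₁ ^ α ≈ + x [mod Q ]
      g₁^α≈x = proj₂ (root-generates ρ₁ (+ x) x≉0-mod-q)
      β : ℕ
      β = proj₁ (root-generates ρ₂ (+ x) x≉0-mod-r)
      g₂^β≈x : g₂ ^ β ≈ + x [mod R ]
      g₂^β≈x = proj₂ (root-generates ρ₂ (+ x) x≉0-mod-r)
      times-1 : ∀ {M u v} → u ≈ + x [mod M ] → v ≈ - + 1 [mod M ] → u * v ≈ - + x [mod M ]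
      times-1 u≈x v≈-1 = ≈-trans (*-cong u≈x v≈-1) (≈-reflexive (trans (sym (ℤ.neg-distribʳ-* (+ x) (+ 1))) (cong -_ (ℤ.*-identityʳ (+ x)))))
      by-parity : (∃ λ h → α ≡ 2 ℕ.* h ⊎ α ≡ suc (2 ℕ.* h)) → (∃ λ h → a′ ≡ 2 ℕ.* h ⊎ a′ ≡ suc (2 ℕ.* h)) → ∃ λ m → H ^ m ≈± + x [mod n ]
      by-parity (h , inj₁ α≡2h) _ =
        let m , H^m≈x = hits (+ x) h β (subst (λ e → g₁ ^ e ≈ + x [mod Q ]) α≡2h g₁^α≈x) g₂^β≈x x≈1 in m , inj₁ H^m≈x
      by-parity (h , inj₂ α≡1+2h) (h′ , inj₂ a′≡1+2h′) =
        let m , H^m≈-x = hits (- + x) (h ℕ.+ h′ ℕ.+ 1) (β ℕ.+ b″) g₁^…≈-x g₂^…≈-x -x≈1 in m , inj₂ H^m≈-x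
        where
        lemma : ∀ h h′ → 2 ℕ.* (h ℕ.+ h′ ℕ.+ 1) ≡ suc (2 ℕ.* h) ℕ.+ suc (2 ℕ.* h′)
        lemma = ℕ-Solver.solve-∀
        g₁^…≈-x : g₁ ^ (2 ℕ.* (h ℕ.+ h′ ℕ.+ 1)) ≈ - + x [mod Q ]
        g₁^…≈-x = ≈-trans (≈-reflexive (trans (cong (g₁ ^_) (trans (lemma h h′) (sym (cong₂ ℕ._+_ α≡1+2h a′≡1+2h′)))) (ℤ.^-distribˡ-+-* g₁ α a′)))
          (times-1 g₁^α≈x g₁^a′≈-1)
        g₂^…≈-x : g₂ ^ (β ℕ.+ b″) ≈ - + x [mod R ]
        g₂^…≈-x = ≈-trans (≈-reflexive (ℤ.^-distribˡ-+-* g₂ β b″)) (times-1 g₂^β≈x g₂^b″≈-1)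
      by-parity (h , inj₂ _) (h′ , inj₁ a′≡2h′) = ⊥-elim (a′-odd (ℕ.divides h′ (trans a′≡2h′ (ℕ.*-comm 2 h′))))

  U'-cyclic-2^j*q^k*r^t : U'-cyclic (2 ℕ.^ j ℕ.* (q ℕ.^ k ℕ.* r ℕ.^ t))
  U'-cyclic-2^j*q^k*r^t = U'-cyclic-from-generator n H (H ^ (a ℕ.* b ℕ.∸ 1)) H-invertible H-generates

¬2∣odd : ∀ {n} h → n ≡ suc (2 ℕ.* h) → ¬ (2 ℕ.∣ n)
¬2∣odd h n≡1+2h (ℕ.divides c n≡c*2) = ℕ.even≢odd c h (trans (ℕ.*-comm 2 c) (trans (sym n≡c*2) n≡1+2h))

gcd≡2⇒half-coprime : ∀ {a b a′} → gcd a b ≡ 2 → a ≡ 2 ℕ.* a′ → ¬ (2 ℕ.∣ a′) → Coprime a′ b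
gcd≡2⇒half-coprime {a} {b} {a′} gcd≡2 a≡2a′ a′-odd {i} (i∣a′ , i∣b) = i≢2 (prime⇒irreducible prime[2] i∣2)
  where
  i∣2 : i ℕ.∣ 2
  i∣2 = subst (i ℕ.∣_) gcd≡2 (gcd-greatest (subst (i ℕ.∣_) (sym a≡2a′) (ℕ.∣n⇒∣m*n 2 i∣a′)) i∣b)
  i≢2 : i ≡ 1 ⊎ i ≡ 2 → i ≡ 1
  i≢2 (inj₁ i≡1) = i≡1
  i≢2 (inj₂ refl) = ⊥-elim (a′-odd i∣a′)

Form⇒U'-cyclic : ∀ n → 3 ℕ.≤ n → Form1 n ⊎ Form2 n → U'-cyclic n
Form⇒U'-cyclic n 3≤n (inj₁ (i , p , k , prime-p , 1≤k , i≤2 , refl)) with p ℕ.≟ 2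
... | yes refl = subst U'-cyclic (ℕ.^-distribˡ-+-* 2 i k) (U'-cyclic-2^ (i ℕ.+ k) (subst (3 ℕ.≤_) (sym (ℕ.^-distribˡ-+-* 2 i k)) 3≤n))
... | no p≢2 = U'-cyclic-2^i*p^k i k prime-p p≢2 1≤k i≤2
Form⇒U'-cyclic n 3≤n (inj₂ (j , q , k , r , t , prime-q , q≢2 , prime-r , r≢2 , 1≤k , 1≤t , j≤1 , refl , gcd≡2)) with q ℕ.≟ r
... | yes refl = subst U'-cyclic (trans (cong (2 ℕ.^ j ℕ.*_) (ℕ.^-distribˡ-+-* q k t)) (sym (ℕ.*-assoc (2 ℕ.^ j) (q ℕ.^ k) (q ℕ.^ t))))
  (U'-cyclic-2^i*p^k j (k ℕ.+ t) prime-q q≢2 (ℕ.≤-trans 1≤k (ℕ.m≤m+n k t)) (ℕ.≤-trans j≤1 (s≤s z≤n)))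
... | no q≢r = by-parity (2∣φ prime-q q≢2 k) (2∣φ prime-r r≢2 t)
  where
  by-parity : 2 ℕ.∣ φ q k → 2 ℕ.∣ φ r t → U'-cyclic (2 ℕ.^ j ℕ.* q ℕ.^ k ℕ.* r ℕ.^ t)
  by-parity (ℕ.divides a′ a≡a′*2) (ℕ.divides b′ b≡b′*2) with ℕ-even-or-odd a′ | ℕ-even-or-odd b′
  ... | h , inj₂ a′≡1+2h | _ = subst U'-cyclic (sym (ℕ.*-assoc (2 ℕ.^ j) (q ℕ.^ k) (r ℕ.^ t)))
    (U'-cyclic-2^j*q^k*r^t j k t prime-q q≢2 prime-r r≢2 q≢r 1≤k 1≤t j≤1 a′ a≡2a′ (¬2∣odd h a′≡1+2h) (gcd≡2⇒half-coprime gcd≡2 a≡2a′ (¬2∣odd h a′≡1+2h)))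
    where
    a≡2a′ : φ q k ≡ 2 ℕ.* a′
    a≡2a′ = trans a≡a′*2 (ℕ.*-comm a′ 2)
  ... | _ | h , inj₂ b′≡1+2h = subst U'-cyclic (trans (cong (2 ℕ.^ j ℕ.*_) (ℕ.*-comm (r ℕ.^ t) (q ℕ.^ k))) (sym (ℕ.*-assoc (2 ℕ.^ j) (q ℕ.^ k) (r ℕ.^ t))))
    (U'-cyclic-2^j*q^k*r^t j t k prime-r r≢2 prime-q q≢2 (q≢r ∘ sym) 1≤t 1≤k j≤1 b′ b≡2b′ (¬2∣odd h b′≡1+2h)
      (gcd≡2⇒half-coprime (trans (gcd-comm (φ r t) (φ q k)) gcd≡2) b≡2b′ (¬2∣odd h b′≡1+2h)))
    where
    b≡2b′ : φ r t ≡ 2 ℕ.* b′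
    b≡2b′ = trans b≡b′*2 (ℕ.*-comm b′ 2)
  ... | h , inj₁ a′≡2h | h′ , inj₁ b′≡2h′ = ⊥-elim (ℕ.>⇒∤ (s≤s (s≤s (s≤s z≤n))) (subst (4 ℕ.∣_) gcd≡2 (gcd-greatest (4∣ h a≡a′*2 a′≡2h) (4∣ h′ b≡b′*2 b′≡2h′))))
    where
    4∣ : ∀ {a a′} h → a ≡ a′ ℕ.* 2 → a′ ≡ 2 ℕ.* h → 4 ℕ.∣ a
    4∣ h refl refl = ℕ.divides h (lemma h)
      where
      lemma : ∀ h → 2 ℕ.* h ℕ.* 2 ≡ h ℕ.* 4
      lemma = ℕ-Solver.solve-∀

-- Subgroups of prime order of a cyclic U'(n)

-- Two of the n + 1 powers G⁰, …, Gⁿ agree mod n; cancel the smaller one.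
invertible⇒^≈1 : ∀ n .{{_ : NonZero n}} G v → G * v ≈ + 1 [mod n ] → ∃ λ N → G ^ suc N ≈ + 1 [mod n ]
invertible⇒^≈1 n G v Gv≈1 with i , j , i<j , same-residue ← Fin.pigeonhole (ℕ.n<1+n n) (λ i → fromℕ< (ℤ.n%ℕd<d (G ^ toℕ i) n)) =
  toℕ j ℕ.∸ suc (toℕ i) , *-cancelˡ-unit {u = G ^ toℕ i} (^-unit G v (toℕ i) Gv≈1) (begin
    G ^ toℕ i * G ^ suc (toℕ j ℕ.∸ suc (toℕ i)) ≡⟨ ℤ.^-distribˡ-+-* G (toℕ i) _ ⟨
    G ^ (toℕ i ℕ.+ suc (toℕ j ℕ.∸ suc (toℕ i))) ≡⟨ cong (G ^_) (trans (cong (toℕ i ℕ.+_) (sym (ℕ.+-∸-assoc 1 i<j))) (ℕ.m+[n∸m]≡n (ℕ.<⇒≤ i<j))) ⟩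
    G ^ toℕ j                                   ≈⟨ a≈a%ℕn n (G ^ toℕ j) ⟩
    + (G ^ toℕ j ℤ.%ℕ n)                        ≡⟨ cong +_ (trans (sym (Fin.toℕ-fromℕ< _)) (trans (cong toℕ (sym same-residue)) (Fin.toℕ-fromℕ< _))) ⟩
    + (G ^ toℕ i ℤ.%ℕ n)                        ≈⟨ a≈a%ℕn n (G ^ toℕ i) ⟨
    G ^ toℕ i                                   ≡⟨ ℤ.*-identityʳ (G ^ toℕ i) ⟨
    G ^ toℕ i * + 1                             ∎)
  where open ≈-Reasoning n

least-witness : (P : ℕ → Set) → (∀ i → Dec (P i)) → ∀ k → P k → ∃ λ N → P N × (∀ i → i ℕ.< N → ¬ P i)
least-witness P P? k Pk = least k (<-wellFounded k) Pk
  where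
  least : ∀ k → Acc ℕ._<_ k → P k → ∃ λ N → P N × (∀ i → i ℕ.< N → ¬ P i)
  least k (acc smaller) Pk with search-below P P? k
  ... | inj₁ (i , i<k , Pi) = least i (smaller i<k) Pi
  ... | inj₂ none-below = k , Pk , none-below

^-multiple≈±1 : ∀ {n} g d {j} → g ^ d ≈± + 1 [mod n ] → d ℕ.∣ j → g ^ j ≈± + 1 [mod n ]
^-multiple≈±1 g d g^d≈±1 (ℕ.divides q refl) =
  ≈±-trans (inj₁ (≈-reflexive (trans (cong (g ^_) (ℕ.*-comm q d)) (^-* g d q)))) (≈±-trans (≈±-^-cong q g^d≈±1) (inj₁ (≈-reflexive (ℤ.^-zeroˡ q))))

^-≈±-exponent : ∀ {n g d m m′} → g ^ d ≈± + 1 [mod n ] → + m ≈ + m′ [mod d ] → g ^ m ≈± g ^ m′ [mod n ]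
^-≈±-exponent {n} {g} {d} {m} {m′} g^d≈±1 m≈m′ = by-order (ℕ.≤-total m′ m)
  where
  larger : ∀ {m m′} → m′ ℕ.≤ m → + m ≈ + m′ [mod d ] → g ^ m ≈± g ^ m′ [mod n ]
  larger {m} {m′} m′≤m m≈m′ = ≈±-trans (inj₁ (≈-reflexive (trans (cong (g ^_) (sym (ℕ.m+[n∸m]≡n m′≤m))) (ℤ.^-distribˡ-+-* g m′ (m ℕ.∸ m′)))))
    (≈±-trans (≈±-*-cong (≈±-refl {a = g ^ m′}) (^-multiple≈±1 g d g^d≈±1 (≈⇒∣∸ m′≤m m≈m′))) (inj₁ (≈-reflexive (ℤ.*-identityʳ (g ^ m′)))))
  by-order : m′ ℕ.≤ m ⊎ m ℕ.≤ m′ → g ^ m ≈± g ^ m′ [mod n ]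
  by-order (inj₁ m′≤m) = larger m′≤m m≈m′
  by-order (inj₂ m≤m′) = ≈±-sym (larger m≤m′ (≈-sym m≈m′))

infix 4 _HasOrder±_[mod_]

record _HasOrder±_[mod_] (g : ℤ) (d n : ℕ) : Set where
  constructor has-order±
  field
    ^order≈±1 : g ^ d ≈± + 1 [mod n ]
    order±∣ : ∀ j → g ^ j ≈± + 1 [mod n ] → d ℕ.∣ j
open _HasOrder±_[mod_] public

invertible⇒has-order± : ∀ n .{{_ : NonZero n}} G v → G * v ≈ + 1 [mod n ] → ∃ λ N → G HasOrder± suc N [mod n ]
invertible⇒has-order± n G v Gv≈1 = from-least (least-witness (λ i → G ^ suc i ≈± + 1 [mod n ]) (λ i → ≈±-dec n _ _)
  (proj₁ (invertible⇒^≈1 n G v Gv≈1)) (inj₁ (proj₂ (invertible⇒^≈1 n G v Gv≈1))))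
  where
  from-least : (∃ λ N′ → G ^ suc N′ ≈± + 1 [mod n ] × (∀ i → i ℕ.< N′ → ¬ (G ^ suc i ≈± + 1 [mod n ]))) →
    ∃ λ N → G HasOrder± suc N [mod n ]
  from-least (N′ , G^[1+N′]≈±1 , below) = N′ , has-order± G^[1+N′]≈±1 λ j G^j≈±1 → order-divides j G^j≈±1 (residue (suc N′) (+ j))
    where
    order-divides : ∀ j → G ^ j ≈± + 1 [mod n ] → (∃ λ r → r ℕ.< suc N′ × + j ≈ + r [mod suc N′ ]) → suc N′ ℕ.∣ j
    order-divides j G^j≈±1 (zero , _ , j≈0) = ≈⇒∣∸ z≤n j≈0
    order-divides j G^j≈±1 (suc r , s≤s r<N′ , j≈1+r) = ⊥-elim (below r r<N′ (≈±-trans (^-≈±-exponent G^[1+N′]≈±1 (≈-sym j≈1+r)) G^j≈±1))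

-- i = β α⁻¹ (mod d).
exponent-solution : ∀ {d} → Prime d → ∀ α β c → ¬ (d ℕ.∣ α) → ∃ λ i → i ℕ.< d × + (α ℕ.* c ℕ.* i) ≈ + (β ℕ.* c) [mod c ℕ.* d ]
exponent-solution {d} prime-d α β c d∤α =
  i , ℤ.n%ℕd<d (s * + β) d , subst₂ (λ u v → + u ≈ + v [mod c ℕ.* d ]) (rearrange c i α) (ℕ.*-comm c β) (*-≈-mod-* c iα≈β)
  where
  instance
    d≢0 : NonZero d
    d≢0 = prime⇒nonZero prime-d
  s : ℤ
  s = proj₁ (coprime⇒invertible (Coprime.sym (prime∤⇒coprime prime-d d∤α)))
  sα≈1 : s * + α ≈ + 1 [mod d ]
  sα≈1 = proj₂ (coprime⇒invertible (Coprime.sym (prime∤⇒coprime prime-d d∤α)))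
  i : ℕ
  i = (s * + β) ℤ.%ℕ d
  rearrange : ∀ c i α → c ℕ.* (i ℕ.* α) ≡ α ℕ.* c ℕ.* i
  rearrange = ℕ-Solver.solve-∀
  swap : ∀ s b a → s * b * a ≡ b * (s * a)
  swap = solve-∀
  iα≈β : + (i ℕ.* α) ≈ + β [mod d ]
  iα≈β = ≈-trans (≈-reflexive (ℤ.pos-* i α)) (≈-trans (*-congʳ (+ α) (≈-sym (a≈a%ℕn d (s * + β))))
    (≈-trans (≈-reflexive (swap s (+ β) (+ α))) (≈-trans (*-congˡ (+ β) sα≈1) (≈-reflexive (ℤ.*-identityʳ (+ β))))))

PrimeOrderSubgroupsUnique : ℕ → Set
PrimeOrderSubgroupsUnique n = ∀ {d} → Prime d → ∀ y z → y ^ d ≈± + 1 [mod n ] → (∀ s → 1 ℕ.≤ s → s ℕ.< d → ¬ (y ^ s ≈± + 1 [mod n ])) →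
  z ^ d ≈± + 1 [mod n ] → ∃ λ i → i ℕ.< d × z ≈± y ^ i [mod n ]

^≈±1⇒invertible : ∀ {n} x e → x ^ suc e ≈± + 1 [mod n ] → ∃ λ w → x * w ≈ + 1 [mod n ]
^≈±1⇒invertible x e (inj₁ x^[1+e]≈1) = x ^ e , x^[1+e]≈1
^≈±1⇒invertible x e (inj₂ x^[1+e]≈-1) = - (x ^ e) , ≈-trans (≈-reflexive (sym (ℤ.neg-distribʳ-* x (x ^ e)))) (≈-1⇒-≈1 x^[1+e]≈-1)

module _ (n : ℕ) .{{_ : NonZero n}} (g : ℕ) (g∈U : InU n g) (gen : ∀ k → InU n k → ∃ λ m → (g ℕ.^ m) ≡± k [mod n ]) where

  private
    G : ℤ
    G = + g

    G-invertible : ∃ λ v → G * v ≈ + 1 [mod n ]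
    G-invertible = let s , sg≈1 = coprime⇒invertible (proj₂ g∈U) in s , ≈-trans (≈-reflexive (ℤ.*-comm G s)) sg≈1

    order : ∃ λ N → G HasOrder± suc N [mod n ]
    order = invertible⇒has-order± n G (proj₁ G-invertible) (proj₂ G-invertible)
    D : ℕ
    D = suc (proj₁ order)
    G-order : G HasOrder± D [mod n ]
    G-order = proj₂ order

    power-of-G : ∀ x w → x * w ≈ + 1 [mod n ] → ∃ λ m → G ^ m ≈± x [mod n ]
    power-of-G x w xw≈1 = m , ≈±-trans (≡±⇒≈± {n} {g} {m} G^m≡±r) (inj₁ (≈-sym x≈r))
      where
      x≈r : x ≈ + (x ℤ.%ℕ n) [mod n ]
      x≈r = a≈a%ℕn n x
      r∈U : InU n (x ℤ.%ℕ n)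
      r∈U = ℤ.n%ℕd<d x n , invertible⇒coprime w (≈-trans (*-congʳ w (≈-sym x≈r)) xw≈1)
      m : ℕ
      m = proj₁ (gen _ r∈U)
      G^m≡±r : (g ℕ.^ m) ≡± (x ℤ.%ℕ n) [mod n ]
      G^m≡±r = proj₂ (gen _ r∈U)

    ^-exponent-* : ∀ {x} a k → G ^ a ≈± x [mod n ] → G ^ (a ℕ.* k) ≈± x ^ k [mod n ]
    ^-exponent-* a k G^a≈±x = ≈±-trans (inj₁ (≈-reflexive (^-* G a k))) (≈±-^-cong k G^a≈±x)

    order∣ad : ∀ {d y} a → G ^ a ≈± y [mod n ] → y ^ d ≈± + 1 [mod n ] → D ℕ.∣ a ℕ.* d
    order∣ad {d} a G^a≈±y y^d≈±1 = order±∣ G-order (a ℕ.* d) (≈±-trans (^-exponent-* a d G^a≈±y) y^d≈±1)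

  -- With y ≡ ±G^a, z ≡ ±G^b and D the order of G, prime d must divide D = d D″ with a = α D″, b = β D″, d ∤ α;
  -- then z ≡ ±y^i for i α ≡ β (mod d).
  U'-cyclic⇒prime-order-subgroups-unique : PrimeOrderSubgroupsUnique n
  U'-cyclic⇒prime-order-subgroups-unique {d@(suc d′)} prime-d y z y^d≈±1 y^s≉±1 z^d≈±1 = by-divisibility (d ℕ.∣? D)
    where
    y-is-power : ∃ λ a → G ^ a ≈± y [mod n ]
    y-is-power = power-of-G y (proj₁ (^≈±1⇒invertible y d′ y^d≈±1)) (proj₂ (^≈±1⇒invertible y d′ y^d≈±1))
    z-is-power : ∃ λ b → G ^ b ≈± z [mod n ]
    z-is-power = power-of-G z (proj₁ (^≈±1⇒invertible z d′ z^d≈±1)) (proj₂ (^≈±1⇒invertible z d′ z^d≈±1))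
    a : ℕ
    a = proj₁ y-is-power
    G^a≈±y : G ^ a ≈± y [mod n ]
    G^a≈±y = proj₂ y-is-power
    b : ℕ
    b = proj₁ z-is-power
    G^b≈±z : G ^ b ≈± z [mod n ]
    G^b≈±z = proj₂ z-is-power
    D∤a : ¬ (D ℕ.∣ a)
    D∤a D∣a = y^s≉±1 1 ℕ.≤-refl (prime≥2 prime-d)
      (≈±-trans (inj₁ (≈-reflexive (ℤ.*-identityʳ y))) (≈±-trans (≈±-sym G^a≈±y) (^-multiple≈±1 G D (^order≈±1 G-order) D∣a)))
    by-divisibility : Dec (d ℕ.∣ D) → ∃ λ i → i ℕ.< d × z ≈± y ^ i [mod n ]
    by-divisibility (no d∤D) = ⊥-elim (D∤a (Coprime.coprime-divisor (Coprime.sym (prime∤⇒coprime prime-d d∤D))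
      (subst (D ℕ.∣_) (ℕ.*-comm a d) (order∣ad a G^a≈±y y^d≈±1))))
    by-divisibility (yes (ℕ.divides D″ D≡D″d)) = i , proj₁ (proj₂ solution) , z≈±y^i
      where
      D″∣ : ∀ c → D ℕ.∣ c ℕ.* d → D″ ℕ.∣ c
      D″∣ c D∣cd = ℕ.*-cancelʳ-∣ d (subst (ℕ._∣ c ℕ.* d) D≡D″d D∣cd)
      α : ℕ
      α = ℕ.quotient (D″∣ a (order∣ad a G^a≈±y y^d≈±1))
      a≡αD″ : a ≡ α ℕ.* D″
      a≡αD″ = ℕ._∣_.equality (D″∣ a (order∣ad a G^a≈±y y^d≈±1))
      β : ℕ
      β = ℕ.quotient (D″∣ b (order∣ad b G^b≈±z z^d≈±1))
      b≡βD″ : b ≡ β ℕ.* D″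
      b≡βD″ = ℕ._∣_.equality (D″∣ b (order∣ad b G^b≈±z z^d≈±1))
      d∤α : ¬ (d ℕ.∣ α)
      d∤α (ℕ.divides α′ α≡α′d) = D∤a (ℕ.divides α′ (begin
        a                 ≡⟨ a≡αD″ ⟩
        α ℕ.* D″          ≡⟨ cong (ℕ._* D″) α≡α′d ⟩
        α′ ℕ.* d ℕ.* D″   ≡⟨ lemma α′ d D″ ⟩
        α′ ℕ.* (D″ ℕ.* d) ≡⟨ cong (α′ ℕ.*_) D≡D″d ⟨
        α′ ℕ.* D          ∎))
        where
        open ≡-Reasoning
        lemma : ∀ x y z → x ℕ.* y ℕ.* z ≡ x ℕ.* (z ℕ.* y)
        lemma = ℕ-Solver.solve-∀
      solution : ∃ λ i → i ℕ.< d × + (α ℕ.* D″ ℕ.* i) ≈ + (β ℕ.* D″) [mod D″ ℕ.* d ]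
      solution = exponent-solution prime-d α β D″ d∤α
      i : ℕ
      i = proj₁ solution
      ia≈b : + (a ℕ.* i) ≈ + b [mod D ]
      ia≈b = subst₂ (λ u v → + (u ℕ.* i) ≈ + v [mod D ]) (sym a≡αD″) (sym b≡βD″)
        (subst (λ v → + (α ℕ.* D″ ℕ.* i) ≈ + (β ℕ.* D″) [mod v ]) (sym D≡D″d) (proj₂ (proj₂ solution)))
      z≈±y^i : z ≈± y ^ i [mod n ]
      z≈±y^i = ≈±-trans (≈±-sym G^b≈±z) (≈±-trans (^-≈±-exponent (^order≈±1 G-order) (≈-sym ia≈b)) (^-exponent-* a i G^a≈±y))

involution-unique : ∀ {n} → PrimeOrderSubgroupsUnique n → ∀ y z → y * y ≈± + 1 [mod n ] → ¬ (y ≈± + 1 [mod n ]) →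
  z * z ≈± + 1 [mod n ] → ¬ (z ≈± + 1 [mod n ]) → z ≈± y [mod n ]
involution-unique {n} unique y z y²≈±1 y≉±1 z²≈±1 z≉±1 = z≈±y^i⇒z≈±y (unique prime[2] y z (square y y²≈±1) y^s≉±1 (square z z²≈±1))
  where
  square : ∀ x → x * x ≈± + 1 [mod n ] → x ^ 2 ≈± + 1 [mod n ]
  square x = ≈±-trans (inj₁ (≈-reflexive (cong (x *_) (ℤ.*-identityʳ x))))
  y^s≉±1 : ∀ s → 1 ℕ.≤ s → s ℕ.< 2 → ¬ (y ^ s ≈± + 1 [mod n ])
  y^s≉±1 (suc zero) _ _ y^1≈±1 = y≉±1 (≈±-trans (inj₁ (≈-reflexive (sym (ℤ.*-identityʳ y)))) y^1≈±1)
  y^s≉±1 (suc (suc _)) _ (s≤s (s≤s ()))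
  z≈±y^i⇒z≈±y : (∃ λ i → i ℕ.< 2 × z ≈± y ^ i [mod n ]) → z ≈± y [mod n ]
  z≈±y^i⇒z≈±y (zero , _ , z≈±1) = ⊥-elim (z≉±1 z≈±1)
  z≈±y^i⇒z≈±y (suc zero , _ , z≈±y^1) = ≈±-trans z≈±y^1 (inj₁ (≈-reflexive (ℤ.*-identityʳ y)))
  z≈±y^i⇒z≈±y (suc (suc _) , s≤s (s≤s ()) , _)

-- Obstructions to cyclicity

1≉-1 : ∀ {M} → 3 ℕ.≤ M → ¬ (+ 1 ≈ - + 1 [mod M ])
1≉-1 3≤M (congruent M∣2) = ℕ.>⇒∤ 3≤M (∣⇒∣ᵤ M∣2)

²≈-1⇒≉±1 : ∀ {M x} → 3 ℕ.≤ M → x * x ≈ - + 1 [mod M ] → ¬ (x ≈± + 1 [mod M ])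
²≈-1⇒≉±1 3≤M x²≈-1 (inj₁ x≈1) = 1≉-1 3≤M (≈-trans (≈-sym (*-cong x≈1 x≈1)) x²≈-1)
²≈-1⇒≉±1 3≤M x²≈-1 (inj₂ x≈-1) = 1≉-1 3≤M (≈-trans (≈-sym (*-cong x≈-1 x≈-1)) x²≈-1)

-- u^s ≡ -1 would give u^(2s) ≡ 1, so ℓ ∣ 2s.
odd-prime-order⇒^≉±1 : ∀ {M ℓ u} → Prime ℓ → 3 ℕ.≤ ℓ → u HasOrder ℓ [mod M ] → ∀ s → 1 ℕ.≤ s → s ℕ.< ℓ → ¬ (u ^ s ≈± + 1 [mod M ])
odd-prime-order⇒^≉±1 prime-ℓ 3≤ℓ ord-u s 1≤s s<ℓ (inj₁ u^s≈1) = ℕ.>⇒∤ {{ℕ.>-nonZero 1≤s}} s<ℓ (order∣ ord-u s u^s≈1)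
odd-prime-order⇒^≉±1 {ℓ = ℓ} {u} prime-ℓ 3≤ℓ ord-u s 1≤s s<ℓ (inj₂ u^s≈-1) = ℓ∤s*2 (euclidsLemma s 2 prime-ℓ
  (order∣ ord-u (s ℕ.* 2) (≈-trans (≈-reflexive (^-* u s 2)) (≈-trans (^-cong 2 u^s≈-1) (≈-reflexive refl)))))
  where
  ℓ∤s*2 : ℓ ℕ.∣ s ⊎ ℓ ℕ.∣ 2 → ⊥
  ℓ∤s*2 (inj₁ ℓ∣s) = ℕ.>⇒∤ {{ℕ.>-nonZero 1≤s}} s<ℓ ℓ∣s
  ℓ∤s*2 (inj₂ ℓ∣2) = ℕ.>⇒∤ 3≤ℓ ℓ∣2

module _ {A B C : ℕ} (A⊥B : Coprime A B) (A⊥C : Coprime A C) (B⊥C : Coprime B C)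
  (unique : PrimeOrderSubgroupsUnique (A ℕ.* (B ℕ.* C))) where

  private
    n : ℕ
    n = A ℕ.* (B ℕ.* C)

    mod-A : ∀ {x y} → x ≈ y [mod n ] → x ≈ y [mod A ]
    mod-A = ≈-mod-∣ (ℕ.m∣m*n (B ℕ.* C))
    mod-B : ∀ {x y} → x ≈ y [mod n ] → x ≈ y [mod B ]
    mod-B = ≈-mod-∣ (ℕ.∣n⇒∣m*n A (ℕ.m∣m*n C))
    mod-C : ∀ {x y} → x ≈ y [mod n ] → x ≈ y [mod C ]
    mod-C = ≈-mod-∣ (ℕ.∣n⇒∣m*n A (ℕ.n∣m*n B))

    residues : ∀ a b c → ∃ λ x → x ≈ a [mod A ] × x ≈ b [mod B ] × x ≈ c [mod C ]
    residues = chinese-remainder₃ A⊥B A⊥C B⊥C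

    combine : ∀ {x y} → x ≈ y [mod A ] → x ≈ y [mod B ] → x ≈ y [mod C ] → x ≈ y [mod n ]
    combine = ≈-combine₃ A⊥B A⊥C B⊥C

    ±1²≈1 : ∀ {M x} → x ≈ + 1 [mod M ] ⊎ x ≈ - + 1 [mod M ] → x * x ≈ + 1 [mod M ]
    ±1²≈1 (inj₁ x≈1) = *-cong x≈1 x≈1
    ±1²≈1 (inj₂ x≈-1) = ≈-trans (*-cong x≈-1 x≈-1) (≈-reflexive refl)

    differ : ∀ {M x a b} → 3 ℕ.≤ M → x ≈ a [mod M ] → x ≈ b [mod M ] → a ≈ + 1 [mod M ] → b ≈ - + 1 [mod M ] → ⊥
    differ 3≤M x≈a x≈b a≈1 b≈-1 = 1≉-1 3≤M (≈-trans (≈-sym a≈1) (≈-trans (≈-sym x≈a) (≈-trans x≈b b≈-1)))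

  -- (-1, 1, 1) and (1, -1, 1) are independent involutions.
  ¬three-parts-≥3 : 3 ℕ.≤ A → 3 ℕ.≤ B → 3 ℕ.≤ C → ⊥
  ¬three-parts-≥3 3≤A 3≤B 3≤C = independent (residues (- + 1) (+ 1) (+ 1)) (residues (+ 1) (- + 1) (+ 1))
    where
    independent : (∃ λ y → y ≈ - + 1 [mod A ] × y ≈ + 1 [mod B ] × y ≈ + 1 [mod C ]) →
      (∃ λ z → z ≈ + 1 [mod A ] × z ≈ - + 1 [mod B ] × z ≈ + 1 [mod C ]) → ⊥
    independent (y , y≈-1ᴬ , y≈1ᴮ , y≈1ᶜ) (z , z≈1ᴬ , z≈-1ᴮ , z≈1ᶜ) = z≉±y (involution-unique unique y z
        (inj₁ (combine (±1²≈1 (inj₂ y≈-1ᴬ)) (±1²≈1 (inj₁ y≈1ᴮ)) (±1²≈1 (inj₁ y≈1ᶜ)))) y≉±1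
        (inj₁ (combine (±1²≈1 (inj₁ z≈1ᴬ)) (±1²≈1 (inj₂ z≈-1ᴮ)) (±1²≈1 (inj₁ z≈1ᶜ)))) z≉±1)
      where
      y≉±1 : ¬ (y ≈± + 1 [mod n ])
      y≉±1 (inj₁ y≈1) = differ 3≤A (mod-A y≈1) y≈-1ᴬ ≈-refl ≈-refl
      y≉±1 (inj₂ y≈-1) = differ 3≤B y≈1ᴮ (mod-B y≈-1) ≈-refl ≈-refl
      z≉±1 : ¬ (z ≈± + 1 [mod n ])
      z≉±1 (inj₁ z≈1) = differ 3≤B (mod-B z≈1) z≈-1ᴮ ≈-refl ≈-refl
      z≉±1 (inj₂ z≈-1) = differ 3≤A z≈1ᴬ (mod-A z≈-1) ≈-refl ≈-refl
      z≉±y : ¬ (z ≈± y [mod n ])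
      z≉±y (inj₁ z≈y) = differ 3≤A z≈1ᴬ (≈-trans (mod-A z≈y) y≈-1ᴬ) ≈-refl ≈-refl
      z≉±y (inj₂ z≈-y) = differ 3≤C z≈1ᶜ (≈-trans (mod-C z≈-y) (-‿cong y≈1ᶜ)) ≈-refl ≈-refl

  -- (1 + 2^(e+2), 1, 1) and (1, -1, 1) are independent involutions.
  ¬2^[3+e]-part : ∀ e → A ≡ 2 ℕ.^ (3 ℕ.+ e) → 3 ℕ.≤ B → ⊥
  ¬2^[3+e]-part e refl 3≤B = independent (residues (+ suc H) (+ 1) (+ 1)) (residues (+ 1) (- + 1) (+ 1))
    where
    H : ℕ
    H = 2 ℕ.^ (2 ℕ.+ e)
    4≤H : 4 ℕ.≤ H
    4≤H = ℕ.≤-trans (ℕ.*-monoʳ-≤ 4 (ℕ.m^n>0 2 e)) (ℕ.≤-reflexive (ℕ.*-assoc 2 2 (2 ℕ.^ e)))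
    H<A : ∀ {c} → c ℕ.< H → c ℕ.+ H ℕ.< A
    H<A {c} c<H = ℕ.<-≤-trans (ℕ.+-monoˡ-< H c<H) (ℕ.≤-reflexive (cong (H ℕ.+_) (sym (ℕ.+-identityʳ H))))
    3≤A : 3 ℕ.≤ A
    3≤A = ℕ.≤-trans (ℕ.≤-trans (s≤s (s≤s (s≤s z≤n))) 4≤H) (ℕ.m≤m+n H (H ℕ.+ 0))
    1+H²≈1 : + suc H * + suc H ≈ + 1 [mod A ]
    1+H²≈1 = congruent (divides (+ 1 + + 2 * two^ e) (begin
      + suc H * + suc H - + 1            ≡⟨ cong (λ h → (+ 1 + h) * (+ 1 + h) - + 1) (pos-^ 2 (2 ℕ.+ e)) ⟩
      (+ 1 + two^ (2 ℕ.+ e)) * (+ 1 + two^ (2 ℕ.+ e)) - + 1 ≡⟨ lemma (two^ e) ⟩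
      (+ 1 + + 2 * two^ e) * two^ (3 ℕ.+ e)   ≡⟨ cong ((+ 1 + + 2 * two^ e) *_) (pos-^ 2 (3 ℕ.+ e)) ⟨
      (+ 1 + + 2 * two^ e) * + A            ∎))
      where
      open ≡-Reasoning
      lemma : ∀ t → (+ 1 + + 2 * (+ 2 * t)) * (+ 1 + + 2 * (+ 2 * t)) - + 1 ≡ (+ 1 + + 2 * t) * (+ 2 * (+ 2 * (+ 2 * t)))
      lemma = solve-∀
    independent : (∃ λ y → y ≈ + suc H [mod A ] × y ≈ + 1 [mod B ] × y ≈ + 1 [mod C ]) →
      (∃ λ z → z ≈ + 1 [mod A ] × z ≈ - + 1 [mod B ] × z ≈ + 1 [mod C ]) → ⊥
    independent (y , y≈1+Hᴬ , y≈1ᴮ , y≈1ᶜ) (z , z≈1ᴬ , z≈-1ᴮ , z≈1ᶜ) = z≉±y (involution-unique unique y z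
        (inj₁ (combine (≈-trans (*-cong y≈1+Hᴬ y≈1+Hᴬ) 1+H²≈1) (±1²≈1 (inj₁ y≈1ᴮ)) (±1²≈1 (inj₁ y≈1ᶜ)))) y≉±1
        (inj₁ (combine (±1²≈1 (inj₁ z≈1ᴬ)) (±1²≈1 (inj₂ z≈-1ᴮ)) (±1²≈1 (inj₁ z≈1ᶜ)))) z≉±1)
      where
      y≉±1 : ¬ (y ≈± + 1 [mod n ])
      y≉±1 (inj₁ y≈1) = <-incongruent (s≤s (ℕ.<-trans (s≤s z≤n) 4≤H)) (H<A (ℕ.<-trans (s≤s (s≤s z≤n)) 4≤H)) (≈-trans (≈-sym y≈1+Hᴬ) (mod-A y≈1))
      y≉±1 (inj₂ y≈-1) = differ 3≤B y≈1ᴮ (mod-B y≈-1) ≈-refl ≈-refl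
      z≉±1 : ¬ (z ≈± + 1 [mod n ])
      z≉±1 (inj₁ z≈1) = differ 3≤B (mod-B z≈1) z≈-1ᴮ ≈-refl ≈-refl
      z≉±1 (inj₂ z≈-1) = differ 3≤A z≈1ᴬ (mod-A z≈-1) ≈-refl ≈-refl
      z≉±y : ¬ (z ≈± y [mod n ])
      z≉±y (inj₁ z≈y) = differ 3≤B (≈-trans (mod-B z≈y) y≈1ᴮ) z≈-1ᴮ ≈-refl ≈-refl
      z≉±y (inj₂ z≈-y) = <-incongruent (s≤s z≤n) (H<A (ℕ.<-trans (s≤s (s≤s (s≤s z≤n))) 4≤H)) 2+H≈0
        where
        lemma : ∀ h → + 1 - - (+ 1 + h) ≡ + 2 + h
        lemma = solve-∀
        2+H≈0 : + (2 ℕ.+ H) ≈ + 0 [mod A ]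
        2+H≈0 = ≈-trans (≈-reflexive (trans (ℤ.pos-+ 2 H) (sym (lemma (+ H))))) (≈⇒-≈0 (≈-trans (≈-sym z≈1ᴬ) (≈-trans (mod-A z≈-y) (-‿cong y≈1+Hᴬ))))

  -- (u₁, u₂, 1) and (u₁, u₂³, 1) both square to -1 when C ∣ 2, but are not ± each other.
  ¬square-roots-of-−1 : 3 ℕ.≤ A → 3 ℕ.≤ B → C ℕ.∣ 2 → ∀ u₁ u₂ → u₁ * u₁ ≈ - + 1 [mod A ] → u₂ * u₂ ≈ - + 1 [mod B ] → ⊥
  ¬square-roots-of-−1 3≤A 3≤B C∣2 u₁ u₂ u₁²≈-1 u₂²≈-1 = independent (residues u₁ u₂ (+ 1)) (residues u₁ u₂³ (+ 1))
    where
    u₂³ : ℤ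
    u₂³ = u₂ * (u₂ * u₂)
    u₂³²≈-1 : u₂³ * u₂³ ≈ - + 1 [mod B ]
    u₂³²≈-1 = ≈-trans (≈-reflexive (lemma u₂)) (≈-trans (*-cong u₂²≈-1 (*-cong u₂²≈-1 u₂²≈-1)) (≈-reflexive refl))
      where
      lemma : ∀ u → u * (u * u) * (u * (u * u)) ≡ (u * u) * ((u * u) * (u * u))
      lemma = solve-∀
    u₂³u₂≈1 : u₂³ * u₂ ≈ + 1 [mod B ]
    u₂³u₂≈1 = ≈-trans (≈-reflexive (lemma u₂)) (≈-trans (*-cong u₂²≈-1 u₂²≈-1) (≈-reflexive refl))
      where
      lemma : ∀ u → u * (u * u) * u ≡ (u * u) * (u * u)
      lemma = solve-∀
    1≈-1ᶜ : + 1 ≈ - + 1 [mod C ]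
    1≈-1ᶜ = ≈-mod-∣ C∣2 (congruent (divides (+ 1) refl))
    independent : (∃ λ y → y ≈ u₁ [mod A ] × y ≈ u₂ [mod B ] × y ≈ + 1 [mod C ]) →
      (∃ λ z → z ≈ u₁ [mod A ] × z ≈ u₂³ [mod B ] × z ≈ + 1 [mod C ]) → ⊥
    independent (y , y≈u₁ , y≈u₂ , y≈1ᶜ) (z , z≈u₁ , z≈u₂³ , z≈1ᶜ) = z≉±y (involution-unique unique y z
        (inj₂ (combine (≈-trans (*-cong y≈u₁ y≈u₁) u₁²≈-1) (≈-trans (*-cong y≈u₂ y≈u₂) u₂²≈-1) (≈-trans (±1²≈1 (inj₁ y≈1ᶜ)) 1≈-1ᶜ)))
        (λ y≈±1 → ²≈-1⇒≉±1 3≤A (≈-trans (*-cong y≈u₁ y≈u₁) u₁²≈-1) (≈±-mod-∣ (ℕ.m∣m*n (B ℕ.* C)) y≈±1))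
        (inj₂ (combine (≈-trans (*-cong z≈u₁ z≈u₁) u₁²≈-1) (≈-trans (*-cong z≈u₂³ z≈u₂³) u₂³²≈-1) (≈-trans (±1²≈1 (inj₁ z≈1ᶜ)) 1≈-1ᶜ)))
        (λ z≈±1 → ²≈-1⇒≉±1 3≤B (≈-trans (*-cong z≈u₂³ z≈u₂³) u₂³²≈-1) (≈±-mod-∣ (ℕ.∣n⇒∣m*n A (ℕ.m∣m*n C)) z≈±1)))
      where
      z≉±y : ¬ (z ≈± y [mod n ])
      z≉±y (inj₁ z≈y) = 1≉-1 3≤B (≈-trans (≈-sym u₂³u₂≈1) (≈-trans (*-congʳ u₂ (≈-trans (≈-sym z≈u₂³) (≈-trans (mod-B z≈y) y≈u₂))) u₂²≈-1))
      z≉±y (inj₂ z≈-y) = 1≉-1 3≤A (≈-sym (≈-trans (≈-sym u₁²≈-1) (≈-trans (*-congʳ u₁ (≈-trans (≈-sym z≈u₁) (≈-trans (mod-A z≈-y) (-‿cong y≈u₁))))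
        (≈-trans (≈-reflexive (sym (ℤ.neg-distribˡ-* u₁ u₁))) (≈-trans (-‿cong u₁²≈-1) (≈-reflexive (ℤ.neg-involutive (+ 1))))))))

  -- (u₁, 1, 1) has order ℓ in U'(n), yet (1, u₂, 1) is no ±power of it.
  ¬odd-prime-order-pair : ∀ {ℓ u₁ u₂} → Prime ℓ → 3 ℕ.≤ ℓ → u₁ HasOrder ℓ [mod A ] → u₂ HasOrder ℓ [mod B ] → ⊥
  ¬odd-prime-order-pair {ℓ} {u₁} {u₂} prime-ℓ 3≤ℓ ord-u₁ ord-u₂ = independent (residues u₁ (+ 1) (+ 1)) (residues (+ 1) u₂ (+ 1))
    where
    independent : (∃ λ y → y ≈ u₁ [mod A ] × y ≈ + 1 [mod B ] × y ≈ + 1 [mod C ]) →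
      (∃ λ z → z ≈ + 1 [mod A ] × z ≈ u₂ [mod B ] × z ≈ + 1 [mod C ]) → ⊥
    independent (y , y≈u₁ , y≈1ᴮ , y≈1ᶜ) (z , z≈1ᴬ , z≈u₂ , z≈1ᶜ) = z-not-a-power (unique prime-ℓ y z
      (inj₁ (combine (≈-trans (^-cong ℓ y≈u₁) (^order≈1 ord-u₁)) (≈1⇒^≈1 ℓ y≈1ᴮ) (≈1⇒^≈1 ℓ y≈1ᶜ)))
      (λ s 1≤s s<ℓ y^s≈±1 → odd-prime-order⇒^≉±1 prime-ℓ 3≤ℓ ord-u₁ s 1≤s s<ℓ (≈±-trans (inj₁ (^-cong s (≈-sym y≈u₁))) (≈±-mod-∣ (ℕ.m∣m*n (B ℕ.* C)) y^s≈±1)))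
      (inj₁ (combine (≈1⇒^≈1 ℓ z≈1ᴬ) (≈-trans (^-cong ℓ z≈u₂) (^order≈1 ord-u₂)) (≈1⇒^≈1 ℓ z≈1ᶜ))))
      where
      z-not-a-power : (∃ λ i → i ℕ.< ℓ × z ≈± y ^ i [mod n ]) → ⊥
      z-not-a-power (i , _ , z≈±y^i) = odd-prime-order⇒^≉±1 prime-ℓ 3≤ℓ ord-u₂ 1 ℕ.≤-refl (ℕ.<-trans (s≤s (s≤s z≤n)) 3≤ℓ)
        (≈±-trans (inj₁ (≈-reflexive (ℤ.*-identityʳ u₂))) (≈±-trans (inj₁ (≈-sym z≈u₂)) (≈±-trans (≈±-mod-∣ (ℕ.∣n⇒∣m*n A (ℕ.m∣m*n C)) z≈±y^i) (inj₁ (≈1⇒^≈1 i y≈1ᴮ)))))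

even≢2⇒4∣∨odd-prime∣ : ∀ {G} → 2 ℕ.∣ G → G ≢ 2 → 4 ℕ.∣ G ⊎ ∃ λ ℓ → Prime ℓ × 3 ℕ.≤ ℓ × ℓ ℕ.∣ G
even≢2⇒4∣∨odd-prime∣ {G} (ℕ.divides c G≡c*2) G≢2 = by-parity (ℕ-even-or-odd c)
  where
  c∣G : c ℕ.∣ G
  c∣G = ℕ.divides 2 (trans G≡c*2 (ℕ.*-comm c 2))
  lemma : ∀ h → 2 ℕ.* h ℕ.* 2 ≡ h ℕ.* 4
  lemma = ℕ-Solver.solve-∀
  odd-factor : ∀ {h} → c ≡ suc (2 ℕ.* h) → (∃ λ ℓ → Prime ℓ × ℓ ℕ.∣ c) → ∃ λ ℓ → Prime ℓ × 3 ℕ.≤ ℓ × ℓ ℕ.∣ G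
  odd-factor {h} c≡1+2h (ℓ , prime-ℓ , ℓ∣c) = ℓ , prime-ℓ , odd-prime≥3 prime-ℓ (λ { refl → ¬2∣odd h c≡1+2h ℓ∣c }) , ℕ.∣-trans ℓ∣c c∣G
  by-parity : (∃ λ h → c ≡ 2 ℕ.* h ⊎ c ≡ suc (2 ℕ.* h)) → 4 ℕ.∣ G ⊎ ∃ λ ℓ → Prime ℓ × 3 ℕ.≤ ℓ × ℓ ℕ.∣ G
  by-parity (h , inj₁ c≡2h) = inj₁ (ℕ.divides h (trans G≡c*2 (trans (cong (ℕ._* 2) c≡2h) (lemma h))))
  by-parity (zero , inj₂ c≡1) = ⊥-elim (G≢2 (trans G≡c*2 (cong (ℕ._* 2) c≡1)))
  by-parity (suc h , inj₂ c≡3+2h) = inj₂ (odd-factor {suc h} c≡3+2h (prime-factor c (subst (2 ℕ.≤_) (sym c≡3+2h) (s≤s (s≤s z≤n)))))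

3≤p^k : ∀ {p} → 3 ℕ.≤ p → ∀ k → 1 ℕ.≤ k → 3 ℕ.≤ p ℕ.^ k
3≤p^k {p} 3≤p (suc k) _ = ℕ.≤-trans 3≤p (ℕ.m≤m*n p (p ℕ.^ k) {{ℕ.m^n≢0 p k {{ℕ.>-nonZero (ℕ.<-trans (s≤s z≤n) 3≤p)}}}})

2^j∣2 : ∀ j → j ℕ.≤ 1 → 2 ℕ.^ j ℕ.∣ 2
2^j∣2 zero _ = ℕ.1∣ 2
2^j∣2 (suc zero) _ = ℕ.∣-refl
2^j∣2 (suc (suc _)) (s≤s ())

order-4c⇒^c-square≈-1 : ∀ {p k g c} → Prime p → 3 ℕ.≤ p → 0 ℕ.< c ℕ.* 4 → g HasOrder c ℕ.* 4 [mod p ℕ.^ k ] → g ^ c * g ^ c ≈ - + 1 [mod p ℕ.^ k ]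
order-4c⇒^c-square≈-1 {p} {k} {g} {c} prime-p 3≤p 0<4c ord-g =
  ≈-trans (≈-reflexive (trans (sym (ℤ.^-distribˡ-+-* g c c)) (cong (λ e → g ^ (c ℕ.+ e)) (sym (ℕ.+-identityʳ c)))))
    (half-order-power≈-1 {k = k} {ψ = c ℕ.+ (c ℕ.+ 0)} prime-p 3≤p (*-positive⇒positive 0<4c (lemma c)) (subst (g HasOrder_[mod p ℕ.^ k ]) (lemma′ c) ord-g))
  where
  lemma : ∀ c → c ℕ.* 4 ≡ (c ℕ.+ (c ℕ.+ 0)) ℕ.* 2
  lemma = ℕ-Solver.solve-∀
  lemma′ : ∀ c → c ℕ.* 4 ≡ 2 ℕ.* (c ℕ.+ (c ℕ.+ 0))
  lemma′ = ℕ-Solver.solve-∀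

module _ (j : ℕ) {q r : ℕ} (k t : ℕ) (prime-q : Prime q) (q≢2 : q ≢ 2) (prime-r : Prime r) (r≢2 : r ≢ 2) (q≢r : q ≢ r)
  (1≤k : 1 ℕ.≤ k) (1≤t : 1 ℕ.≤ t) (j≤1 : j ℕ.≤ 1) (unique : PrimeOrderSubgroupsUnique (q ℕ.^ k ℕ.* (r ℕ.^ t ℕ.* 2 ℕ.^ j))) where

  private
    Q⊥R : Coprime (q ℕ.^ k) (r ℕ.^ t)
    Q⊥R = prime-powers-coprime prime-q prime-r q≢r k t
    Q⊥2^j : Coprime (q ℕ.^ k) (2 ℕ.^ j)
    Q⊥2^j = prime-powers-coprime prime-q prime[2] q≢2 k j
    R⊥2^j : Coprime (r ℕ.^ t) (2 ℕ.^ j)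
    R⊥2^j = prime-powers-coprime prime-r prime[2] r≢2 t j
    ρ₁ : PrimitiveRoot q k
    ρ₁ = primitive-root-mod-odd-prime-power prime-q (odd-prime≥3 prime-q q≢2) k 1≤k
    ρ₂ : PrimitiveRoot r t
    ρ₂ = primitive-root-mod-odd-prime-power prime-r (odd-prime≥3 prime-r r≢2) t 1≤t
    G : ℕ
    G = gcd (φ q k) (φ r t)

    ¬4∣G : ¬ (4 ℕ.∣ G)
    ¬4∣G 4∣G with ℕ.divides c₁ φ₁≡ ← ℕ.∣-trans 4∣G (gcd[m,n]∣m (φ q k) (φ r t)) | ℕ.divides c₂ φ₂≡ ← ℕ.∣-trans 4∣G (gcd[m,n]∣n (φ q k) (φ r t)) =
      ¬square-roots-of-−1 Q⊥R Q⊥2^j R⊥2^j unique (3≤p^k (odd-prime≥3 prime-q q≢2) k 1≤k) (3≤p^k (odd-prime≥3 prime-r r≢2) t 1≤t) (2^j∣2 j j≤1)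
        (root ρ₁ ^ c₁) (root ρ₂ ^ c₂)
        (order-4c⇒^c-square≈-1 {k = k} {c = c₁} prime-q (odd-prime≥3 prime-q q≢2) (subst (0 ℕ.<_) φ₁≡ (1≤φ prime-q k)) (subst (root ρ₁ HasOrder_[mod q ℕ.^ k ]) φ₁≡ (root-order ρ₁)))
        (order-4c⇒^c-square≈-1 {k = t} {c = c₂} prime-r (odd-prime≥3 prime-r r≢2) (subst (0 ℕ.<_) φ₂≡ (1≤φ prime-r t)) (subst (root ρ₂ HasOrder_[mod r ℕ.^ t ]) φ₂≡ (root-order ρ₂)))

    ¬odd-prime∣G : ¬ (∃ λ ℓ → Prime ℓ × 3 ℕ.≤ ℓ × ℓ ℕ.∣ G)
    ¬odd-prime∣G (ℓ , prime-ℓ , 3≤ℓ , ℓ∣G)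
      with ℕ.divides c₁ φ₁≡ ← ℕ.∣-trans ℓ∣G (gcd[m,n]∣m (φ q k) (φ r t)) | ℕ.divides c₂ φ₂≡ ← ℕ.∣-trans ℓ∣G (gcd[m,n]∣n (φ q k) (φ r t)) =
      ¬odd-prime-order-pair Q⊥R Q⊥2^j R⊥2^j unique prime-ℓ 3≤ℓ
        (^-has-order c₁ ℓ {{ℕ.>-nonZero (*-positive⇒positive (1≤φ prime-q k) φ₁≡)}} (subst (root ρ₁ HasOrder_[mod q ℕ.^ k ]) φ₁≡ (root-order ρ₁)))
        (^-has-order c₂ ℓ {{ℕ.>-nonZero (*-positive⇒positive (1≤φ prime-r t) φ₂≡)}} (subst (root ρ₂ HasOrder_[mod r ℕ.^ t ]) φ₂≡ (root-order ρ₂)))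

  -- gcd(φ(q^k), φ(r^t)) is even; a factor 4 or an odd prime ℓ in it would give two independent subgroups of order 2 or ℓ.
  gcd-φ≡2 : gcd (φ q k) (φ r t) ≡ 2
  gcd-φ≡2 with G ℕ.≟ 2
  ... | yes G≡2 = G≡2
  ... | no G≢2 with even≢2⇒4∣∨odd-prime∣ (gcd-greatest (2∣φ prime-q q≢2 k) (2∣φ prime-r r≢2 t)) G≢2
  ...   | inj₁ 4∣G = ⊥-elim (¬4∣G 4∣G)
  ...   | inj₂ odd-prime∣G = ⊥-elim (¬odd-prime∣G odd-prime∣G)

-- Classification

odd≢1⇒3≤ : ∀ {m} → ¬ (2 ℕ.∣ m) → m ≢ 1 → 3 ℕ.≤ m
odd≢1⇒3≤ {zero} m-odd _ = ⊥-elim (m-odd (ℕ.divides 0 refl))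
odd≢1⇒3≤ {suc zero} _ m≢1 = ⊥-elim (m≢1 refl)
odd≢1⇒3≤ {suc (suc zero)} m-odd _ = ⊥-elim (m-odd ℕ.∣-refl)
odd≢1⇒3≤ {suc (suc (suc m))} _ _ = s≤s (s≤s (s≤s z≤n))

∣odd⇒≢2 : ∀ {q m} → q ℕ.∣ m → ¬ (2 ℕ.∣ m) → q ≢ 2
∣odd⇒≢2 q∣m m-odd refl = m-odd q∣m

module _ (n : ℕ) (3≤n : 3 ℕ.≤ n) (unique : PrimeOrderSubgroupsUnique n) where

  private
    unique-at : ∀ {m} → n ≡ m → PrimeOrderSubgroupsUnique m
    unique-at refl = unique

    ¬three-parts : ∀ a {q r} k t m″ → Prime q → q ≢ 2 → Prime r → r ≢ 2 → q ≢ r → 1 ℕ.≤ k → 1 ℕ.≤ t →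
      ¬ (q ℕ.∣ m″) → ¬ (r ℕ.∣ m″) → n ≡ 2 ℕ.^ a ℕ.* (q ℕ.^ k ℕ.* (r ℕ.^ t ℕ.* m″)) → 3 ℕ.≤ 2 ℕ.^ a ℕ.* m″ → ⊥
    ¬three-parts a {q} {r} k t m″ prime-q q≢2 prime-r r≢2 q≢r 1≤k 1≤t q∤m″ r∤m″ n≡ 3≤C = ¬three-parts-≥3
      (prime-powers-coprime prime-q prime-r q≢r k t)
      (coprime-*ʳ (prime-powers-coprime prime-q prime[2] q≢2 k a) (coprime-^ˡ (prime∤⇒coprime prime-q q∤m″) k))
      (coprime-*ʳ (prime-powers-coprime prime-r prime[2] r≢2 t a) (coprime-^ˡ (prime∤⇒coprime prime-r r∤m″) t))
      (unique-at (trans n≡ (lemma (2 ℕ.^ a) (q ℕ.^ k) (r ℕ.^ t) m″)))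
      (3≤p^k (odd-prime≥3 prime-q q≢2) k 1≤k) (3≤p^k (odd-prime≥3 prime-r r≢2) t 1≤t) 3≤C
      where
      lemma : ∀ A Q R m → A ℕ.* (Q ℕ.* (R ℕ.* m)) ≡ Q ℕ.* (R ℕ.* (A ℕ.* m))
      lemma = ℕ-Solver.solve-∀

    two-odd-prime-powers : ∀ a {q r} k t → Prime q → q ≢ 2 → Prime r → r ≢ 2 → q ≢ r → 1 ℕ.≤ k → 1 ℕ.≤ t → a ℕ.≤ 1 →
      n ≡ 2 ℕ.^ a ℕ.* (q ℕ.^ k ℕ.* (r ℕ.^ t ℕ.* 1)) → Form2 n
    two-odd-prime-powers a {q} {r} k t prime-q q≢2 prime-r r≢2 q≢r 1≤k 1≤t a≤1 n≡ =
      a , q , k , r , t , prime-q , q≢2 , prime-r , r≢2 , 1≤k , 1≤t , a≤1 , trans n≡ (lemma (2 ℕ.^ a) (q ℕ.^ k) (r ℕ.^ t)) ,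
      gcd-φ≡2 a k t prime-q q≢2 prime-r r≢2 q≢r 1≤k 1≤t a≤1 (unique-at (trans n≡ (lemma′ (2 ℕ.^ a) (q ℕ.^ k) (r ℕ.^ t))))
      where
      lemma : ∀ A Q R → A ℕ.* (Q ℕ.* (R ℕ.* 1)) ≡ A ℕ.* Q ℕ.* R
      lemma = ℕ-Solver.solve-∀
      lemma′ : ∀ A Q R → A ℕ.* (Q ℕ.* (R ℕ.* 1)) ≡ Q ℕ.* (R ℕ.* A)
      lemma′ = ℕ-Solver.solve-∀

    three-factors : ∀ a {q r} k t m″ → Prime q → q ≢ 2 → Prime r → r ≢ 2 → q ≢ r → 1 ℕ.≤ k → 1 ℕ.≤ t →
      ¬ (q ℕ.∣ m″) → ¬ (r ℕ.∣ m″) → ¬ (2 ℕ.∣ m″) → n ≡ 2 ℕ.^ a ℕ.* (q ℕ.^ k ℕ.* (r ℕ.^ t ℕ.* m″)) → Form1 n ⊎ Form2 n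
    three-factors a k t m″ prime-q q≢2 prime-r r≢2 q≢r 1≤k 1≤t q∤m″ r∤m″ m″-odd n≡ with m″ ℕ.≟ 1 | a ℕ.≤? 1
    ... | yes refl | yes a≤1 = inj₂ (two-odd-prime-powers a k t prime-q q≢2 prime-r r≢2 q≢r 1≤k 1≤t a≤1 n≡)
    ... | yes refl | no a≰1 = ⊥-elim (¬three-parts a k t 1 prime-q q≢2 prime-r r≢2 q≢r 1≤k 1≤t q∤m″ r∤m″ n≡
      (ℕ.≤-trans (ℕ.n≤1+n 3) (ℕ.≤-trans (ℕ.^-monoʳ-≤ 2 (ℕ.≰⇒> a≰1)) (ℕ.≤-reflexive (sym (ℕ.*-identityʳ (2 ℕ.^ a)))))))
    ... | no m″≢1 | _ = ⊥-elim (¬three-parts a k t m″ prime-q q≢2 prime-r r≢2 q≢r 1≤k 1≤t q∤m″ r∤m″ n≡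
      (ℕ.≤-trans (odd≢1⇒3≤ m″-odd m″≢1) (ℕ.m≤n*m m″ (2 ℕ.^ a) {{ℕ.m^n≢0 2 a}})))

    two-factors : ∀ a {q} k m′ → Prime q → q ≢ 2 → 1 ℕ.≤ k → ¬ (q ℕ.∣ m′) → ¬ (2 ℕ.∣ m′) →
      n ≡ 2 ℕ.^ a ℕ.* (q ℕ.^ k ℕ.* m′) → Form1 n ⊎ Form2 n
    two-factors a {q} k m′ prime-q q≢2 1≤k q∤m′ m′-odd n≡ with m′ ℕ.≟ 1 | a ℕ.≤? 2
    ... | yes refl | yes a≤2 = inj₁ (a , q , k , prime-q , 1≤k , a≤2 , trans n≡ (cong (2 ℕ.^ a ℕ.*_) (ℕ.*-identityʳ (q ℕ.^ k))))
    ... | yes refl | no a≰2 = ⊥-elim (¬2^[3+e]-part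
      (prime-powers-coprime prime[2] prime-q (q≢2 ∘ sym) a k) (λ (_ , i∣1) → ℕ.∣1⇒≡1 i∣1) (λ (_ , i∣1) → ℕ.∣1⇒≡1 i∣1)
      (unique-at n≡) (a ℕ.∸ 3) (cong (2 ℕ.^_) (sym (ℕ.m+[n∸m]≡n (ℕ.≰⇒> a≰2)))) (3≤p^k (odd-prime≥3 prime-q q≢2) k 1≤k))
    ... | no m′≢1 | _ = by-prime-power (prime-power-factor m′ (ℕ.≤-trans (s≤s (s≤s z≤n)) (odd≢1⇒3≤ m′-odd m′≢1)))
      where
      by-prime-power : (∃ λ r → ∃ λ t → ∃ λ m″ → Prime r × m′ ≡ r ℕ.^ suc t ℕ.* m″ × ¬ (r ℕ.∣ m″)) → Form1 n ⊎ Form2 n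
      by-prime-power (r , t , m″ , prime-r , m′≡ , r∤m″) = three-factors a k (suc t) m″ prime-q q≢2 prime-r (∣odd⇒≢2 r∣m′ m′-odd)
        (λ { refl → q∤m′ r∣m′ }) 1≤k (s≤s z≤n) (q∤m′ ∘ (λ q∣m″ → ℕ.∣-trans q∣m″ m″∣m′)) r∤m″ (m′-odd ∘ λ 2∣m″ → ℕ.∣-trans 2∣m″ m″∣m′)
        (trans n≡ (cong (λ x → 2 ℕ.^ a ℕ.* (q ℕ.^ k ℕ.* x)) m′≡))
        where
        r∣m′ : r ℕ.∣ m′
        r∣m′ = ℕ.∣-trans (p∣p^k r (suc t) (s≤s z≤n)) (ℕ.divides m″ (trans m′≡ (ℕ.*-comm _ m″)))
        m″∣m′ : m″ ℕ.∣ m′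
        m″∣m′ = ℕ.divides (r ℕ.^ suc t) m′≡

    power-of-2 : ∀ a → n ≡ 2 ℕ.^ a ℕ.* 1 → Form1 n
    power-of-2 zero refl = ⊥-elim (ℕ.<⇒≱ 3≤n (s≤s z≤n))
    power-of-2 a@(suc _) n≡ = 0 , 2 , a , prime[2] , s≤s z≤n , z≤n , trans n≡ (trans (ℕ.*-identityʳ (2 ℕ.^ a)) (sym (ℕ.*-identityˡ (2 ℕ.^ a))))

    odd-part : ∀ a m → ¬ (2 ℕ.∣ m) → m ≢ 1 → n ≡ 2 ℕ.^ a ℕ.* m → Form1 n ⊎ Form2 n
    odd-part a m m-odd m≢1 n≡ = by-prime-power (prime-power-factor m (ℕ.≤-trans (s≤s (s≤s z≤n)) (odd≢1⇒3≤ m-odd m≢1)))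
      where
      by-prime-power : (∃ λ q → ∃ λ k → ∃ λ m′ → Prime q × m ≡ q ℕ.^ suc k ℕ.* m′ × ¬ (q ℕ.∣ m′)) → Form1 n ⊎ Form2 n
      by-prime-power (q , k , m′ , prime-q , m≡ , q∤m′) = two-factors a (suc k) m′ prime-q
        (∣odd⇒≢2 (ℕ.∣-trans (p∣p^k q (suc k) (s≤s z≤n)) (ℕ.divides m′ (trans m≡ (ℕ.*-comm _ m′)))) m-odd)
        (s≤s z≤n) q∤m′ (m-odd ∘ λ 2∣m′ → ℕ.∣-trans 2∣m′ (ℕ.divides (q ℕ.^ suc k) m≡)) (trans n≡ (cong (2 ℕ.^ a ℕ.*_) m≡))

  prime-order-subgroups-unique⇒Form : Form1 n ⊎ Form2 n
  prime-order-subgroups-unique⇒Form with a , m , n≡ , m-odd ← split-prime-power prime[2] n (ℕ.<-≤-trans (s≤s z≤n) 3≤n) | m ℕ.≟ 1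
  ... | yes refl = inj₁ (power-of-2 a n≡)
  ... | no m≢1 = odd-part a m m-odd m≢1 n≡

mainTheorem8 : (n : ℕ) → 3 ≤ n →
    (U'-cyclic n → Form1 n ⊎ Form2 n) × (Form1 n ⊎ Form2 n → U'-cyclic n)
mainTheorem8 n 3≤n = cyclic⇒Form , Form⇒U'-cyclic n 3≤n
  where
  instance
    n≢0 : NonZero n
    n≢0 = ℕ.>-nonZero (ℕ.<-≤-trans (s≤s z≤n) 3≤n)
  cyclic⇒Form : U'-cyclic n → Form1 n ⊎ Form2 n
  cyclic⇒Form (g , g∈U , generates) = prime-order-subgroups-unique⇒Form n 3≤n (U'-cyclic⇒prime-order-subgroups-unique n g g∈U generates)
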